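{- Let $m\le n$ be positive integers and fix $0\le k\le n-1$. Then \[ |\mathrm{PF}_{m,n}(k)|=\sum_{i=1}^n\left[X(i)+Y(i)+\sum_{x=0}^{m-1}\left(Z(i,x)+\sum_{R=1}^{n-i-1}V(i,x,R)+\sum_{R=k+1}^{i-2}W(i,x,R)\right)\right], \] where $X(i)=\binom{m-1}{n-i}|\mathrm{PF}_{m-1-n+i,\,i-1}(k)|\,|\mathrm{C}_{n-i,n-i}(k,n-1)|\,\min(k,n-i)$, $Y(i)=\binom{m-1}{i-1}|\mathrm{PF}_{i-1,i-1}(k)|\,|\mathrm{C}_{m-i,n-i}(k,n-1)|\,(i-1)$, $Z(i,x)=\binom{m-1}{x}|\mathrm{PF}_{x,i-1}(k)|\,|\mathrm{C}_{m-1-x,n-i}(k,n-1)|$, $V(i,x,R)=\binom{m-1}{x}|\mathrm{PF}_{x,i-1}(k)|\binom{m-1-x}{R}|\mathrm{C}_{R,R}(k,n-1)|\,|\mathrm{C}_{m-1-x-R,\,n-R-i-1}(k,n-1)|\,\min(R,k)$, and $W(i,x,R)=\binom{m-1}{x}|\mathrm{PF}_{x,i-R-2}(k)|\binom{m-1-x}{R}|\mathrm{C}_{R,R}(k,n-1)|\,|\mathrm{C}_{m-1-x-R,\,n-i}(k,n-1)|\,(R-k)$.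
   Context: $k$-Naples rule for $a$ cars on a street with spots $1,\dots,b$: with preferences $\alpha\in[b]^a$, cars enter in order; a car with preference $p$ parks in spot $p$ if empty; otherwise it checks spots $p-1,\dots,p-k$ in order (stopping at the start of the street) and parks in the first empty one; if none, it parks in the first empty spot after $p$ (up to spot $b$), if any; otherwise it fails. $\mathrm{PF}_{a,b}(k)$ is the set of $\alpha$ under which all cars park. The $(k,\ell)$-pullback rule is the same except that, after failing to back up, the car only checks spots $p+1,\dots,p+\ell$. $\mathrm{C}_{a,b}(k,\ell)$ is the set of $(k,\ell)$-pullback $(a,b)$-parking functions $\alpha\in[b]^a$ such that, when an extra empty spot $0$ is placed before spot $1$ and the cars park by the same rule on spots $0,1,\dots,b$, all cars park in spots $1,\dots,b$ and no car backs into spot $0$. Conventions: $|\mathrm{PF}_{a,b}(k)|=|\mathrm{C}_{a,b}(k,\ell)|=0$ if $a>b$; binomial coefficients $\binom{p}{q}$ are $0$ when $q>p$ or $q<0$; empty sums are $0$; the empty preference list (zero cars) counts as one parking function. -}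

module Defs where

open import Data.Nat using (ℕ; zero; suc; _+_; _*_; _∸_; _⊓_; _≤ᵇ_; _<ᵇ_; _≡ᵇ_)
open import Data.Bool using (Bool; true; false; if_then_else_; _∧_; not)
open import Data.Maybe using (Maybe; just; nothing)
open import Data.List using (List; []; _∷_; map; concatMap; upTo)
open import Data.Bool.ListAction using (any)
open import Data.Nat.ListAction using (sum)

free : List ℕ → ℕ → Bool
free occ q = not (any (λ s → s ≡ᵇ q) occ)

backScan : List ℕ → ℕ → ℕ → ℕ → Maybe ℕ
backScan occ lo p zero    = nothing
backScan occ lo p (suc j) =
  if p ≤ᵇ lo then nothing
  else (if free occ (p ∸ 1) then just (p ∸ 1) else backScan occ lo (p ∸ 1) j)

fwdScan : List ℕ → ℕ → ℕ → ℕ → Maybe ℕ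
fwdScan occ hi q zero    = nothing
fwdScan occ hi q (suc f) =
  if hi <ᵇ q then nothing
  else (if free occ q then just q else fwdScan occ hi (suc q) f)

parkCar : ℕ → ℕ → ℕ → ℕ → List ℕ → ℕ → Maybe ℕ
parkCar lo hi k ℓ occ p with free occ p
... | true  = just p
... | false with backScan occ lo p k
...   | just q  = just q
...   | nothing = fwdScan occ hi (suc p) ℓ

runPark : ℕ → ℕ → ℕ → ℕ → List ℕ → List ℕ → Maybe (List ℕ)
runPark lo hi k ℓ occ []       = just occ
runPark lo hi k ℓ occ (p ∷ ps) with parkCar lo hi k ℓ occ p
... | nothing = nothing
... | just q  = runPark lo hi k ℓ (q ∷ occ) ps

isPullbackPF : ℕ → ℕ → ℕ → List ℕ → Bool
isPullbackPF b k ℓ α with runPark 1 b k ℓ [] α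
... | nothing = false
... | just _  = true

-- k-Naples rule on spots 1..b: forward scan up to spot b is unlimited,
-- i.e. the (k,b)-pullback rule (spot p+b > b always, since p ≥ 1)
isNaplesPF : ℕ → ℕ → List ℕ → Bool
isNaplesPF b k α = isPullbackPF b k b α

isC : ℕ → ℕ → ℕ → List ℕ → Bool
isC b k ℓ α with runPark 0 b k ℓ [] α
... | nothing  = false
... | just occ = isPullbackPF b k ℓ α ∧ free occ 0

allPrefs : ℕ → ℕ → List (List ℕ)
allPrefs zero    b = [] ∷ []
allPrefs (suc a) b = concatMap (λ p → map (p ∷_) (allPrefs a b)) (map suc (upTo b))

count : {A : Set} → (A → Bool) → List A → ℕ
count P []       = 0
count P (x ∷ xs) = if P x then suc (count P xs) else count P xs

numPF : ℕ → ℕ → ℕ → ℕ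
numPF a b k = count (isNaplesPF b k) (allPrefs a b)

numC : ℕ → ℕ → ℕ → ℕ → ℕ
numC a b k ℓ = count (isC b k ℓ) (allPrefs a b)

-- ∑_{i=lo}^{hi} f i  (empty when hi < lo)
sumFromTo : ℕ → ℕ → (ℕ → ℕ) → ℕ
sumFromTo lo hi f = sum (map (λ t → f (lo + t)) (upTo (suc hi ∸ lo)))

-- Write a preference list of length m as α followed by the preference j of the last car. The list
-- parks iff α parks and the last car then ends in some spot i, so numPF m n k is a sum over i of the
-- number of pairs (α, j) that fill i last. Fix i = c + 1 and d = n − i. For i to be filled last it must
-- be empty after α; then no car of α prefers i and none crosses it, so α parks exactly when its x
-- entries below i park on the street 1..c and its other entries, shifted down by i, park on the street
-- 0..d without anybody backing into the new spot 0 (the C-condition). Choosing which x of the m − 1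
-- cars go left gives the factor C(m − 1, x). The last car ends in i iff j = i (term Z), or j < i and it
-- finds no room on the left, or j > i and it backs into spot 0 of the right street. On the left this
-- happens for c preferences if 1..c is full, which by pigeonhole forces x = c (term Y), and otherwise
-- for (c − e − 1) − k preferences, where e + 1 is the last empty spot; splitting the left run again at
-- e + 1 gives term W with R = c − e − 1. On the right it happens for min(d, k) preferences if 1..d is
-- full (term X), and otherwise for min(e, k), where e + 1 is the first empty spot; splitting the right
-- run again at e + 1 gives term V with R = e.

module Submission where

open import Defs
open import Data.Nat using (ℕ; _+_; _*_; _∸_; _⊓_; _≤_; _<_)
open import Data.Nat.Combinatorics using (_C_)
open import Relation.Binary.PropositionalEquality using (_≡_)
open import Data.Nat using (zero; suc; _≤ᵇ_; _<ᵇ_; _≡ᵇ_; z≤n; s≤s; z<s; s<s; NonZero; _!)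
open import Data.Nat.Properties
open import Data.Nat.Combinatorics
  using (nCk+nC[k+1]≡[n+1]C[k+1]; k>n⇒nCk≡0; nCk≡nC[n∸k]; nCk≡n!/k![n-k]!; k![n∸k]!∣n!)
open import Data.Nat.DivMod using (m/n*n≡m)
open import Data.Nat.ListAction using (sum)
open import Data.Nat.ListAction.Properties using (sum-++)
open import Data.Bool using (Bool; true; false; if_then_else_; _∧_; _∨_; not; T)
open import Data.Bool.Properties using (∧-assoc; ∧-identityʳ; ∧-zeroʳ; ∧-conicalˡ; ∧-conicalʳ; ∨-conicalˡ; ∨-conicalʳ)
open import Data.Maybe using (Maybe; just; nothing; is-just; is-nothing; _<∣>_; zipWith)
import Data.Maybe as Maybe
open import Data.Maybe.Properties using (just-injective)
open import Data.Maybe.Relation.Binary.Pointwise using (Pointwise; just; nothing)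
open import Data.List using (List; []; _∷_; map; concatMap; upTo; applyUpTo; _++_; length)
open import Data.List.Properties using (map-++)
open import Data.List.Relation.Unary.All using (All; []; _∷_)
open import Data.Product using (_×_; _,_; proj₁; proj₂)
open import Data.Sum using (_⊎_; inj₁; inj₂)
open import Data.Empty using (⊥-elim)
open import Function using (_∘_; case_of_)
open import Relation.Nullary using (¬_; Dec; yes; no)
open import Relation.Binary.Definitions using (tri<; tri≈; tri>)
open import Relation.Binary.PropositionalEquality
  using (refl; sym; trans; cong; cong₂; subst; subst₂; _≢_; module ≡-Reasoning)
open import Algebra.Properties.CommutativeSemigroup +-commutativeSemigroup using () renaming (interchange to +-interchange)
open import Data.Nat.Solver using (module +-*-Solver)
open +-*-Solver using (solve; _:+_; _:*_; _:=_; con)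

T⇒≡true : ∀ {b} → T b → b ≡ true
T⇒≡true {true} _ = refl

≡true⇒T : ∀ {b} → b ≡ true → T b
≡true⇒T refl = _

¬T⇒≡false : ∀ {b} → ¬ T b → b ≡ false
¬T⇒≡false {true}  ¬b = ⊥-elim (¬b _)
¬T⇒≡false {false} _  = refl

≡false⇒¬T : ∀ {b} → b ≡ false → ¬ T b
≡false⇒¬T refl ()

true≢false : true ≢ false
true≢false ()

≡ᵇ-refl : ∀ n → (n ≡ᵇ n) ≡ true
≡ᵇ-refl n = T⇒≡true (≡⇒≡ᵇ n n refl)

≢⇒≡ᵇ≡false : ∀ {m n} → m ≢ n → (m ≡ᵇ n) ≡ false
≢⇒≡ᵇ≡false {m} {n} m≢n = ¬T⇒≡false (m≢n ∘ ≡ᵇ⇒≡ m n)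

≡ᵇ≡true⇒≡ : ∀ m n → (m ≡ᵇ n) ≡ true → m ≡ n
≡ᵇ≡true⇒≡ m n = ≡ᵇ⇒≡ m n ∘ ≡true⇒T

<⇒<ᵇ≡true : ∀ {m n} → m < n → (m <ᵇ n) ≡ true
<⇒<ᵇ≡true = T⇒≡true ∘ <⇒<ᵇ

≥⇒<ᵇ≡false : ∀ {m n} → n ≤ m → (m <ᵇ n) ≡ false
≥⇒<ᵇ≡false {m} {n} n≤m = ¬T⇒≡false (≤⇒≯ n≤m ∘ <ᵇ⇒< m n)

<ᵇ≡true⇒< : ∀ m n → (m <ᵇ n) ≡ true → m < n
<ᵇ≡true⇒< m n = <ᵇ⇒< m n ∘ ≡true⇒T

<ᵇ≡false⇒≥ : ∀ m n → (m <ᵇ n) ≡ false → n ≤ m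
<ᵇ≡false⇒≥ m n m≮ᵇn = ≮⇒≥ (≡false⇒¬T m≮ᵇn ∘ <⇒<ᵇ)

≤⇒≤ᵇ≡true : ∀ {m n} → m ≤ n → (m ≤ᵇ n) ≡ true
≤⇒≤ᵇ≡true = T⇒≡true ∘ ≤⇒≤ᵇ

>⇒≤ᵇ≡false : ∀ {m n} → n < m → (m ≤ᵇ n) ≡ false
>⇒≤ᵇ≡false {m} {n} n<m = ¬T⇒≡false (<⇒≱ n<m ∘ ≤ᵇ⇒≤ m n)

≤ᵇ≡true⇒≤ : ∀ m n → (m ≤ᵇ n) ≡ true → m ≤ n
≤ᵇ≡true⇒≤ m n = ≤ᵇ⇒≤ m n ∘ ≡true⇒T

+-cancelˡ-≡ᵇ : ∀ d a b → (d + a ≡ᵇ d + b) ≡ (a ≡ᵇ b)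
+-cancelˡ-≡ᵇ zero    a b = refl
+-cancelˡ-≡ᵇ (suc d) a b = +-cancelˡ-≡ᵇ d a b

+-cancelˡ-<ᵇ : ∀ d a b → (d + a <ᵇ d + b) ≡ (a <ᵇ b)
+-cancelˡ-<ᵇ zero    a b = refl
+-cancelˡ-<ᵇ (suc d) a b = +-cancelˡ-<ᵇ d a b

∑< : ℕ → (ℕ → ℕ) → ℕ
∑< zero    f = 0
∑< (suc n) f = f 0 + ∑< n (λ t → f (suc t))

syntax ∑< n (λ t → e) = ∑[ t < n ] e

∑<-cong : ∀ n {f g : ℕ → ℕ} → (∀ t → t < n → f t ≡ g t) → ∑< n f ≡ ∑< n g
∑<-cong zero    f≗g = refl
∑<-cong (suc n) f≗g = cong₂ _+_ (f≗g 0 z<s) (∑<-cong n (λ t t<n → f≗g (suc t) (s<s t<n)))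

∑<-0 : ∀ n (f : ℕ → ℕ) → (∀ t → t < n → f t ≡ 0) → ∑< n f ≡ 0
∑<-0 zero    f f≗0 = refl
∑<-0 (suc n) f f≗0 = cong₂ _+_ (f≗0 0 z<s) (∑<-0 n _ (λ t t<n → f≗0 (suc t) (s<s t<n)))

∑<-const : ∀ n c → ∑[ _ < n ] c ≡ n * c
∑<-const zero    c = refl
∑<-const (suc n) c = cong (c +_) (∑<-const n c)

∑<-applyUpTo : ∀ n (f g : ℕ → ℕ) → sum (map f (applyUpTo g n)) ≡ ∑[ t < n ] f (g t)
∑<-applyUpTo zero    f g = refl
∑<-applyUpTo (suc n) f g = cong (f (g 0) +_) (∑<-applyUpTo n f (g ∘ suc))

sumFromTo≡∑< : ∀ lo hi f → sumFromTo lo hi f ≡ ∑[ t < suc hi ∸ lo ] f (lo + t)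
sumFromTo≡∑< lo hi f = ∑<-applyUpTo (suc hi ∸ lo) (λ t → f (lo + t)) (λ t → t)

∑<-distrib-+ : ∀ n (f g : ℕ → ℕ) → ∑[ t < n ] (f t + g t) ≡ ∑< n f + ∑< n g
∑<-distrib-+ zero    f g = refl
∑<-distrib-+ (suc n) f g = begin
  (f 0 + g 0) + ∑[ t < n ] (f (suc t) + g (suc t))
    ≡⟨ cong ((f 0 + g 0) +_) (∑<-distrib-+ n (f ∘ suc) (g ∘ suc)) ⟩
  (f 0 + g 0) + (∑< n (f ∘ suc) + ∑< n (g ∘ suc))
    ≡⟨ +-interchange (f 0) (g 0) _ _ ⟩
  (f 0 + ∑< n (f ∘ suc)) + (g 0 + ∑< n (g ∘ suc)) ∎
  where open ≡-Reasoning

*-distribˡ-∑< : ∀ n c (f : ℕ → ℕ) → ∑[ t < n ] (c * f t) ≡ c * ∑< n f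
*-distribˡ-∑< zero    c f = sym (*-zeroʳ c)
*-distribˡ-∑< (suc n) c f =
  trans (cong (c * f 0 +_) (*-distribˡ-∑< n c (f ∘ suc))) (sym (*-distribˡ-+ c (f 0) _))

*-distribʳ-∑< : ∀ n c (f : ℕ → ℕ) → ∑[ t < n ] (f t * c) ≡ ∑< n f * c
*-distribʳ-∑< n c f =
  trans (∑<-cong n (λ t _ → *-comm (f t) c)) (trans (*-distribˡ-∑< n c f) (*-comm c _))

∑<-split : ∀ a b (f : ℕ → ℕ) → ∑< (a + b) f ≡ ∑< a f + ∑[ t < b ] f (a + t)
∑<-split zero    b f = refl
∑<-split (suc a) b f = trans (cong (f 0 +_) (∑<-split a b (f ∘ suc))) (sym (+-assoc (f 0) _ _))

∑<-last : ∀ n (f : ℕ → ℕ) → ∑< (suc n) f ≡ ∑< n f + f n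
∑<-last n f = begin
  ∑< (suc n) f           ≡⟨ cong (λ m → ∑< m f) (+-comm 1 n) ⟩
  ∑< (n + 1) f           ≡⟨ ∑<-split n 1 f ⟩
  ∑< n f + (f (n + 0) + 0) ≡⟨ cong (λ m → ∑< n f + (f m + 0)) (+-identityʳ n) ⟩
  ∑< n f + (f n + 0)     ≡⟨ cong (∑< n f +_) (+-identityʳ (f n)) ⟩
  ∑< n f + f n           ∎
  where open ≡-Reasoning

∑<-comm : ∀ n m (f : ℕ → ℕ → ℕ) → ∑[ a < n ] ∑[ b < m ] f a b ≡ ∑[ b < m ] ∑[ a < n ] f a b
∑<-comm zero    m f = sym (∑<-0 m _ (λ _ _ → refl))
∑<-comm (suc n) m f = trans (cong (∑< m (f 0) +_) (∑<-comm n m (f ∘ suc)))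
                            (sym (∑<-distrib-+ m (f 0) (λ b → ∑[ a < n ] f (suc a) b)))

∑<-∑<-*ˡ : ∀ c n (w : ℕ → ℕ) (f : ℕ → ℕ → ℕ) → ∑[ t < c ] ∑[ x < n ] (w x * f t x) ≡ ∑[ x < n ] (w x * ∑[ t < c ] f t x)
∑<-∑<-*ˡ c n w f = trans (∑<-comm c n (λ t x → w x * f t x)) (∑<-cong n (λ x _ → *-distribˡ-∑< c (w x) (λ t → f t x)))

∑<-select : ∀ n (f : ℕ → ℕ) s → s < n → (∀ t → t < n → t ≢ s → f t ≡ 0) → ∑< n f ≡ f s
∑<-select (suc n) f zero    s<n f≗0 =
  trans (cong (f 0 +_) (∑<-0 n _ (λ t t<n → f≗0 (suc t) (s<s t<n) (λ ())))) (+-identityʳ _)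
∑<-select (suc n) f (suc s) (s≤s s<n) f≗0 =
  trans (cong (_+ ∑< n (f ∘ suc)) (f≗0 0 z<s (λ ())))
        (∑<-select n (f ∘ suc) s s<n (λ t t<n t≢s → f≗0 (suc t) (s<s t<n) (t≢s ∘ suc-injective)))

∑<-extend : ∀ n n′ (f : ℕ → ℕ) → n ≤ n′ → (∀ t → n ≤ t → t < n′ → f t ≡ 0) → ∑< n f ≡ ∑< n′ f
∑<-extend n n′ f n≤n′ tail≗0 = begin
  ∑< n f                                  ≡⟨ +-identityʳ _ ⟨
  ∑< n f + 0                              ≡⟨ cong (∑< n f +_) (∑<-0 (n′ ∸ n) _ tail≗0′) ⟨
  ∑< n f + ∑[ t < n′ ∸ n ] f (n + t)      ≡⟨ ∑<-split n (n′ ∸ n) f ⟨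
  ∑< (n + (n′ ∸ n)) f                     ≡⟨ cong (λ m → ∑< m f) (m+[n∸m]≡n n≤n′) ⟩
  ∑< n′ f                                 ∎
  where
  open ≡-Reasoning
  tail≗0′ : ∀ t → t < n′ ∸ n → f (n + t) ≡ 0
  tail≗0′ t t<n′∸n = tail≗0 (n + t) (m≤m+n n t)
    (subst (n + t <_) (m+[n∸m]≡n n≤n′) (+-monoʳ-< n t<n′∸n))

∑<-reverse : ∀ n (f : ℕ → ℕ) → ∑< n f ≡ ∑[ t < n ] f (n ∸ suc t)
∑<-reverse zero    f = refl
∑<-reverse (suc n) f = begin
  f 0 + ∑< n (f ∘ suc)                         ≡⟨ cong (f 0 +_) (∑<-reverse n (f ∘ suc)) ⟩
  f 0 + ∑[ t < n ] f (suc (n ∸ suc t))         ≡⟨ +-comm (f 0) _ ⟩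
  ∑[ t < n ] f (suc (n ∸ suc t)) + f 0
    ≡⟨ cong₂ _+_ (∑<-cong n (λ t t<n → cong f (sym (+-∸-assoc 1 t<n)))) (cong f (sym (n∸n≡0 n))) ⟩
  ∑[ t < n ] f (suc n ∸ suc t) + f (n ∸ n)      ≡⟨ ∑<-last n (λ t → f (suc n ∸ suc t)) ⟨
  ∑[ t < suc n ] f (suc n ∸ suc t)             ∎
  where open ≡-Reasoning

∑<-drop : ∀ n a (f : ℕ → ℕ) → (∀ t → t < a → f t ≡ 0) → ∑< n f ≡ ∑[ t < n ∸ a ] f (a + t)
∑<-drop n a f head≗0 with a ≤? n
... | yes a≤n = begin
  ∑< n f                               ≡⟨ cong (λ m → ∑< m f) (m+[n∸m]≡n a≤n) ⟨
  ∑< (a + (n ∸ a)) f                   ≡⟨ ∑<-split a (n ∸ a) f ⟩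
  ∑< a f + ∑[ t < n ∸ a ] f (a + t)    ≡⟨ cong (_+ ∑[ t < n ∸ a ] f (a + t)) (∑<-0 a f head≗0) ⟩
  ∑[ t < n ∸ a ] f (a + t)             ∎
  where open ≡-Reasoning
... | no a≰n rewrite m≤n⇒m∸n≡0 (<⇒≤ (≰⇒> a≰n)) =
  ∑<-0 n f (λ t t<n → head≗0 t (<-≤-trans t<n (<⇒≤ (≰⇒> a≰n))))

𝟙 : Bool → ℕ
𝟙 true  = 1
𝟙 false = 0

nCk*[k!*[n∸k]!]≡n! : ∀ {n k} → k ≤ n → (n C k) * (k ! * (n ∸ k) !) ≡ n !
nCk*[k!*[n∸k]!]≡n! {n} {k} k≤n =
  trans (cong (_* (k ! * (n ∸ k) !)) (nCk≡n!/k![n-k]! k≤n)) (m/n*n≡m (k![n∸k]!∣n! k≤n))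
  where instance _ = k !* (n ∸ k) !≢0

nC[x+r]*[x+r]Cx≡nCx*[n∸x]Cr : ∀ n x r → x + r ≤ n →
  (n C (x + r)) * ((x + r) C x) ≡ (n C x) * ((n ∸ x) C r)
nC[x+r]*[x+r]Cx≡nCx*[n∸x]Cr n x r x+r≤n =
  *-cancelʳ-≡ _ _ (x ! * r ! * (n ∸ x ∸ r) !) {{denominator≢0}} (trans lhs≡n! (sym rhs≡n!))
  where
  denominator≢0 : NonZero (x ! * r ! * (n ∸ x ∸ r) !)
  denominator≢0 = m*n≢0 (x ! * r !) ((n ∸ x ∸ r) !) {{x !* r !≢0}} {{(n ∸ x ∸ r) !≢0}}
  r≤n∸x : r ≤ n ∸ x
  r≤n∸x = subst (_≤ n ∸ x) (m+n∸m≡n x r) (∸-monoˡ-≤ x x+r≤n)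
  lhs≡n! : (n C (x + r)) * ((x + r) C x) * (x ! * r ! * (n ∸ x ∸ r) !) ≡ n !
  lhs≡n! = begin
    (n C (x + r)) * ((x + r) C x) * (x ! * r ! * (n ∸ x ∸ r) !)
      ≡⟨ reassoc (n C (x + r)) ((x + r) C x) (x !) (r !) ((n ∸ x ∸ r) !) ⟩
    (n C (x + r)) * (((x + r) C x) * (x ! * r !) * (n ∸ x ∸ r) !)
      ≡⟨ cong₂ (λ a b → (n C (x + r)) * (((x + r) C x) * (x ! * a !) * b !))
               (sym (m+n∸m≡n x r)) (∸-+-assoc n x r) ⟩
    (n C (x + r)) * (((x + r) C x) * (x ! * ((x + r) ∸ x) !) * (n ∸ (x + r)) !)
      ≡⟨ cong (λ a → (n C (x + r)) * (a * (n ∸ (x + r)) !)) (nCk*[k!*[n∸k]!]≡n! (m≤m+n x r)) ⟩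
    (n C (x + r)) * ((x + r) ! * (n ∸ (x + r)) !)
      ≡⟨ nCk*[k!*[n∸k]!]≡n! x+r≤n ⟩
    n ! ∎
    where
    open ≡-Reasoning
    reassoc : ∀ p q u v w → p * q * (u * v * w) ≡ p * (q * (u * v) * w)
    reassoc = solve 5 (λ p q u v w → p :* q :* (u :* v :* w) := p :* (q :* (u :* v) :* w)) refl
  rhs≡n! : (n C x) * ((n ∸ x) C r) * (x ! * r ! * (n ∸ x ∸ r) !) ≡ n !
  rhs≡n! = begin
    (n C x) * ((n ∸ x) C r) * (x ! * r ! * (n ∸ x ∸ r) !)
      ≡⟨ reassoc (n C x) ((n ∸ x) C r) (x !) (r !) ((n ∸ x ∸ r) !) ⟩
    (n C x) * (x ! * (((n ∸ x) C r) * (r ! * (n ∸ x ∸ r) !)))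
      ≡⟨ cong (λ a → (n C x) * (x ! * a)) (nCk*[k!*[n∸k]!]≡n! r≤n∸x) ⟩
    (n C x) * (x ! * (n ∸ x) !)
      ≡⟨ nCk*[k!*[n∸k]!]≡n! (≤-trans (m≤m+n x r) x+r≤n) ⟩
    n ! ∎
    where
    open ≡-Reasoning
    reassoc : ∀ p q u v w → p * q * (u * v * w) ≡ p * (u * (q * (v * w)))
    reassoc = solve 5 (λ p q u v w → p :* q :* (u :* v :* w) := p :* (u :* (q :* (v :* w)))) refl

∑Prefs : ℕ → ℕ → (List ℕ → ℕ) → ℕ
∑Prefs a b w = sum (map w (allPrefs a b))

InRange : ℕ → ℕ → List ℕ → Set
InRange lo hi = All (λ p → lo ≤ p × p ≤ hi)

count≡sum-𝟙 : ∀ {A : Set} (P : A → Bool) xs → count P xs ≡ sum (map (𝟙 ∘ P) xs)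
count≡sum-𝟙 P []       = refl
count≡sum-𝟙 P (x ∷ xs) with P x
... | true  = cong suc (count≡sum-𝟙 P xs)
... | false = count≡sum-𝟙 P xs

sum-map-concatMap : ∀ {A B : Set} (w : B → ℕ) (g : A → List B) xs →
  sum (map w (concatMap g xs)) ≡ sum (map (λ x → sum (map w (g x))) xs)
sum-map-concatMap w g []       = refl
sum-map-concatMap w g (x ∷ xs) = begin
  sum (map w (g x ++ concatMap g xs))             ≡⟨ cong sum (map-++ w (g x) (concatMap g xs)) ⟩
  sum (map w (g x) ++ map w (concatMap g xs))     ≡⟨ sum-++ (map w (g x)) _ ⟩
  sum (map w (g x)) + sum (map w (concatMap g xs)) ≡⟨ cong (sum (map w (g x)) +_) (sum-map-concatMap w g xs) ⟩
  sum (map w (g x)) + sum (map (λ x → sum (map w (g x))) xs) ∎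
  where open ≡-Reasoning

sum-map-map : ∀ {A B : Set} (w : B → ℕ) (g : A → B) xs → sum (map w (map g xs)) ≡ sum (map (w ∘ g) xs)
sum-map-map w g []       = refl
sum-map-map w g (x ∷ xs) = cong (w (g x) +_) (sum-map-map w g xs)

∑Prefs-[] : ∀ b w → ∑Prefs 0 b w ≡ w []
∑Prefs-[] b w = +-identityʳ (w [])

∑Prefs-∷ : ∀ a b w → ∑Prefs (suc a) b w ≡ ∑[ t < b ] ∑Prefs a b (λ α → w (suc t ∷ α))
∑Prefs-∷ a b w = begin
  sum (map w (concatMap (λ p → map (p ∷_) (allPrefs a b)) (map suc (upTo b))))
    ≡⟨ sum-map-concatMap w (λ p → map (p ∷_) (allPrefs a b)) (map suc (upTo b)) ⟩
  sum (map (λ p → sum (map w (map (p ∷_) (allPrefs a b)))) (map suc (upTo b)))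
    ≡⟨ sum-map-map (λ p → sum (map w (map (p ∷_) (allPrefs a b)))) suc (upTo b) ⟩
  sum (map (λ t → sum (map w (map (suc t ∷_) (allPrefs a b)))) (upTo b))
    ≡⟨ ∑<-applyUpTo b _ (λ t → t) ⟩
  ∑[ t < b ] sum (map w (map (suc t ∷_) (allPrefs a b)))
    ≡⟨ ∑<-cong b (λ t _ → sum-map-map w (suc t ∷_) (allPrefs a b)) ⟩
  ∑[ t < b ] ∑Prefs a b (λ α → w (suc t ∷ α)) ∎
  where open ≡-Reasoning

∑Prefs-cong : ∀ a b (f g : List ℕ → ℕ) →
  (∀ α → InRange 1 b α → length α ≡ a → f α ≡ g α) → ∑Prefs a b f ≡ ∑Prefs a b g
∑Prefs-cong zero    b f g f≗g = cong (_+ 0) (f≗g [] [] refl)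
∑Prefs-cong (suc a) b f g f≗g = begin
  ∑Prefs (suc a) b f                             ≡⟨ ∑Prefs-∷ a b f ⟩
  ∑[ t < b ] ∑Prefs a b (λ α → f (suc t ∷ α))
    ≡⟨ ∑<-cong b (λ t t<b → ∑Prefs-cong a b _ _ (λ α α∈ |α| →
         f≗g (suc t ∷ α) ((s≤s z≤n , t<b) ∷ α∈) (cong suc |α|))) ⟩
  ∑[ t < b ] ∑Prefs a b (λ α → g (suc t ∷ α))    ≡⟨ ∑Prefs-∷ a b g ⟨
  ∑Prefs (suc a) b g                             ∎
  where open ≡-Reasoning

∑Prefs-0 : ∀ a b → ∑Prefs a b (λ _ → 0) ≡ 0
∑Prefs-0 zero    b = refl
∑Prefs-0 (suc a) b = trans (∑Prefs-∷ a b (λ _ → 0)) (∑<-0 b _ (λ _ _ → ∑Prefs-0 a b))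

∑Prefs-distrib-+ : ∀ a b (f g : List ℕ → ℕ) → ∑Prefs a b (λ α → f α + g α) ≡ ∑Prefs a b f + ∑Prefs a b g
∑Prefs-distrib-+ a b f g = go (allPrefs a b)
  where
  go : ∀ αs → sum (map (λ α → f α + g α) αs) ≡ sum (map f αs) + sum (map g αs)
  go []       = refl
  go (α ∷ αs) = trans (cong ((f α + g α) +_) (go αs)) (+-interchange (f α) (g α) _ _)

*-distribˡ-∑Prefs : ∀ a b c (f : List ℕ → ℕ) → ∑Prefs a b (λ α → c * f α) ≡ c * ∑Prefs a b f
*-distribˡ-∑Prefs a b c f = go (allPrefs a b)
  where
  go : ∀ αs → sum (map (λ α → c * f α) αs) ≡ c * sum (map f αs)
  go []       = sym (*-zeroʳ c)
  go (α ∷ αs) = trans (cong (c * f α +_) (go αs)) (sym (*-distribˡ-+ c (f α) _))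

∑Prefs-∑< : ∀ a b n (f : ℕ → List ℕ → ℕ) → ∑Prefs a b (λ α → ∑[ i < n ] f i α) ≡ ∑[ i < n ] ∑Prefs a b (f i)
∑Prefs-∑< a b n f = go (allPrefs a b)
  where
  go : ∀ αs → sum (map (λ α → ∑[ i < n ] f i α) αs) ≡ ∑[ i < n ] sum (map (f i) αs)
  go []       = sym (∑<-0 n _ (λ _ _ → refl))
  go (α ∷ αs) = trans (cong (∑[ i < n ] f i α +_) (go αs)) (sym (∑<-distrib-+ n (λ i → f i α) _))

∑Prefs-snoc : ∀ a b w → ∑Prefs (suc a) b w ≡ ∑Prefs a b (λ α → ∑[ t < b ] w (α ++ suc t ∷ []))
∑Prefs-snoc zero    b w = begin
  ∑Prefs 1 b w                                ≡⟨ ∑Prefs-∷ 0 b w ⟩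
  ∑[ t < b ] ∑Prefs 0 b (λ α → w (suc t ∷ α)) ≡⟨ ∑<-cong b (λ t _ → ∑Prefs-[] b (λ α → w (suc t ∷ α))) ⟩
  ∑[ t < b ] w (suc t ∷ [])                    ≡⟨ ∑Prefs-[] b (λ α → ∑[ t < b ] w (α ++ suc t ∷ [])) ⟨
  ∑Prefs 0 b (λ α → ∑[ t < b ] w (α ++ suc t ∷ [])) ∎
  where open ≡-Reasoning
∑Prefs-snoc (suc a) b w = begin
  ∑Prefs (suc (suc a)) b w                        ≡⟨ ∑Prefs-∷ (suc a) b w ⟩
  ∑[ p < b ] ∑Prefs (suc a) b (λ α → w (suc p ∷ α))
    ≡⟨ ∑<-cong b (λ p _ → ∑Prefs-snoc a b (λ α → w (suc p ∷ α))) ⟩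
  ∑[ p < b ] ∑Prefs a b (λ α → ∑[ t < b ] w (suc p ∷ α ++ suc t ∷ []))
    ≡⟨ ∑Prefs-∷ a b (λ α → ∑[ t < b ] w (α ++ suc t ∷ [])) ⟨
  ∑Prefs (suc a) b (λ α → ∑[ t < b ] w (α ++ suc t ∷ [])) ∎
  where open ≡-Reasoning

-- Shuffling the cars left and right of a spot

leftPrefs : ℕ → List ℕ → List ℕ
leftPrefs c []      = []
leftPrefs c (p ∷ α) = if p ≤ᵇ c then p ∷ leftPrefs c α else leftPrefs c α

rightPrefs : ℕ → List ℕ → List ℕ
rightPrefs c []      = []
rightPrefs c (p ∷ α) = if suc c <ᵇ p then (p ∸ suc c) ∷ rightPrefs c α else rightPrefs c α

prefers : ℕ → List ℕ → Bool
prefers s []      = false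
prefers s (p ∷ α) = (p ≡ᵇ s) ∨ prefers s α

_⊗[_]_ : (List ℕ → ℕ) → ℕ → (List ℕ → ℕ) → List ℕ → ℕ
(G ⊗[ c ] H) α = if prefers (suc c) α then 0 else G (leftPrefs c α) * H (rightPrefs c α)

pascal-convolution : ∀ a (A B : ℕ → ℕ) →
  ∑[ x < suc (suc a) ] ((suc a C x) * (A x * B (suc a ∸ x)))
  ≡ ∑[ x < suc a ] ((a C x) * (A (suc x) * B (a ∸ x))) + ∑[ x < suc a ] ((a C x) * (A x * B (suc (a ∸ x))))
pascal-convolution a A B = begin
    1 * Term 0 + ∑[ x < suc a ] ((suc a C suc x) * Term (suc x))
  ≡⟨ cong (1 * Term 0 +_) (∑<-cong (suc a) (λ x _ → cong (_* Term (suc x)) (sym (nCk+nC[k+1]≡[n+1]C[k+1] a x)))) ⟩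
    1 * Term 0 + ∑[ x < suc a ] (((a C x) + (a C suc x)) * Term (suc x))
  ≡⟨ cong (1 * Term 0 +_) (∑<-cong (suc a) (λ x _ → *-distribʳ-+ (Term (suc x)) (a C x) (a C suc x))) ⟩
    1 * Term 0 + ∑[ x < suc a ] ((a C x) * Term (suc x) + U (suc x))
  ≡⟨ cong (1 * Term 0 +_) (∑<-distrib-+ (suc a) (λ x → (a C x) * Term (suc x)) (U ∘ suc)) ⟩
    1 * Term 0 + (R₁ + ∑< (suc a) (U ∘ suc))
  ≡⟨ solve 3 (λ t r u → t :+ (r :+ u) := r :+ (t :+ u)) refl (1 * Term 0) R₁ _ ⟩
    R₁ + ∑< (suc (suc a)) U
  ≡⟨ cong (R₁ +_) (∑<-last (suc a) U) ⟩
    R₁ + (∑< (suc a) U + (a C suc a) * Term (suc a))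
  ≡⟨ cong (λ z → R₁ + (∑< (suc a) U + z * Term (suc a))) (k>n⇒nCk≡0 (n<1+n a)) ⟩
    R₁ + (∑< (suc a) U + 0)
  ≡⟨ cong (R₁ +_) (trans (+-identityʳ _) (∑<-cong (suc a) (λ x x≤a →
       cong (λ z → (a C x) * (A x * B z)) (+-∸-assoc 1 (≤-pred x≤a))))) ⟩
    R₁ + ∑[ x < suc a ] ((a C x) * (A x * B (suc (a ∸ x))))
  ∎
  where
  open ≡-Reasoning
  Term U : ℕ → ℕ
  Term x = A x * B (suc a ∸ x)
  U x = (a C x) * Term x
  R₁ = ∑[ x < suc a ] ((a C x) * (A (suc x) * B (a ∸ x)))

∑Prefs-⊗ : ∀ a c d (G H : List ℕ → ℕ) →
  ∑Prefs a (c + suc d) (G ⊗[ c ] H) ≡ ∑[ x < suc a ] ((a C x) * (∑Prefs x c G * ∑Prefs (a ∸ x) d H))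
∑Prefs-⊗ zero c d G H =
  trans (+-identityʳ _) (sym (trans (+-identityʳ _) (trans (*-identityˡ _)
    (cong₂ _*_ (+-identityʳ (G [])) (+-identityʳ (H []))))))
∑Prefs-⊗ (suc a) c d G H = begin
    ∑Prefs (suc a) (c + suc d) (G ⊗[ c ] H)
  ≡⟨ ∑Prefs-∷ a (c + suc d) (G ⊗[ c ] H) ⟩
    ∑< (c + suc d) first
  ≡⟨ ∑<-split c (suc d) first ⟩
    ∑< c first + (first (c + 0) + ∑[ t < d ] first (c + suc t))
  ≡⟨ cong₂ (λ u v → u + (v + ∑[ t < d ] first (c + suc t))) left middle ⟩
    A₁ + (0 + ∑[ t < d ] first (c + suc t))
  ≡⟨ cong (A₁ +_) right ⟩
    A₁ + A₂
  ≡⟨ pascal-convolution a (λ x → ∑Prefs x c G) (λ y → ∑Prefs y d H) ⟨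
    ∑[ x < suc (suc a) ] ((suc a C x) * (∑Prefs x c G * ∑Prefs (suc a ∸ x) d H))
  ∎
  where
  open ≡-Reasoning
  first : ℕ → ℕ
  first t = ∑Prefs a (c + suc d) (λ α → (G ⊗[ c ] H) (suc t ∷ α))
  A₁ = ∑[ x < suc a ] ((a C x) * (∑Prefs (suc x) c G * ∑Prefs (a ∸ x) d H))
  A₂ = ∑[ x < suc a ] ((a C x) * (∑Prefs x c G * ∑Prefs (suc (a ∸ x)) d H))

  middle : first (c + 0) ≡ 0
  middle = trans (∑Prefs-cong a (c + suc d) _ (λ _ → 0) (λ α _ _ → prefers-gap α)) (∑Prefs-0 a (c + suc d))
    where
    prefers-gap : ∀ α → (G ⊗[ c ] H) (suc (c + 0) ∷ α) ≡ 0
    prefers-gap α rewrite +-identityʳ c | ≡ᵇ-refl c = refl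

  left : ∑< c first ≡ A₁
  left = begin
    ∑< c first
      ≡⟨ ∑<-cong c (λ t t<c → trans (∑Prefs-cong a (c + suc d) _ _ (λ α _ _ → goes-left t t<c α))
                                     (∑Prefs-⊗ a c d (λ β → G (suc t ∷ β)) H)) ⟩
    ∑[ t < c ] ∑[ x < suc a ] ((a C x) * (∑Prefs x c (λ β → G (suc t ∷ β)) * ∑Prefs (a ∸ x) d H))
      ≡⟨ ∑<-∑<-*ˡ c (suc a) (a C_) (λ t x → ∑Prefs x c (λ β → G (suc t ∷ β)) * ∑Prefs (a ∸ x) d H) ⟩
    ∑[ x < suc a ] ((a C x) * ∑[ t < c ] (∑Prefs x c (λ β → G (suc t ∷ β)) * ∑Prefs (a ∸ x) d H))
      ≡⟨ ∑<-cong (suc a) (λ x _ → cong ((a C x) *_) (trans (*-distribʳ-∑< c (∑Prefs (a ∸ x) d H) _)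
                                                           (cong (_* ∑Prefs (a ∸ x) d H) (sym (∑Prefs-∷ x c G))))) ⟩
    A₁ ∎
    where
    goes-left : ∀ t → t < c → ∀ α → (G ⊗[ c ] H) (suc t ∷ α) ≡ ((λ β → G (suc t ∷ β)) ⊗[ c ] H) α
    goes-left t t<c α
      rewrite ≢⇒≡ᵇ≡false (<⇒≢ (s<s t<c)) | ≤⇒≤ᵇ≡true t<c | ≥⇒<ᵇ≡false {c} {t} (<⇒≤ t<c) = refl

  right : 0 + ∑[ t < d ] first (c + suc t) ≡ A₂
  right = begin
    ∑[ t < d ] first (c + suc t)
      ≡⟨ ∑<-cong d (λ t _ → trans (∑Prefs-cong a (c + suc d) _ _ (λ α _ _ → goes-right t α))
                                   (∑Prefs-⊗ a c d G (λ γ → H (suc t ∷ γ)))) ⟩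
    ∑[ t < d ] ∑[ x < suc a ] ((a C x) * (∑Prefs x c G * ∑Prefs (a ∸ x) d (λ γ → H (suc t ∷ γ))))
      ≡⟨ ∑<-∑<-*ˡ d (suc a) (a C_) (λ t x → ∑Prefs x c G * ∑Prefs (a ∸ x) d (λ γ → H (suc t ∷ γ))) ⟩
    ∑[ x < suc a ] ((a C x) * ∑[ t < d ] (∑Prefs x c G * ∑Prefs (a ∸ x) d (λ γ → H (suc t ∷ γ))))
      ≡⟨ ∑<-cong (suc a) (λ x _ → cong ((a C x) *_) (trans (*-distribˡ-∑< d (∑Prefs x c G) _)
                                                           (cong (∑Prefs x c G *_) (sym (∑Prefs-∷ (a ∸ x) d H))))) ⟩
    A₂ ∎
    where
    goes-right : ∀ t α → (G ⊗[ c ] H) (suc (c + suc t) ∷ α) ≡ (G ⊗[ c ] (λ γ → H (suc t ∷ γ))) α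
    goes-right t α
      rewrite ≢⇒≡ᵇ≡false (>⇒≢ (s<s (m<m+n c (z<s {t}))))
            | >⇒≤ᵇ≡false {suc (c + suc t)} {c} (s<s (m≤m+n c (suc t)))
            | <⇒<ᵇ≡true (m<m+n c (z<s {t}))
            | m+n∸m≡n c (suc t) = refl

free-∷ : ∀ x O q → free (x ∷ O) q ≡ (if x ≡ᵇ q then false else free O q)
free-∷ x O q with x ≡ᵇ q
... | true  = refl
... | false = refl

free-∷-self : ∀ q O → free (q ∷ O) q ≡ false
free-∷-self q O = trans (free-∷ q O q) (cong (λ b → if b then false else free O q) (≡ᵇ-refl q))

free-∷-other : ∀ x O q → x ≢ q → free (x ∷ O) q ≡ free O q
free-∷-other x O q x≢q = trans (free-∷ x O q) (cong (λ b → if b then false else free O q) (≢⇒≡ᵇ≡false x≢q))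

taken-∷ : ∀ x O q → free O q ≡ false → free (x ∷ O) q ≡ false
taken-∷ x O q taken with x ≡ᵇ q | free-∷ x O q
... | true  | eq = eq
... | false | eq = trans eq taken

free-++ : ∀ A B q → free (A ++ B) q ≡ free A q ∧ free B q
free-++ []      B q = refl
free-++ (x ∷ A) B q with x ≡ᵇ q | free-∷ x (A ++ B) q | free-∷ x A q
... | true  | eq | eqA = trans eq (sym (cong (_∧ free B q) eqA))
... | false | eq | eqA = trans eq (trans (free-++ A B q) (sym (cong (_∧ free B q) eqA)))

record _≈_ (O O′ : List ℕ) : Set where
  constructor mk≈
  field free≡ : ∀ q → free O q ≡ free O′ q
open _≈_

≈-trans : ∀ {A B C} → A ≈ B → B ≈ C → A ≈ C
≈-trans A≈B B≈C = mk≈ (λ q → trans (free≡ A≈B q) (free≡ B≈C q))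

≈-∷ : ∀ x {O O′} → O ≈ O′ → (x ∷ O) ≈ (x ∷ O′)
≈-∷ x {O} {O′} O≈O′ = mk≈ (λ q → begin
  free (x ∷ O) q                        ≡⟨ free-∷ x O q ⟩
  (if x ≡ᵇ q then false else free O q)  ≡⟨ cong (λ b → if x ≡ᵇ q then false else b) (free≡ O≈O′ q) ⟩
  (if x ≡ᵇ q then false else free O′ q) ≡⟨ free-∷ x O′ q ⟨
  free (x ∷ O′) q                       ∎)
  where open ≡-Reasoning

∷-++-≈ : ∀ q A B → (q ∷ (A ++ B)) ≈ (A ++ (q ∷ B))
∷-++-≈ q A B = mk≈ (λ x → begin
  free (q ∷ (A ++ B)) x                          ≡⟨ free-∷ q (A ++ B) x ⟩
  (if q ≡ᵇ x then false else free (A ++ B) x)    ≡⟨ cong (λ z → if q ≡ᵇ x then false else z) (free-++ A B x) ⟩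
  (if q ≡ᵇ x then false else free A x ∧ free B x) ≡⟨ if-∧ (q ≡ᵇ x) (free A x) (free B x) ⟩
  free A x ∧ (if q ≡ᵇ x then false else free B x) ≡⟨ cong (free A x ∧_) (free-∷ q B x) ⟨
  free A x ∧ free (q ∷ B) x                      ≡⟨ free-++ A (q ∷ B) x ⟨
  free (A ++ (q ∷ B)) x                          ∎)
  where
  open ≡-Reasoning
  if-∧ : ∀ b a c → (if b then false else a ∧ c) ≡ a ∧ (if b then false else c)
  if-∧ true  true  c = refl
  if-∧ true  false c = refl
  if-∧ false a     c = refl

AgreeOn : ℕ → ℕ → List ℕ → List ℕ → Set
AgreeOn lo hi O O′ = ∀ q → lo ≤ q → q ≤ hi → free O q ≡ free O′ q

parkOutcome : ℕ → Bool → Maybe ℕ → Maybe ℕ → Maybe ℕ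
parkOutcome p true  back     fwd = just p
parkOutcome p false (just q) fwd = just q
parkOutcome p false nothing  fwd = fwd

parkCar≡parkOutcome : ∀ lo hi k ℓ O p →
  parkCar lo hi k ℓ O p ≡ parkOutcome p (free O p) (backScan O lo p k) (fwdScan O hi (suc p) ℓ)
parkCar≡parkOutcome lo hi k ℓ O p with free O p
... | true  = refl
... | false with backScan O lo p k
...   | just q  = refl
...   | nothing = refl

data ParkedBy (p q : ℕ) (isFree : Bool) (back fwd : Maybe ℕ) : Set where
  parked-at-pref : isFree ≡ true → q ≡ p → ParkedBy p q isFree back fwd
  parked-behind  : isFree ≡ false → back ≡ just q → ParkedBy p q isFree back fwd
  parked-ahead   : isFree ≡ false → back ≡ nothing → fwd ≡ just q → ParkedBy p q isFree back fwd

parkOutcome-cases : ∀ p q b back fwd → parkOutcome p b back fwd ≡ just q → ParkedBy p q b back fwd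
parkOutcome-cases p q true  back     fwd eq = parked-at-pref refl (sym (just-injective eq))
parkOutcome-cases p q false (just x) fwd eq = parked-behind refl eq
parkOutcome-cases p q false nothing  fwd eq = parked-ahead refl refl eq

parkCar-cases : ∀ lo hi k ℓ O p q → parkCar lo hi k ℓ O p ≡ just q →
  ParkedBy p q (free O p) (backScan O lo p k) (fwdScan O hi (suc p) ℓ)
parkCar-cases lo hi k ℓ O p q parks =
  parkOutcome-cases p q _ _ _ (trans (sym (parkCar≡parkOutcome lo hi k ℓ O p)) parks)

backScan-result : ∀ O lo p j q → backScan O lo p j ≡ just q →
  lo ≤ q × q < p × free O q ≡ true × (∀ r → q < r → r < p → free O r ≡ false)
backScan-result O lo zero    (suc j) q ()
backScan-result O lo (suc p) (suc j) q found with p <ᵇ lo in p<ᵇlo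
... | false with free O p in free-p
...   | true with just-injective found
...     | refl = <ᵇ≡false⇒≥ p lo p<ᵇlo , ≤-refl , free-p , (λ r q<r r≤q → ⊥-elim (<-irrefl refl (<-≤-trans q<r (≤-pred r≤q))))
backScan-result O lo (suc p) (suc j) q found | false | false with backScan-result O lo p j q found
... | lo≤q , q<p , free-q , between = lo≤q , ≤-trans q<p (n≤1+n p) , free-q , between′
  where
  between′ : ∀ r → q < r → r < suc p → free O r ≡ false
  between′ r q<r r≤p with r ≟ p
  ... | yes refl = free-p
  ... | no r≢p   = between r q<r (≤∧≢⇒< (≤-pred r≤p) r≢p)

fwdScan-result : ∀ O hi q₀ f q → fwdScan O hi q₀ f ≡ just q →
  q₀ ≤ q × q ≤ hi × free O q ≡ true × (∀ r → q₀ ≤ r → r < q → free O r ≡ false)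
fwdScan-result O hi q₀ (suc f) q found with hi <ᵇ q₀ in hi<ᵇq₀
... | false with free O q₀ in free-q₀
...   | true with just-injective found
...     | refl = ≤-refl , <ᵇ≡false⇒≥ hi q₀ hi<ᵇq₀ , free-q₀ , (λ r q≤r r<q → ⊥-elim (<-irrefl refl (≤-<-trans q≤r r<q)))
fwdScan-result O hi q₀ (suc f) q found | false | false with fwdScan-result O hi (suc q₀) f q found
... | q₀<q , q≤hi , free-q , between = <⇒≤ q₀<q , q≤hi , free-q , between′
  where
  between′ : ∀ r → q₀ ≤ r → r < q → free O r ≡ false
  between′ r q₀≤r r<q with r ≟ q₀
  ... | yes refl = free-q₀
  ... | no r≢q₀  = between r (≤∧≢⇒< q₀≤r (r≢q₀ ∘ sym)) r<q

parkCar-result : ∀ lo hi k ℓ O p q → lo ≤ p → p ≤ hi → parkCar lo hi k ℓ O p ≡ just q →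
  lo ≤ q × q ≤ hi × free O q ≡ true
parkCar-result lo hi k ℓ O p q lo≤p p≤hi parks with parkCar-cases lo hi k ℓ O p q parks
... | parked-at-pref free-p refl = lo≤p , p≤hi , free-p
... | parked-behind _ back =
  let (lo≤q , q<p , free-q , _) = backScan-result O lo p k q back in lo≤q , ≤-trans (<⇒≤ q<p) p≤hi , free-q
... | parked-ahead _ _ fwd =
  let (p<q , q≤hi , free-q , _) = fwdScan-result O hi (suc p) ℓ q fwd in ≤-trans lo≤p (<⇒≤ p<q) , q≤hi , free-q

parkCar-takes-pref : ∀ lo hi k ℓ O p q → parkCar lo hi k ℓ O p ≡ just q → free (q ∷ O) p ≡ false
parkCar-takes-pref lo hi k ℓ O p q parks with parkCar-cases lo hi k ℓ O p q parks
... | parked-at-pref _ refl = free-∷-self p O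
... | parked-behind taken _ = taken-∷ q O p taken
... | parked-ahead taken _ _ = taken-∷ q O p taken

continueRun : ℕ → ℕ → ℕ → ℕ → List ℕ → List ℕ → Maybe ℕ → Maybe (List ℕ)
continueRun lo hi k ℓ O α nothing  = nothing
continueRun lo hi k ℓ O α (just q) = runPark lo hi k ℓ (q ∷ O) α

runPark-∷ : ∀ lo hi k ℓ O p α →
  runPark lo hi k ℓ O (p ∷ α) ≡ continueRun lo hi k ℓ O α (parkCar lo hi k ℓ O p)
runPark-∷ lo hi k ℓ O p α with free O p
... | true  = refl
... | false with backScan O lo p k
...   | just q  = refl
...   | nothing with fwdScan O hi (suc p) ℓ
...     | just q  = refl
...     | nothing = refl

runPark-inRange : ∀ lo hi k ℓ O α O′ → runPark lo hi k ℓ O α ≡ just O′ →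
  InRange lo hi O → InRange lo hi α → InRange lo hi O′
runPark-inRange lo hi k ℓ O []      O′ refl O∈ [] = O∈
runPark-inRange lo hi k ℓ O (p ∷ α) O′ run O∈ ((lo≤p , p≤hi) ∷ α∈) =
  go (parkCar lo hi k ℓ O p) refl (trans (sym (runPark-∷ lo hi k ℓ O p α)) run)
  where
  go : ∀ v → parkCar lo hi k ℓ O p ≡ v → continueRun lo hi k ℓ O α v ≡ just O′ → InRange lo hi O′
  go (just q) parks rest with parkCar-result lo hi k ℓ O p q lo≤p p≤hi parks
  ... | lo≤q , q≤hi , _ = runPark-inRange lo hi k ℓ (q ∷ O) α O′ rest ((lo≤q , q≤hi) ∷ O∈) α∈

_≈ᴹ_ : Maybe (List ℕ) → Maybe (List ℕ) → Set
_≈ᴹ_ = Pointwise _≈_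

backScan-≈ : ∀ {O O′} → O ≈ O′ → ∀ lo p j → backScan O lo p j ≡ backScan O′ lo p j
backScan-≈ O≈O′ lo p zero    = refl
backScan-≈ O≈O′ lo p (suc j) =
  cong₂ (λ a b → if p ≤ᵇ lo then nothing else (if a then just (p ∸ 1) else b))
        (free≡ O≈O′ (p ∸ 1)) (backScan-≈ O≈O′ lo (p ∸ 1) j)

fwdScan-≈ : ∀ {O O′} → O ≈ O′ → ∀ hi q f → fwdScan O hi q f ≡ fwdScan O′ hi q f
fwdScan-≈ O≈O′ hi q zero    = refl
fwdScan-≈ O≈O′ hi q (suc f) =
  cong₂ (λ a b → if hi <ᵇ q then nothing else (if a then just q else b))
        (free≡ O≈O′ q) (fwdScan-≈ O≈O′ hi (suc q) f)

parkCar-≈ : ∀ {O O′} → O ≈ O′ → ∀ lo hi k ℓ p → parkCar lo hi k ℓ O p ≡ parkCar lo hi k ℓ O′ p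
parkCar-≈ {O} {O′} O≈O′ lo hi k ℓ p = begin
  parkCar lo hi k ℓ O p
    ≡⟨ parkCar≡parkOutcome lo hi k ℓ O p ⟩
  parkOutcome p (free O p) (backScan O lo p k) (fwdScan O hi (suc p) ℓ)
    ≡⟨ cong₂ (λ a b → parkOutcome p a b (fwdScan O hi (suc p) ℓ)) (free≡ O≈O′ p) (backScan-≈ O≈O′ lo p k) ⟩
  parkOutcome p (free O′ p) (backScan O′ lo p k) (fwdScan O hi (suc p) ℓ)
    ≡⟨ cong (parkOutcome p (free O′ p) (backScan O′ lo p k)) (fwdScan-≈ O≈O′ hi (suc p) ℓ) ⟩
  parkOutcome p (free O′ p) (backScan O′ lo p k) (fwdScan O′ hi (suc p) ℓ)
    ≡⟨ parkCar≡parkOutcome lo hi k ℓ O′ p ⟨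
  parkCar lo hi k ℓ O′ p ∎
  where open ≡-Reasoning

runPark-≈ : ∀ lo hi k ℓ {O O′} → O ≈ O′ → ∀ α → runPark lo hi k ℓ O α ≈ᴹ runPark lo hi k ℓ O′ α
runPark-≈ lo hi k ℓ O≈O′ [] = just O≈O′
runPark-≈ lo hi k ℓ {O} {O′} O≈O′ (p ∷ α) =
  subst₂ _≈ᴹ_ (sym (runPark-∷ lo hi k ℓ O p α)) (sym (runPark-∷ lo hi k ℓ O′ p α))
    (go (parkCar lo hi k ℓ O p) (parkCar lo hi k ℓ O′ p) (parkCar-≈ O≈O′ lo hi k ℓ p))
  where
  go : ∀ v v′ → v ≡ v′ → continueRun lo hi k ℓ O α v ≈ᴹ continueRun lo hi k ℓ O′ α v′
  go nothing  .nothing  refl = nothing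
  go (just q) .(just q) refl = runPark-≈ lo hi k ℓ (≈-∷ q O≈O′) α

backScan-agree : ∀ lo hi O O′ → AgreeOn lo hi O O′ → ∀ p j → p ≤ suc hi →
  backScan O lo p j ≡ backScan O′ lo p j
backScan-agree lo hi O O′ agree p       zero    p≤1+hi = refl
backScan-agree lo hi O O′ agree zero    (suc j) p≤1+hi = refl
backScan-agree lo hi O O′ agree (suc p) (suc j) p≤1+hi with p <ᵇ lo in p<ᵇlo
... | true  = refl
... | false = cong₂ (λ a b → if a then just p else b)
                    (agree p (<ᵇ≡false⇒≥ p lo p<ᵇlo) (≤-pred p≤1+hi))
                    (backScan-agree lo hi O O′ agree p j (≤-trans (n≤1+n p) p≤1+hi))

fwdScan-agree : ∀ lo hi O O′ → AgreeOn lo hi O O′ → ∀ q f → lo ≤ q →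
  fwdScan O hi q f ≡ fwdScan O′ hi q f
fwdScan-agree lo hi O O′ agree q zero    lo≤q = refl
fwdScan-agree lo hi O O′ agree q (suc f) lo≤q with hi <ᵇ q in hi<ᵇq
... | true  = refl
... | false = cong₂ (λ a b → if a then just q else b)
                    (agree q lo≤q (<ᵇ≡false⇒≥ hi q hi<ᵇq))
                    (fwdScan-agree lo hi O O′ agree (suc q) f (≤-trans lo≤q (n≤1+n q)))

parkCar-agree : ∀ lo hi k ℓ O O′ → AgreeOn lo hi O O′ → ∀ p → lo ≤ p → p ≤ hi →
  parkCar lo hi k ℓ O p ≡ parkCar lo hi k ℓ O′ p
parkCar-agree lo hi k ℓ O O′ agree p lo≤p p≤hi = begin
  parkCar lo hi k ℓ O p
    ≡⟨ parkCar≡parkOutcome lo hi k ℓ O p ⟩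
  parkOutcome p (free O p) (backScan O lo p k) (fwdScan O hi (suc p) ℓ)
    ≡⟨ cong₂ (λ a b → parkOutcome p a b (fwdScan O hi (suc p) ℓ))
             (agree p lo≤p p≤hi) (backScan-agree lo hi O O′ agree p k (≤-trans p≤hi (n≤1+n hi))) ⟩
  parkOutcome p (free O′ p) (backScan O′ lo p k) (fwdScan O hi (suc p) ℓ)
    ≡⟨ cong (parkOutcome p (free O′ p) (backScan O′ lo p k))
            (fwdScan-agree lo hi O O′ agree (suc p) ℓ (≤-trans lo≤p (n≤1+n p))) ⟩
  parkOutcome p (free O′ p) (backScan O′ lo p k) (fwdScan O′ hi (suc p) ℓ)
    ≡⟨ parkCar≡parkOutcome lo hi k ℓ O′ p ⟨
  parkCar lo hi k ℓ O′ p ∎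
  where open ≡-Reasoning

-- Changing the street

fwdScan-cut : ∀ O hi c q₀ f → q₀ ≤ suc c → suc c ≤ hi → free O (suc c) ≡ true → suc c < q₀ + f →
  fwdScan O hi q₀ f ≡ fwdScan O c q₀ f <∣> just (suc c)
fwdScan-cut O hi c q₀ zero    q₀≤1+c _ _ 1+c<q₀+0 =
  ⊥-elim (<-irrefl refl (≤-trans (s≤s q₀≤1+c) (≤-trans 1+c<q₀+0 (≤-reflexive (+-identityʳ q₀)))))
fwdScan-cut O hi c q₀ (suc f) q₀≤1+c 1+c≤hi free-1+c 1+c<q₀+f
  rewrite ≥⇒<ᵇ≡false {hi} {q₀} (≤-trans q₀≤1+c 1+c≤hi) with q₀ ≟ suc c
... | yes refl rewrite <⇒<ᵇ≡true {c} {suc c} ≤-refl | free-1+c = refl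
... | no q₀≢1+c rewrite ≥⇒<ᵇ≡false {c} {q₀} (≤-pred (≤∧≢⇒< q₀≤1+c q₀≢1+c)) with free O q₀
...   | true  = refl
...   | false = fwdScan-cut O hi c (suc q₀) f (≤∧≢⇒< q₀≤1+c q₀≢1+c) 1+c≤hi free-1+c
                            (≤-trans 1+c<q₀+f (≤-reflexive (+-suc q₀ f)))

parkOutcome-<∣> : ∀ p b back fwd s → parkOutcome p b back (fwd <∣> just s) ≡ parkOutcome p b back fwd <∣> just s
parkOutcome-<∣> p true  back     fwd s = refl
parkOutcome-<∣> p false (just x) fwd s = refl
parkOutcome-<∣> p false nothing  fwd s = refl

parkCar-cut : ∀ lo hi c k ℓ O p → p ≤ c → suc c ≤ hi → suc c ≤ ℓ → free O (suc c) ≡ true →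
  parkCar lo hi k ℓ O p ≡ parkCar lo c k ℓ O p <∣> just (suc c)
parkCar-cut lo hi c k ℓ O p p≤c 1+c≤hi 1+c≤ℓ free-1+c = begin
  parkCar lo hi k ℓ O p
    ≡⟨ parkCar≡parkOutcome lo hi k ℓ O p ⟩
  parkOutcome p (free O p) (backScan O lo p k) (fwdScan O hi (suc p) ℓ)
    ≡⟨ cong (parkOutcome p (free O p) (backScan O lo p k))
            (fwdScan-cut O hi c (suc p) ℓ (s≤s p≤c) 1+c≤hi free-1+c (s≤s (≤-trans 1+c≤ℓ (m≤n+m ℓ p)))) ⟩
  parkOutcome p (free O p) (backScan O lo p k) (fwdScan O c (suc p) ℓ <∣> just (suc c))
    ≡⟨ parkOutcome-<∣> p (free O p) (backScan O lo p k) (fwdScan O c (suc p) ℓ) (suc c) ⟩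
  parkOutcome p (free O p) (backScan O lo p k) (fwdScan O c (suc p) ℓ) <∣> just (suc c)
    ≡⟨ cong (_<∣> just (suc c)) (parkCar≡parkOutcome lo c k ℓ O p) ⟨
  parkCar lo c k ℓ O p <∣> just (suc c) ∎
  where open ≡-Reasoning

backScan-raise : ∀ O lo s p j → lo ≤ s → s < p → free O s ≡ true → backScan O lo p j ≡ backScan O s p j
backScan-raise O lo s p       zero    lo≤s s<p free-s = refl
backScan-raise O lo s (suc p) (suc j) lo≤s (s≤s s≤p) free-s
  rewrite ≥⇒<ᵇ≡false {p} {lo} (≤-trans lo≤s s≤p) | ≥⇒<ᵇ≡false {p} {s} s≤p with free O p in free-p
... | true  = refl
... | false with s ≟ p
...   | yes refl = ⊥-elim (true≢false (trans (sym free-s) free-p))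
...   | no s≢p   = backScan-raise O lo s p j lo≤s (≤∧≢⇒< s≤p s≢p) free-s

parkCar-raise : ∀ lo s hi k ℓ O p → lo ≤ s → s < p → free O s ≡ true →
  parkCar lo hi k ℓ O p ≡ parkCar s hi k ℓ O p
parkCar-raise lo s hi k ℓ O p lo≤s s<p free-s =
  trans (parkCar≡parkOutcome lo hi k ℓ O p)
  (trans (cong (λ z → parkOutcome p (free O p) z (fwdScan O hi (suc p) ℓ)) (backScan-raise O lo s p k lo≤s s<p free-s))
         (sym (parkCar≡parkOutcome s hi k ℓ O p)))

free-shift : ∀ d O q → free (map (d +_) O) (d + q) ≡ free O q
free-shift d []      q = refl
free-shift d (x ∷ O) q = begin
  free (d + x ∷ map (d +_) O) (d + q)
    ≡⟨ free-∷ (d + x) (map (d +_) O) (d + q) ⟩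
  (if d + x ≡ᵇ d + q then false else free (map (d +_) O) (d + q))
    ≡⟨ cong₂ (λ a b → if a then false else b) (+-cancelˡ-≡ᵇ d x q) (free-shift d O q) ⟩
  (if x ≡ᵇ q then false else free O q)
    ≡⟨ free-∷ x O q ⟨
  free (x ∷ O) q ∎
  where open ≡-Reasoning

free-shift-below : ∀ d O q → q < d → free (map (d +_) O) q ≡ true
free-shift-below d []      q q<d = refl
free-shift-below d (x ∷ O) q q<d =
  trans (free-∷-other (d + x) (map (d +_) O) q (λ d+x≡q → <-irrefl refl (≤-trans q<d (≤-trans (m≤m+n d x) (≤-reflexive d+x≡q)))))
        (free-shift-below d O q q<d)

backScan-shift : ∀ d O lo p j →
  backScan (map (d +_) O) (d + lo) (d + p) j ≡ Maybe.map (d +_) (backScan O lo p j)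
backScan-shift d O lo p       zero    = refl
backScan-shift d O lo zero    (suc j) rewrite +-identityʳ d | ≤⇒≤ᵇ≡true (m≤m+n d lo) = refl
backScan-shift d O lo (suc p) (suc j) rewrite +-suc d p | +-cancelˡ-<ᵇ d p lo with p <ᵇ lo
... | true  = refl
... | false rewrite free-shift d O p with free O p
...   | true  = refl
...   | false = backScan-shift d O lo p j

fwdScan-shift : ∀ d O hi q f →
  fwdScan (map (d +_) O) (d + hi) (d + q) f ≡ Maybe.map (d +_) (fwdScan O hi q f)
fwdScan-shift d O hi q zero    = refl
fwdScan-shift d O hi q (suc f) rewrite +-cancelˡ-<ᵇ d hi q with hi <ᵇ q
... | true  = refl
... | false rewrite free-shift d O q with free O q
...   | true  = refl
...   | false = trans (cong (λ z → fwdScan (map (d +_) O) (d + hi) z f) (sym (+-suc d q)))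
                      (fwdScan-shift d O hi (suc q) f)

parkOutcome-shift : ∀ d p b back fwd →
  parkOutcome (d + p) b (Maybe.map (d +_) back) (Maybe.map (d +_) fwd) ≡ Maybe.map (d +_) (parkOutcome p b back fwd)
parkOutcome-shift d p true  back     fwd = refl
parkOutcome-shift d p false (just x) fwd = refl
parkOutcome-shift d p false nothing  fwd = refl

parkCar-shift : ∀ d lo hi k ℓ O p →
  parkCar (d + lo) (d + hi) k ℓ (map (d +_) O) (d + p) ≡ Maybe.map (d +_) (parkCar lo hi k ℓ O p)
parkCar-shift d lo hi k ℓ O p = begin
  parkCar (d + lo) (d + hi) k ℓ (map (d +_) O) (d + p)
    ≡⟨ parkCar≡parkOutcome (d + lo) (d + hi) k ℓ (map (d +_) O) (d + p) ⟩
  parkOutcome (d + p) (free (map (d +_) O) (d + p)) (backScan (map (d +_) O) (d + lo) (d + p) k)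
              (fwdScan (map (d +_) O) (d + hi) (suc (d + p)) ℓ)
    ≡⟨ cong (λ z → parkOutcome (d + p) (free (map (d +_) O) (d + p)) (backScan (map (d +_) O) (d + lo) (d + p) k)
                                  (fwdScan (map (d +_) O) (d + hi) z ℓ)) (sym (+-suc d p)) ⟩
  parkOutcome (d + p) (free (map (d +_) O) (d + p)) (backScan (map (d +_) O) (d + lo) (d + p) k)
              (fwdScan (map (d +_) O) (d + hi) (d + suc p) ℓ)
    ≡⟨ cong₂ (λ a b → parkOutcome (d + p) a b (fwdScan (map (d +_) O) (d + hi) (d + suc p) ℓ))
             (free-shift d O p) (backScan-shift d O lo p k) ⟩
  parkOutcome (d + p) (free O p) (Maybe.map (d +_) (backScan O lo p k))
              (fwdScan (map (d +_) O) (d + hi) (d + suc p) ℓ)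
    ≡⟨ cong (parkOutcome (d + p) (free O p) (Maybe.map (d +_) (backScan O lo p k)))
            (fwdScan-shift d O hi (suc p) ℓ) ⟩
  parkOutcome (d + p) (free O p) (Maybe.map (d +_) (backScan O lo p k)) (Maybe.map (d +_) (fwdScan O hi (suc p) ℓ))
    ≡⟨ parkOutcome-shift d p (free O p) (backScan O lo p k) (fwdScan O hi (suc p) ℓ) ⟩
  Maybe.map (d +_) (parkOutcome p (free O p) (backScan O lo p k) (fwdScan O hi (suc p) ℓ))
    ≡⟨ cong (Maybe.map (d +_)) (parkCar≡parkOutcome lo hi k ℓ O p) ⟨
  Maybe.map (d +_) (parkCar lo hi k ℓ O p) ∎
  where open ≡-Reasoning

runPark-shift : ∀ d lo hi k ℓ O α →
  runPark (d + lo) (d + hi) k ℓ (map (d +_) O) (map (d +_) α) ≡ Maybe.map (map (d +_)) (runPark lo hi k ℓ O α)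
runPark-shift d lo hi k ℓ O []      = refl
runPark-shift d lo hi k ℓ O (p ∷ α) =
  trans (runPark-∷ (d + lo) (d + hi) k ℓ (map (d +_) O) (d + p) (map (d +_) α))
  (trans (go (parkCar (d + lo) (d + hi) k ℓ (map (d +_) O) (d + p)) (parkCar lo hi k ℓ O p) (parkCar-shift d lo hi k ℓ O p))
         (cong (Maybe.map (map (d +_))) (sym (runPark-∷ lo hi k ℓ O p α))))
  where
  go : ∀ v v′ → v ≡ Maybe.map (d +_) v′ →
    continueRun (d + lo) (d + hi) k ℓ (map (d +_) O) (map (d +_) α) v ≡ Maybe.map (map (d +_)) (continueRun lo hi k ℓ O α v′)
  go .nothing        nothing  refl = refl
  go .(just (d + q)) (just q) refl = runPark-shift d lo hi k ℓ (q ∷ O) α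

free-shift₀ : ∀ a O → free (map (a +_) O) a ≡ free O 0
free-shift₀ a O = subst (λ z → free (map (a +_) O) z ≡ free O 0) (+-identityʳ a) (free-shift a O 0)

parkCar-shift₀ : ∀ a d k ℓ O p →
  parkCar a (a + d) k ℓ (map (a +_) O) (a + p) ≡ Maybe.map (a +_) (parkCar 0 d k ℓ O p)
parkCar-shift₀ a d k ℓ O p =
  subst (λ z → parkCar z (a + d) k ℓ (map (a +_) O) (a + p) ≡ Maybe.map (a +_) (parkCar 0 d k ℓ O p))
        (+-identityʳ a) (parkCar-shift a 0 d k ℓ O p)

runPark-shift₀ : ∀ a d k ℓ α →
  runPark a (a + d) k ℓ [] (map (a +_) α) ≡ Maybe.map (map (a +_)) (runPark 0 d k ℓ [] α)
runPark-shift₀ a d k ℓ α =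
  subst (λ z → runPark z (a + d) k ℓ [] (map (a +_) α) ≡ Maybe.map (map (a +_)) (runPark 0 d k ℓ [] α))
        (+-identityʳ a) (runPark-shift a 0 d k ℓ [] α)

fwdScan-ℓ-irrelevant : ∀ O hi q f f′ → hi < q + f → hi < q + f′ → fwdScan O hi q f ≡ fwdScan O hi q f′
fwdScan-ℓ-irrelevant O hi q zero    zero     _ _ = refl
fwdScan-ℓ-irrelevant O hi q zero    (suc f′) hi<q+0 _ rewrite <⇒<ᵇ≡true (≤-trans hi<q+0 (≤-reflexive (+-identityʳ q))) = refl
fwdScan-ℓ-irrelevant O hi q (suc f) zero     _ hi<q+0 rewrite <⇒<ᵇ≡true (≤-trans hi<q+0 (≤-reflexive (+-identityʳ q))) = refl
fwdScan-ℓ-irrelevant O hi q (suc f) (suc f′) hi<q+f hi<q+f′ =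
  cong (λ z → if hi <ᵇ q then nothing else (if free O q then just q else z))
       (fwdScan-ℓ-irrelevant O hi (suc q) f f′ (≤-trans hi<q+f (≤-reflexive (+-suc q f))) (≤-trans hi<q+f′ (≤-reflexive (+-suc q f′))))

parkCar-ℓ-irrelevant : ∀ lo hi k ℓ ℓ′ O p → hi ≤ p + ℓ → hi ≤ p + ℓ′ →
  parkCar lo hi k ℓ O p ≡ parkCar lo hi k ℓ′ O p
parkCar-ℓ-irrelevant lo hi k ℓ ℓ′ O p hi≤p+ℓ hi≤p+ℓ′ =
  trans (parkCar≡parkOutcome lo hi k ℓ O p)
  (trans (cong (parkOutcome p (free O p) (backScan O lo p k)) (fwdScan-ℓ-irrelevant O hi (suc p) ℓ ℓ′ (s≤s hi≤p+ℓ) (s≤s hi≤p+ℓ′)))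
         (sym (parkCar≡parkOutcome lo hi k ℓ′ O p)))

runPark-ℓ-irrelevant : ∀ lo hi k ℓ ℓ′ B O α → InRange 1 B α → hi ≤ suc ℓ → hi ≤ suc ℓ′ →
  runPark lo hi k ℓ O α ≡ runPark lo hi k ℓ′ O α
runPark-ℓ-irrelevant lo hi k ℓ ℓ′ B O []      _ _ _ = refl
runPark-ℓ-irrelevant lo hi k ℓ ℓ′ B O (p ∷ α) ((1≤p , _) ∷ α∈) hi≤1+ℓ hi≤1+ℓ′ =
  trans (runPark-∷ lo hi k ℓ O p α)
  (trans (go (parkCar lo hi k ℓ O p) (parkCar lo hi k ℓ′ O p)
             (parkCar-ℓ-irrelevant lo hi k ℓ ℓ′ O p (≤-trans hi≤1+ℓ (+-monoˡ-≤ ℓ 1≤p)) (≤-trans hi≤1+ℓ′ (+-monoˡ-≤ ℓ′ 1≤p))))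
         (sym (runPark-∷ lo hi k ℓ′ O p α)))
  where
  go : ∀ v v′ → v ≡ v′ → continueRun lo hi k ℓ O α v ≡ continueRun lo hi k ℓ′ O α v′
  go nothing  .nothing  refl = refl
  go (just q) .(just q) refl = runPark-ℓ-irrelevant lo hi k ℓ ℓ′ B (q ∷ O) α α∈ hi≤1+ℓ hi≤1+ℓ′

-- Splitting a run at a spot that stays empty

keepIfFree : ℕ → Maybe (List ℕ) → Maybe (List ℕ)
keepIfFree s nothing  = nothing
keepIfFree s (just O) = if free O s then just O else nothing

keepIfFree-taken : ∀ lo hi k ℓ O α s → free O s ≡ false → keepIfFree s (runPark lo hi k ℓ O α) ≡ nothing
keepIfFree-taken lo hi k ℓ O []      s taken rewrite taken = refl
keepIfFree-taken lo hi k ℓ O (p ∷ α) s taken =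
  trans (cong (keepIfFree s) (runPark-∷ lo hi k ℓ O p α)) (go (parkCar lo hi k ℓ O p))
  where
  go : ∀ v → keepIfFree s (continueRun lo hi k ℓ O α v) ≡ nothing
  go nothing  = refl
  go (just q) = keepIfFree-taken lo hi k ℓ (q ∷ O) α s (taken-∷ q O s taken)

keepIfFree-prefers : ∀ lo hi k ℓ O α s → prefers s α ≡ true → keepIfFree s (runPark lo hi k ℓ O α) ≡ nothing
keepIfFree-prefers lo hi k ℓ O (p ∷ α) s prefers-s with p ≡ᵇ s in p≡ᵇs
... | true rewrite ≡ᵇ≡true⇒≡ p s p≡ᵇs =
  trans (cong (keepIfFree s) (runPark-∷ lo hi k ℓ O s α)) (go (parkCar lo hi k ℓ O s) refl)
  where
  go : ∀ v → parkCar lo hi k ℓ O s ≡ v → keepIfFree s (continueRun lo hi k ℓ O α v) ≡ nothing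
  go nothing  _     = refl
  go (just q) parks = keepIfFree-taken lo hi k ℓ (q ∷ O) α s (parkCar-takes-pref lo hi k ℓ O s q parks)
... | false = trans (cong (keepIfFree s) (runPark-∷ lo hi k ℓ O p α)) (go (parkCar lo hi k ℓ O p))
  where
  go : ∀ v → keepIfFree s (continueRun lo hi k ℓ O α v) ≡ nothing
  go nothing  = refl
  go (just q) = keepIfFree-prefers lo hi k ℓ (q ∷ O) α s prefers-s

rightPrefsUnshifted : ℕ → List ℕ → List ℕ
rightPrefsUnshifted c []      = []
rightPrefsUnshifted c (p ∷ α) = if suc c <ᵇ p then p ∷ rightPrefsUnshifted c α else rightPrefsUnshifted c α

rightPrefs-shift : ∀ c α → map (suc c +_) (rightPrefs c α) ≡ rightPrefsUnshifted c α
rightPrefs-shift c []      = refl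
rightPrefs-shift c (p ∷ α) with suc c <ᵇ p in 1+c<ᵇp
... | true  = cong₂ _∷_ (m+[n∸m]≡n (<⇒≤ (<ᵇ≡true⇒< (suc c) p 1+c<ᵇp))) (rightPrefs-shift c α)
... | false = rightPrefs-shift c α

InRange-free-below : ∀ a b O q → InRange a b O → q < a → free O q ≡ true
InRange-free-below a b []      q _                q<a = refl
InRange-free-below a b (x ∷ O) q ((a≤x , _) ∷ O∈) q<a =
  trans (free-∷-other x O q (λ x≡q → <-irrefl refl (≤-trans q<a (≤-trans a≤x (≤-reflexive x≡q)))))
        (InRange-free-below a b O q O∈ q<a)

InRange-free-above : ∀ a b O q → InRange a b O → b < q → free O q ≡ true
InRange-free-above a b []      q _                b<q = refl
InRange-free-above a b (x ∷ O) q ((_ , x≤b) ∷ O∈) b<q =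
  trans (free-∷-other x O q (λ x≡q → <-irrefl refl (≤-trans (s≤s x≤b) (≤-trans b<q (≤-reflexive (sym x≡q))))))
        (InRange-free-above a b O q O∈ b<q)

InRange-monoˡ : ∀ {lo′ lo hi} α → lo′ ≤ lo → InRange lo hi α → InRange lo′ hi α
InRange-monoˡ []      _      []                   = []
InRange-monoˡ (_ ∷ α) lo′≤lo ((lo≤p , p≤hi) ∷ α∈) = (≤-trans lo′≤lo lo≤p , p≤hi) ∷ InRange-monoˡ α lo′≤lo α∈

InRange-leftPrefs : ∀ c N α → InRange 1 N α → InRange 1 c (leftPrefs c α)
InRange-leftPrefs c N []      _ = []
InRange-leftPrefs c N (p ∷ α) ((1≤p , _) ∷ α∈) with p ≤ᵇ c in p≤ᵇc
... | true  = (1≤p , ≤ᵇ≡true⇒≤ p c p≤ᵇc) ∷ InRange-leftPrefs c N α α∈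
... | false = InRange-leftPrefs c N α α∈

module _ (lo hi c k ℓ : ℕ) {O OL OR : List ℕ} (O≈ : O ≈ (OL ++ OR))
         (OL∈ : InRange 0 c OL) (OR∈ : InRange (suc (suc c)) hi OR) where

  split-free : free O (suc c) ≡ true
  split-free rewrite free≡ O≈ (suc c) | free-++ OL OR (suc c)
                   | InRange-free-above 0 c OL (suc c) OL∈ ≤-refl
                   | InRange-free-below (suc (suc c)) hi OR (suc c) OR∈ ≤-refl = refl

  parkCar-split-left : ∀ p → lo ≤ p → p ≤ c → suc c ≤ hi → hi ≤ ℓ →
    parkCar lo hi k ℓ O p ≡ parkCar lo c k ℓ OL p <∣> just (suc c)
  parkCar-split-left p lo≤p p≤c 1+c≤hi hi≤ℓ =
    trans (parkCar-cut lo hi c k ℓ O p p≤c 1+c≤hi (≤-trans 1+c≤hi hi≤ℓ) split-free)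
          (cong (_<∣> just (suc c)) (parkCar-agree lo c k ℓ O OL agree p lo≤p p≤c))
    where
    agree : AgreeOn lo c O OL
    agree q _ q≤c = begin
      free O q                   ≡⟨ free≡ O≈ q ⟩
      free (OL ++ OR) q          ≡⟨ free-++ OL OR q ⟩
      free OL q ∧ free OR q      ≡⟨ cong (free OL q ∧_) (InRange-free-below (suc (suc c)) hi OR q OR∈ (≤-trans (s≤s q≤c) (n≤1+n (suc c)))) ⟩
      free OL q ∧ true           ≡⟨ ∧-identityʳ (free OL q) ⟩
      free OL q                  ∎
      where open ≡-Reasoning

  parkCar-split-right : ∀ p → lo ≤ suc c → suc c < p → p ≤ hi →
    parkCar lo hi k ℓ O p ≡ parkCar (suc c) hi k ℓ OR p
  parkCar-split-right p lo≤1+c 1+c<p p≤hi =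
    trans (parkCar-raise lo (suc c) hi k ℓ O p lo≤1+c 1+c<p split-free)
          (parkCar-agree (suc c) hi k ℓ O OR agree p (<⇒≤ 1+c<p) p≤hi)
    where
    agree : AgreeOn (suc c) hi O OR
    agree q c<q _ = trans (free≡ O≈ q) (trans (free-++ OL OR q) (cong (_∧ free OR q) (InRange-free-above 0 c OL q OL∈ c<q)))

zipWith-nothing : ∀ {A B C : Set} (f : A → B → C) m → zipWith f m nothing ≡ nothing
zipWith-nothing f (just _) = refl
zipWith-nothing f nothing  = refl

runPark-split : ∀ lo hi c k ℓ α O OL OR → lo ≤ suc c → suc c ≤ hi → hi ≤ ℓ →
  O ≈ (OL ++ OR) → InRange 0 c OL → InRange (suc (suc c)) hi OR →
  InRange lo hi α → prefers (suc c) α ≡ false →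
  keepIfFree (suc c) (runPark lo hi k ℓ O α)
    ≈ᴹ zipWith _++_ (runPark lo c k ℓ OL (leftPrefs c α))
                    (keepIfFree (suc c) (runPark (suc c) hi k ℓ OR (rightPrefsUnshifted c α)))
runPark-split lo hi c k ℓ [] O OL OR lo≤1+c 1+c≤hi hi≤ℓ O≈ OL∈ OR∈ _ _
  rewrite split-free lo hi c k ℓ O≈ OL∈ OR∈ | InRange-free-below (suc (suc c)) hi OR (suc c) OR∈ ≤-refl = just O≈
runPark-split lo hi c k ℓ (p ∷ α) O OL OR lo≤1+c 1+c≤hi hi≤ℓ O≈ OL∈ OR∈ ((lo≤p , p≤hi) ∷ α∈) avoids
  with <-cmp p (suc c)
... | tri≈ _ refl _ = ⊥-elim (true≢false (trans (sym (≡ᵇ-refl p)) (∨-conicalˡ (p ≡ᵇ p) _ avoids)))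
... | tri< p<1+c _ _ rewrite ≤⇒≤ᵇ≡true (≤-pred p<1+c) | ≥⇒<ᵇ≡false {suc c} {p} (<⇒≤ p<1+c) =
  subst₂ _≈ᴹ_
    (cong (keepIfFree (suc c)) (sym (trans (runPark-∷ lo hi k ℓ O p α)
      (cong (continueRun lo hi k ℓ O α) (parkCar-split-left lo hi c k ℓ O≈ OL∈ OR∈ p lo≤p (≤-pred p<1+c) 1+c≤hi hi≤ℓ)))))
    (cong (λ z → zipWith _++_ z Right) (sym (runPark-∷ lo c k ℓ OL p (leftPrefs c α))))
    (step (parkCar lo c k ℓ OL p) refl)
  where
  Right = keepIfFree (suc c) (runPark (suc c) hi k ℓ OR (rightPrefsUnshifted c α))
  step : ∀ v → parkCar lo c k ℓ OL p ≡ v →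
    keepIfFree (suc c) (continueRun lo hi k ℓ O α (v <∣> just (suc c)))
      ≈ᴹ zipWith _++_ (continueRun lo c k ℓ OL (leftPrefs c α) v) Right
  step nothing _ rewrite keepIfFree-taken lo hi k ℓ (suc c ∷ O) α (suc c) (free-∷-self (suc c) O) = nothing
  step (just q) parks with parkCar-result lo c k ℓ OL p q lo≤p (≤-pred p<1+c) parks
  ... | _ , q≤c , _ = runPark-split lo hi c k ℓ α (q ∷ O) (q ∷ OL) OR lo≤1+c 1+c≤hi hi≤ℓ
                        (≈-∷ q O≈) ((z≤n , q≤c) ∷ OL∈) OR∈ α∈ (∨-conicalʳ _ _ avoids)
... | tri> _ _ 1+c<p rewrite >⇒≤ᵇ≡false {p} {c} (≤-trans (n≤1+n (suc c)) 1+c<p) | <⇒<ᵇ≡true 1+c<p =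
  subst₂ _≈ᴹ_
    (cong (keepIfFree (suc c)) (sym (trans (runPark-∷ lo hi k ℓ O p α)
      (cong (continueRun lo hi k ℓ O α) (parkCar-split-right lo hi c k ℓ O≈ OL∈ OR∈ p lo≤1+c 1+c<p p≤hi)))))
    (cong (λ z → zipWith _++_ Left (keepIfFree (suc c) z)) (sym (runPark-∷ (suc c) hi k ℓ OR p (rightPrefsUnshifted c α))))
    (step (parkCar (suc c) hi k ℓ OR p) refl)
  where
  Left = runPark lo c k ℓ OL (leftPrefs c α)
  step : ∀ v → parkCar (suc c) hi k ℓ OR p ≡ v →
    keepIfFree (suc c) (continueRun lo hi k ℓ O α v)
      ≈ᴹ zipWith _++_ Left (keepIfFree (suc c) (continueRun (suc c) hi k ℓ OR (rightPrefsUnshifted c α) v))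
  step nothing _ rewrite zipWith-nothing _++_ Left = nothing
  step (just q) parks with parkCar-result (suc c) hi k ℓ OR p q (<⇒≤ 1+c<p) p≤hi parks
  ... | 1+c≤q , q≤hi , _ with q ≟ suc c
  ...   | yes refl rewrite keepIfFree-taken lo hi k ℓ (suc c ∷ O) α (suc c) (free-∷-self (suc c) O)
                         | keepIfFree-taken (suc c) hi k ℓ (suc c ∷ OR) (rightPrefsUnshifted c α) (suc c) (free-∷-self (suc c) OR)
                         | zipWith-nothing _++_ Left = nothing
  ...   | no q≢1+c = runPark-split lo hi c k ℓ α (q ∷ O) OL (q ∷ OR) lo≤1+c 1+c≤hi hi≤ℓ
                       (≈-trans (≈-∷ q O≈) (∷-++-≈ q OL OR)) OL∈ ((≤∧≢⇒< 1+c≤q (q≢1+c ∘ sym) , q≤hi) ∷ OR∈) α∈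
                       (∨-conicalʳ _ _ avoids)

parkLast : ℕ → ℕ → ℕ → ℕ → ℕ → Maybe (List ℕ) → Maybe (List ℕ)
parkLast lo hi k ℓ j nothing  = nothing
parkLast lo hi k ℓ j (just O) = continueRun lo hi k ℓ O [] (parkCar lo hi k ℓ O j)

runPark-snoc : ∀ lo hi k ℓ O α j →
  runPark lo hi k ℓ O (α ++ j ∷ []) ≡ parkLast lo hi k ℓ j (runPark lo hi k ℓ O α)
runPark-snoc lo hi k ℓ O []      j = runPark-∷ lo hi k ℓ O j []
runPark-snoc lo hi k ℓ O (p ∷ α) j =
  trans (runPark-∷ lo hi k ℓ O p (α ++ j ∷ []))
  (trans (go (parkCar lo hi k ℓ O p)) (cong (parkLast lo hi k ℓ j) (sym (runPark-∷ lo hi k ℓ O p α))))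
  where
  go : ∀ v → continueRun lo hi k ℓ O (α ++ j ∷ []) v ≡ parkLast lo hi k ℓ j (continueRun lo hi k ℓ O α v)
  go nothing  = refl
  go (just q) = runPark-snoc lo hi k ℓ (q ∷ O) α j

isPullbackPF≡is-just : ∀ b k ℓ α → isPullbackPF b k ℓ α ≡ is-just (runPark 1 b k ℓ [] α)
isPullbackPF≡is-just b k ℓ α with runPark 1 b k ℓ [] α
... | nothing = refl
... | just _  = refl

spot0Free : Maybe (List ℕ) → Bool
spot0Free nothing  = false
spot0Free (just O) = free O 0

backScan-from0 : ∀ O p j → free O 0 ≡ true →
  backScan O 0 p j ≡ backScan O 1 p j ⊎ backScan O 0 p j ≡ just 0
backScan-from0 O p                zero    _      = inj₁ refl
backScan-from0 O zero             (suc j) _      = inj₁ refl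
backScan-from0 O (suc zero)       (suc j) free-0 rewrite free-0 = inj₂ refl
backScan-from0 O (suc (suc p))    (suc j) free-0 with free O (suc p)
... | true  = inj₁ refl
... | false = backScan-from0 O (suc p) j free-0

parkCar-from0 : ∀ b k ℓ O p → free O 0 ≡ true →
  parkCar 0 b k ℓ O p ≡ parkCar 1 b k ℓ O p ⊎ parkCar 0 b k ℓ O p ≡ just 0
parkCar-from0 b k ℓ O p free-0
  rewrite parkCar≡parkOutcome 0 b k ℓ O p | parkCar≡parkOutcome 1 b k ℓ O p
  with free O p | backScan-from0 O p k free-0
... | true  | _        = inj₁ refl
... | false | inj₁ eq  = inj₁ (cong (λ z → parkOutcome p false z (fwdScan O b (suc p) ℓ)) eq)
... | false | inj₂ eq  = inj₂ (cong (λ z → parkOutcome p false z (fwdScan O b (suc p) ℓ)) eq)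

runPark-from0 : ∀ b k ℓ O α O′ → free O 0 ≡ true → keepIfFree 0 (runPark 0 b k ℓ O α) ≡ just O′ →
  runPark 1 b k ℓ O α ≡ just O′
runPark-from0 b k ℓ O []      O′ free-0 run rewrite free-0 = run
runPark-from0 b k ℓ O (p ∷ α) O′ free-0 run with parkCar-from0 b k ℓ O p free-0
... | inj₂ into0 = case trans (sym killed) run of λ ()
  where
  killed : keepIfFree 0 (runPark 0 b k ℓ O (p ∷ α)) ≡ nothing
  killed = trans (cong (keepIfFree 0) (trans (runPark-∷ 0 b k ℓ O p α) (cong (continueRun 0 b k ℓ O α) into0)))
                 (keepIfFree-taken 0 b k ℓ (0 ∷ O) α 0 (free-∷-self 0 O))
... | inj₁ same = trans (runPark-∷ 1 b k ℓ O p α) (go (parkCar 1 b k ℓ O p) rest)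
  where
  rest : keepIfFree 0 (continueRun 0 b k ℓ O α (parkCar 1 b k ℓ O p)) ≡ just O′
  rest = trans (cong (keepIfFree 0) (sym (trans (runPark-∷ 0 b k ℓ O p α) (cong (continueRun 0 b k ℓ O α) same)))) run
  go : ∀ v → keepIfFree 0 (continueRun 0 b k ℓ O α v) ≡ just O′ → continueRun 1 b k ℓ O α v ≡ just O′
  go (just q) run′ with q ≟ 0
  ... | yes refl rewrite keepIfFree-taken 0 b k ℓ (0 ∷ O) α 0 (free-∷-self 0 O) = case run′ of λ ()
  ... | no q≢0  = runPark-from0 b k ℓ (q ∷ O) α O′ (trans (free-∷-other q O 0 q≢0) free-0) run′

-- When nobody backs into spot 0, the street 0..b behaves like 1..b, so the first conjunct of isC is redundant.
isC≡spot0Free : ∀ b k ℓ α → isC b k ℓ α ≡ spot0Free (runPark 0 b k ℓ [] α)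
isC≡spot0Free b k ℓ α with runPark 0 b k ℓ [] α in run
... | nothing = refl
... | just O with free O 0 in free-0
...   | false = ∧-zeroʳ (isPullbackPF b k ℓ α)
...   | true  = cong (_∧ true) (trans (isPullbackPF≡is-just b k ℓ α)
                  (cong is-just (runPark-from0 b k ℓ [] α O refl kept)))
  where
  kept : keepIfFree 0 (runPark 0 b k ℓ [] α) ≡ just O
  kept rewrite run | free-0 = refl

taken : List ℕ → ℕ → Bool
taken O q = not (free O q)

#taken : List ℕ → ℕ → ℕ → ℕ
#taken O a zero      = 0
#taken O a (suc len) = 𝟙 (taken O a) + #taken O (suc a) len

allTaken : List ℕ → ℕ → ℕ → Bool
allTaken O a zero      = true
allTaken O a (suc len) = taken O a ∧ allTaken O (suc a) len

#taken-[] : ∀ a len → #taken [] a len ≡ 0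
#taken-[] a zero      = refl
#taken-[] a (suc len) = #taken-[] (suc a) len

#taken≤len : ∀ O a len → #taken O a len ≤ len
#taken≤len O a zero      = z≤n
#taken≤len O a (suc len) with taken O a
... | true  = s≤s (#taken≤len O (suc a) len)
... | false = m≤n⇒m≤1+n (#taken≤len O (suc a) len)

#taken-∷-below : ∀ O q a len → q < a → #taken (q ∷ O) a len ≡ #taken O a len
#taken-∷-below O q a zero      q<a = refl
#taken-∷-below O q a (suc len) q<a =
  cong₂ (λ f n → 𝟙 (not f) + n) (free-∷-other q O a (<⇒≢ q<a)) (#taken-∷-below O q (suc a) len (m<n⇒m<1+n q<a))

#taken-∷ : ∀ O q a len → free O q ≡ true → a ≤ q → q < a + len → #taken (q ∷ O) a len ≡ suc (#taken O a len)
#taken-∷ O q a zero      free-q a≤q q<a+0 = ⊥-elim (<-irrefl refl (≤-<-trans a≤q (subst (q <_) (+-identityʳ a) q<a+0)))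
#taken-∷ O q a (suc len) free-q a≤q q<a+len with q ≟ a
... | yes refl rewrite free-∷-self q O | free-q = cong suc (#taken-∷-below O q (suc q) len ≤-refl)
... | no q≢a rewrite free-∷-other q O a q≢a =
  trans (cong (𝟙 (taken O a) +_) (#taken-∷ O q (suc a) len free-q (≤∧≢⇒< a≤q (q≢a ∘ sym)) (subst (q <_) (+-suc a len) q<a+len)))
        (+-suc (𝟙 (taken O a)) _)

runPark-#taken : ∀ lo hi k ℓ O α O′ → runPark lo hi k ℓ O α ≡ just O′ → InRange lo hi α →
  #taken O′ lo (suc hi ∸ lo) ≡ #taken O lo (suc hi ∸ lo) + length α
runPark-#taken lo hi k ℓ O []      O′ refl _ = sym (+-identityʳ _)
runPark-#taken lo hi k ℓ O (p ∷ α) O′ run ((lo≤p , p≤hi) ∷ α∈) =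
  go (parkCar lo hi k ℓ O p) refl (trans (sym (runPark-∷ lo hi k ℓ O p α)) run)
  where
  go : ∀ v → parkCar lo hi k ℓ O p ≡ v → continueRun lo hi k ℓ O α v ≡ just O′ →
    #taken O′ lo (suc hi ∸ lo) ≡ #taken O lo (suc hi ∸ lo) + suc (length α)
  go (just q) parks rest with parkCar-result lo hi k ℓ O p q lo≤p p≤hi parks
  ... | lo≤q , q≤hi , free-q = begin
    #taken O′ lo (suc hi ∸ lo)                            ≡⟨ runPark-#taken lo hi k ℓ (q ∷ O) α O′ rest α∈ ⟩
    #taken (q ∷ O) lo (suc hi ∸ lo) + length α           ≡⟨ cong (_+ length α) (#taken-∷ O q lo (suc hi ∸ lo) free-q lo≤q q<end) ⟩
    suc (#taken O lo (suc hi ∸ lo)) + length α           ≡⟨ +-suc _ (length α) ⟨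
    #taken O lo (suc hi ∸ lo) + suc (length α)           ∎
    where
    open ≡-Reasoning
    q<end : q < lo + (suc hi ∸ lo)
    q<end = subst (q <_) (sym (m+[n∸m]≡n (≤-trans lo≤p (≤-trans p≤hi (n≤1+n hi))))) (s≤s q≤hi)

allTaken≡#taken≡ᵇlen : ∀ O a len → allTaken O a len ≡ (#taken O a len ≡ᵇ len)
allTaken≡#taken≡ᵇlen O a zero      = refl
allTaken≡#taken≡ᵇlen O a (suc len) with taken O a
... | true  = allTaken≡#taken≡ᵇlen O (suc a) len
... | false = sym (≢⇒≡ᵇ≡false (<⇒≢ (s≤s (#taken≤len O (suc a) len))))

allTaken⇒taken : ∀ O a len → allTaken O a len ≡ true → ∀ q → a ≤ q → q < a + len → free O q ≡ false
allTaken⇒taken O a zero      _   q a≤q q<a+0 = ⊥-elim (<-irrefl refl (≤-<-trans a≤q (subst (q <_) (+-identityʳ a) q<a+0)))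
allTaken⇒taken O a (suc len) all q a≤q q<a+len with q ≟ a
... | yes refl = not-injective (∧-conicalˡ _ _ all)
  where
  not-injective : ∀ {b} → not b ≡ true → b ≡ false
  not-injective {false} _ = refl
... | no q≢a = allTaken⇒taken O (suc a) len (∧-conicalʳ _ _ all) q (≤∧≢⇒< a≤q (q≢a ∘ sym)) (subst (q <_) (+-suc a len) q<a+len)

allTaken-snoc : ∀ O a len → allTaken O a (suc len) ≡ allTaken O a len ∧ taken O (a + len)
allTaken-snoc O a zero      = trans (∧-identityʳ (taken O a)) (cong (taken O) (sym (+-identityʳ a)))
allTaken-snoc O a (suc len) = begin
  taken O a ∧ allTaken O (suc a) (suc len)                ≡⟨ cong (taken O a ∧_) (allTaken-snoc O (suc a) len) ⟩
  taken O a ∧ (allTaken O (suc a) len ∧ taken O (suc a + len)) ≡⟨ ∧-assoc (taken O a) _ _ ⟨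
  (taken O a ∧ allTaken O (suc a) len) ∧ taken O (suc a + len) ≡⟨ cong (λ z → (taken O a ∧ allTaken O (suc a) len) ∧ taken O z) (+-suc a len) ⟨
  (taken O a ∧ allTaken O (suc a) len) ∧ taken O (a + suc len) ∎
  where open ≡-Reasoning

allTaken-cong : ∀ O O′ a b len → (∀ t → t < len → free O (a + t) ≡ free O′ (b + t)) →
  allTaken O a len ≡ allTaken O′ b len
allTaken-cong O O′ a b zero      same = refl
allTaken-cong O O′ a b (suc len) same =
  cong₂ _∧_ (cong not (subst₂ (λ x y → free O x ≡ free O′ y) (+-identityʳ a) (+-identityʳ b) (same 0 z<s)))
            (allTaken-cong O O′ (suc a) (suc b) len (λ t t<len →
              subst₂ (λ x y → free O x ≡ free O′ y) (+-suc a t) (+-suc b t) (same (suc t) (s<s t<len))))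

runPark-allTaken : ∀ k ℓ c β O → runPark 1 c k ℓ [] β ≡ just O → InRange 1 c β →
  allTaken O 1 c ≡ (length β ≡ᵇ c)
runPark-allTaken k ℓ c β O run β∈ =
  trans (allTaken≡#taken≡ᵇlen O 1 c)
        (cong (_≡ᵇ c) (trans (runPark-#taken 1 c k ℓ [] β O run β∈) (cong (_+ length β) (#taken-[] 1 c))))

runPark-allTaken₀ : ∀ k ℓ f γ O → runPark 0 f k ℓ [] γ ≡ just O → InRange 1 f γ → free O 0 ≡ true →
  allTaken O 1 f ≡ (length γ ≡ᵇ f)
runPark-allTaken₀ k ℓ f γ O run γ∈ free-0 =
  trans (allTaken≡#taken≡ᵇlen O 1 f) (cong (_≡ᵇ f) (begin
    #taken O 1 f                   ≡⟨ cong (λ b → 𝟙 (not b) + #taken O 1 f) free-0 ⟨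
    #taken O 0 (suc f)             ≡⟨ runPark-#taken 0 f k ℓ [] γ O run (InRange-monoˡ γ z≤n γ∈) ⟩
    #taken [] 0 (suc f) + length γ ≡⟨ cong (_+ length γ) (#taken-[] 0 (suc f)) ⟩
    length γ                       ∎))
  where open ≡-Reasoning

backScan-blocked : ∀ O lo p j → (∀ q → lo ≤ q → q < p → p ≤ q + j → free O q ≡ false) → backScan O lo p j ≡ nothing
backScan-blocked O lo p       zero    _       = refl
backScan-blocked O lo zero    (suc j) _       = refl
backScan-blocked O lo (suc p) (suc j) blocked with p <ᵇ lo in p<ᵇlo
... | true  = refl
... | false rewrite blocked p (<ᵇ≡false⇒≥ p lo p<ᵇlo) ≤-refl (≤-trans (s≤s (m≤m+n p j)) (≤-reflexive (sym (+-suc p j)))) =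
  backScan-blocked O lo p j (λ q lo≤q q<p p≤q+j →
    blocked q lo≤q (m<n⇒m<1+n q<p) (≤-trans (s≤s p≤q+j) (≤-reflexive (sym (+-suc q j)))))

backScan-finds : ∀ O lo p j q → lo ≤ q → q < p → p ≤ q + j → free O q ≡ true → is-just (backScan O lo p j) ≡ true
backScan-finds O lo p zero q _ q<p p≤q+0 _ = ⊥-elim (<-irrefl refl (<-≤-trans q<p (≤-trans p≤q+0 (≤-reflexive (+-identityʳ q)))))
backScan-finds O lo (suc p) (suc j) q lo≤q (s≤s q≤p) p≤q+j free-q
  rewrite ≥⇒<ᵇ≡false {p} {lo} (≤-trans lo≤q q≤p) with free O p in free-p
... | true  = refl
... | false with q ≟ p
...   | yes refl = ⊥-elim (true≢false (trans (sym free-q) free-p))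
...   | no q≢p   = backScan-finds O lo p j q lo≤q (≤∧≢⇒< q≤p q≢p) (≤-pred (≤-trans p≤q+j (≤-reflexive (+-suc q j)))) free-q

fwdScan-blocked : ∀ O hi q₀ f → (∀ q → q₀ ≤ q → q ≤ hi → free O q ≡ false) → fwdScan O hi q₀ f ≡ nothing
fwdScan-blocked O hi q₀ zero    _       = refl
fwdScan-blocked O hi q₀ (suc f) blocked with hi <ᵇ q₀ in hi<ᵇq₀
... | true  = refl
... | false rewrite blocked q₀ ≤-refl (<ᵇ≡false⇒≥ hi q₀ hi<ᵇq₀) =
  fwdScan-blocked O hi (suc q₀) f (λ q q₀<q q≤hi → blocked q (<⇒≤ q₀<q) q≤hi)

fwdScan-finds : ∀ O hi q₀ f q → q₀ ≤ q → q ≤ hi → q < q₀ + f → free O q ≡ true → is-just (fwdScan O hi q₀ f) ≡ true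
fwdScan-finds O hi q₀ zero    q q₀≤q _ q<q₀+0 _ = ⊥-elim (<-irrefl refl (≤-<-trans q₀≤q (≤-trans q<q₀+0 (≤-reflexive (+-identityʳ q₀)))))
fwdScan-finds O hi q₀ (suc f) q q₀≤q q≤hi q<q₀+f free-q rewrite ≥⇒<ᵇ≡false {hi} {q₀} (≤-trans q₀≤q q≤hi) with free O q₀ in free-q₀
... | true  = refl
... | false with q₀ ≟ q
...   | yes refl = ⊥-elim (true≢false (trans (sym free-q) free-q₀))
...   | no q₀≢q  = fwdScan-finds O hi (suc q₀) f q (≤∧≢⇒< q₀≤q q₀≢q) q≤hi (≤-trans q<q₀+f (≤-reflexive (+-suc q₀ f))) free-q

parkOutcome-back-finds : ∀ p b back fwd → is-just back ≡ true → is-just (parkOutcome p b back fwd) ≡ true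
parkOutcome-back-finds p true  back     fwd _ = refl
parkOutcome-back-finds p false (just x) fwd _ = refl

parkOutcome-fwd-finds : ∀ p b back fwd → is-just fwd ≡ true → is-just (parkOutcome p b back fwd) ≡ true
parkOutcome-fwd-finds p true  back     fwd _     = refl
parkOutcome-fwd-finds p false (just x) fwd _     = refl
parkOutcome-fwd-finds p false nothing  fwd found = found

landsOn : Maybe ℕ → ℕ → Bool
landsOn nothing  i = false
landsOn (just q) i = q ≡ᵇ i

landsOn-≢ : ∀ v i → v ≢ just i → landsOn v i ≡ false
landsOn-≢ nothing  i _   = refl
landsOn-≢ (just q) i v≢i = ≢⇒≡ᵇ≡false (v≢i ∘ cong just)

-- Failing on the street 1..c, backing into spot 0 of the street 0..d

parkCar-fails-when-full : ∀ c k ℓ O j → allTaken O 1 c ≡ true → 1 ≤ j → j ≤ c → parkCar 1 c k ℓ O j ≡ nothing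
parkCar-fails-when-full c k ℓ O j full 1≤j j≤c = begin
  parkCar 1 c k ℓ O j
    ≡⟨ parkCar≡parkOutcome 1 c k ℓ O j ⟩
  parkOutcome j (free O j) (backScan O 1 j k) (fwdScan O c (suc j) ℓ)
    ≡⟨ cong₂ (parkOutcome j (free O j))
             (backScan-blocked O 1 j k (λ q 1≤q q<j _ → taken-spot q 1≤q (≤-trans (<⇒≤ q<j) j≤c)))
             (fwdScan-blocked O c (suc j) ℓ (λ q j<q q≤c → taken-spot q (≤-trans 1≤j (<⇒≤ j<q)) q≤c)) ⟩
  parkOutcome j (free O j) nothing nothing
    ≡⟨ cong (λ b → parkOutcome j b nothing nothing) (taken-spot j 1≤j j≤c) ⟩
  nothing ∎
  where
  open ≡-Reasoning
  taken-spot : ∀ q → 1 ≤ q → q ≤ c → free O q ≡ false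
  taken-spot q 1≤q q≤c = allTaken⇒taken O 1 c full q 1≤q (s≤s q≤c)

parkCar-fails-past-last-gap : ∀ c k ℓ O e j → suc e ≤ c → c ≤ ℓ →
  free O (suc e) ≡ true → allTaken O (suc (suc e)) (c ∸ suc e) ≡ true → 1 ≤ j → j ≤ c →
  is-nothing (parkCar 1 c k ℓ O j) ≡ (suc e + k <ᵇ j)
parkCar-fails-past-last-gap c k ℓ O e j 1+e≤c c≤ℓ free-gap full 1≤j j≤c with j ≤? suc e
... | yes j≤1+e rewrite ≥⇒<ᵇ≡false {suc e + k} {j} (≤-trans j≤1+e (m≤m+n (suc e) k)) =
  cong not (trans (cong is-just (parkCar≡parkOutcome 1 c k ℓ O j)) finds)
  where
  finds : is-just (parkOutcome j (free O j) (backScan O 1 j k) (fwdScan O c (suc j) ℓ)) ≡ true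
  finds with j ≟ suc e
  ... | yes refl rewrite free-gap = refl
  ... | no j≢1+e = parkOutcome-fwd-finds j (free O j) _ _
          (fwdScan-finds O c (suc j) ℓ (suc e) (≤∧≢⇒< j≤1+e j≢1+e) 1+e≤c (s≤s (≤-trans 1+e≤c (≤-trans c≤ℓ (m≤n+m ℓ j)))) free-gap)
... | no j≰1+e with suc e + k <? j
...   | yes far rewrite <⇒<ᵇ≡true far = cong is-nothing (begin
  parkCar 1 c k ℓ O j
    ≡⟨ parkCar≡parkOutcome 1 c k ℓ O j ⟩
  parkOutcome j (free O j) (backScan O 1 j k) (fwdScan O c (suc j) ℓ)
    ≡⟨ cong₂ (parkOutcome j (free O j))
             (backScan-blocked O 1 j k (λ q _ q<j j≤q+k → taken-spot q (+-cancelʳ-< k (suc e) q (<-≤-trans far j≤q+k)) (≤-trans (<⇒≤ q<j) j≤c)))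
             (fwdScan-blocked O c (suc j) ℓ (λ q j<q q≤c → taken-spot q (<-trans (≰⇒> j≰1+e) j<q) q≤c)) ⟩
  parkOutcome j (free O j) nothing nothing
    ≡⟨ cong (λ b → parkOutcome j b nothing nothing) (taken-spot j (≰⇒> j≰1+e) j≤c) ⟩
  nothing ∎)
  where
  open ≡-Reasoning
  taken-spot : ∀ q → suc e < q → q ≤ c → free O q ≡ false
  taken-spot q 1+e<q q≤c = allTaken⇒taken O (suc (suc e)) (c ∸ suc e) full q 1+e<q
    (subst (λ z → q < suc z) (sym (m+[n∸m]≡n 1+e≤c)) (s≤s q≤c))
...   | no near rewrite ≥⇒<ᵇ≡false (≮⇒≥ near) =
  cong not (trans (cong is-just (parkCar≡parkOutcome 1 c k ℓ O j))
                  (parkOutcome-back-finds j (free O j) _ _ (backScan-finds O 1 j k (suc e) (s≤s z≤n) (≰⇒> j≰1+e) (≮⇒≥ near) free-gap)))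

parkCar-into0 : ∀ lo hi k ℓ O p → 1 ≤ p → parkCar lo hi k ℓ O p ≡ just 0 →
  free O p ≡ false × (∀ r → 0 < r → r < p → free O r ≡ false)
parkCar-into0 lo hi k ℓ O p 1≤p parks with parkCar-cases lo hi k ℓ O p 0 parks
... | parked-at-pref _ refl = ⊥-elim (<-irrefl refl 1≤p)
... | parked-behind taken back = taken , proj₂ (proj₂ (proj₂ (backScan-result O lo p k 0 back)))
... | parked-ahead _ _ fwd = case proj₁ (fwdScan-result O hi (suc p) ℓ 0 fwd) of λ ()

landsOn0-behind-full-prefix : ∀ d k ℓ O e j → free O 0 ≡ true → allTaken O 1 e ≡ true → 1 ≤ j → j ≤ e →
  landsOn (parkCar 0 d k ℓ O j) 0 ≡ (j ≤ᵇ k)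
landsOn0-behind-full-prefix d k ℓ O e j free-0 full 1≤j j≤e with j ≤? k
... | yes j≤k rewrite ≤⇒≤ᵇ≡true j≤k with backScan O 0 j k in back
...   | nothing = ⊥-elim (true≢false (trans (sym (backScan-finds O 0 j k 0 z≤n 1≤j j≤k free-0)) (cong is-just back)))
...   | just r with backScan-result O 0 j k r back
...     | _ , r<j , free-r , _ = begin
  landsOn (parkCar 0 d k ℓ O j) 0
    ≡⟨ cong (λ v → landsOn v 0) (parkCar≡parkOutcome 0 d k ℓ O j) ⟩
  landsOn (parkOutcome j (free O j) (backScan O 0 j k) (fwdScan O d (suc j) ℓ)) 0
    ≡⟨ cong₂ (λ b v → landsOn (parkOutcome j b v (fwdScan O d (suc j) ℓ)) 0) (taken-spot j 1≤j j≤e) back ⟩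
  r ≡ᵇ 0
    ≡⟨ cong (_≡ᵇ 0) (only-free-spot-is-0 r r<j free-r) ⟩
  true ∎
  where
  open ≡-Reasoning
  taken-spot : ∀ q → 1 ≤ q → q ≤ e → free O q ≡ false
  taken-spot q 1≤q q≤e = allTaken⇒taken O 1 e full q 1≤q (s≤s q≤e)
  only-free-spot-is-0 : ∀ r → r < j → free O r ≡ true → r ≡ 0
  only-free-spot-is-0 zero    _   _      = refl
  only-free-spot-is-0 (suc r) r<j free-r = ⊥-elim (true≢false (trans (sym free-r) (taken-spot (suc r) (s≤s z≤n) (≤-trans (<⇒≤ r<j) j≤e))))
landsOn0-behind-full-prefix d k ℓ O e j free-0 full 1≤j j≤e | no j≰k
  rewrite >⇒≤ᵇ≡false (≰⇒> j≰k) = landsOn-≢ _ 0 (not-ahead ∘ into0⇒ahead)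
  where
  taken-spot : ∀ q → 1 ≤ q → q ≤ e → free O q ≡ false
  taken-spot q 1≤q q≤e = allTaken⇒taken O 1 e full q 1≤q (s≤s q≤e)
  back-fails : backScan O 0 j k ≡ nothing
  back-fails = backScan-blocked O 0 j k (λ q _ q<j j≤q+k → taken-spot q (positive q j≤q+k) (≤-trans (<⇒≤ q<j) j≤e))
    where
    positive : ∀ q → j ≤ q + k → 1 ≤ q
    positive zero    j≤k = ⊥-elim (j≰k j≤k)
    positive (suc q) _   = s≤s z≤n
  into0⇒ahead : parkCar 0 d k ℓ O j ≡ just 0 → fwdScan O d (suc j) ℓ ≡ just 0
  into0⇒ahead into0 = trans (sym (trans (parkCar≡parkOutcome 0 d k ℓ O j)
    (cong₂ (λ b v → parkOutcome j b v (fwdScan O d (suc j) ℓ)) (taken-spot j 1≤j j≤e) back-fails))) into0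
  not-ahead : fwdScan O d (suc j) ℓ ≢ just 0
  not-ahead fwd = <-irrefl refl (≤-trans (s≤s z≤n) (proj₁ (fwdScan-result O d (suc j) ℓ 0 fwd)))

landsOn0-blocked-by-gap : ∀ d k ℓ O s j → 1 ≤ s → s ≤ j → free O s ≡ true → landsOn (parkCar 0 d k ℓ O j) 0 ≡ false
landsOn0-blocked-by-gap d k ℓ O s j 1≤s s≤j free-s = landsOn-≢ _ 0 gap-in-the-way
  where
  gap-in-the-way : parkCar 0 d k ℓ O j ≢ just 0
  gap-in-the-way into0 with parkCar-into0 0 d k ℓ O j (≤-trans 1≤s s≤j) into0
  ... | taken-j , taken-before with s ≟ j
  ...   | yes refl = true≢false (trans (sym free-s) taken-j)
  ...   | no s≢j   = true≢false (trans (sym free-s) (taken-before s 1≤s (≤∧≢⇒< s≤j s≢j)))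

-- Where the last car lands

parksOn : ℕ → ℕ → ℕ → List ℕ → ℕ
parksOn k ℓ c β = 𝟙 (is-just (runPark 1 c k ℓ [] β))

parksAvoiding0 : ℕ → ℕ → ℕ → List ℕ → ℕ
parksAvoiding0 k ℓ d γ = 𝟙 (spot0Free (runPark 0 d k ℓ [] γ))

#failing : ℕ → ℕ → ℕ → Maybe (List ℕ) → ℕ
#failing k ℓ c nothing  = 0
#failing k ℓ c (just O) = ∑[ t < c ] 𝟙 (is-nothing (parkCar 1 c k ℓ O (suc t)))

#into0 : ℕ → ℕ → ℕ → Maybe (List ℕ) → ℕ
#into0 k ℓ d nothing  = 0
#into0 k ℓ d (just O) = if free O 0 then ∑[ t < d ] 𝟙 (landsOn (parkCar 0 d k ℓ O (suc t)) 0) else 0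

#landing : ℕ → ℕ → ℕ → ℕ → Maybe (List ℕ) → ℕ
#landing k ℓ N i nothing  = 0
#landing k ℓ N i (just O) = ∑[ t < N ] 𝟙 (landsOn (parkCar 1 N k ℓ O (suc t)) i)

failuresAfter : ℕ → ℕ → ℕ → List ℕ → ℕ
failuresAfter k ℓ c β = #failing k ℓ c (runPark 1 c k ℓ [] β)

into0After : ℕ → ℕ → ℕ → List ℕ → ℕ
into0After k ℓ d γ = #into0 k ℓ d (runPark 0 d k ℓ [] γ)

#landing-≈ : ∀ k ℓ N i {M M′} → M ≈ᴹ M′ → #landing k ℓ N i M ≡ #landing k ℓ N i M′
#landing-≈ k ℓ N i nothing      = refl
#landing-≈ k ℓ N i (just O≈O′) = ∑<-cong N (λ t _ → cong (λ v → 𝟙 (landsOn v i)) (parkCar-≈ O≈O′ 1 N k ℓ (suc t)))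

#landing-keepIfFree : ∀ k ℓ N i M → 1 ≤ i → #landing k ℓ N i M ≡ #landing k ℓ N i (keepIfFree i M)
#landing-keepIfFree k ℓ N i nothing  _ = refl
#landing-keepIfFree k ℓ N i (just O) 1≤i with free O i in free-i
... | true  = refl
... | false = ∑<-0 N _ (λ t t<N → cong 𝟙 (landsOn-≢ _ i (λ lands →
  true≢false (trans (sym (proj₂ (proj₂ (parkCar-result 1 N k ℓ O (suc t) i (s≤s z≤n) t<N lands)))) free-i))))

landsOn-<∣> : ∀ v c → (∀ q → v ≡ just q → q ≤ c) → landsOn (v <∣> just (suc c)) (suc c) ≡ is-nothing v
landsOn-<∣> nothing  c _     = ≡ᵇ-refl (suc c)
landsOn-<∣> (just q) c q≤c = ≢⇒≡ᵇ≡false (λ q≡1+c → <-irrefl q≡1+c (s≤s (q≤c q refl)))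

landsOn-shift : ∀ a v → landsOn (Maybe.map (a +_) v) a ≡ landsOn v 0
landsOn-shift a nothing  = refl
landsOn-shift a (just q) = trans (cong (a + q ≡ᵇ_) (sym (+-identityʳ a))) (+-cancelˡ-≡ᵇ a q 0)

module _ (k ℓ c d : ℕ) {OL OR : List ℕ} (N≤ℓ : suc c + d ≤ ℓ) (OL∈ : InRange 1 c OL) (free-0 : free OR 0 ≡ true) where
  private
    N = suc c + d
    ORs = map (suc c +_) OR
    O = OL ++ ORs
    free-gap : free O (suc c) ≡ true
    free-gap = trans (free-++ OL ORs (suc c))
      (cong₂ _∧_ (InRange-free-above 1 c OL (suc c) OL∈ ≤-refl) (trans (free-shift₀ (suc c) OR) free-0))

  landsOn-gap-from-left : ∀ t → t < c →
    landsOn (parkCar 1 N k ℓ O (suc t)) (suc c) ≡ is-nothing (parkCar 1 c k ℓ OL (suc t))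
  landsOn-gap-from-left t t<c = begin
    landsOn (parkCar 1 N k ℓ O (suc t)) (suc c)
      ≡⟨ cong (λ v → landsOn v (suc c)) (parkCar-cut 1 N c k ℓ O (suc t) t<c (s≤s (m≤m+n c d)) (≤-trans (s≤s (m≤m+n c d)) N≤ℓ) free-gap) ⟩
    landsOn (parkCar 1 c k ℓ O (suc t) <∣> just (suc c)) (suc c)
      ≡⟨ cong (λ v → landsOn (v <∣> just (suc c)) (suc c)) (parkCar-agree 1 c k ℓ O OL agree (suc t) (s≤s z≤n) t<c) ⟩
    landsOn (parkCar 1 c k ℓ OL (suc t) <∣> just (suc c)) (suc c)
      ≡⟨ landsOn-<∣> (parkCar 1 c k ℓ OL (suc t)) c (λ q parks → proj₁ (proj₂ (parkCar-result 1 c k ℓ OL (suc t) q (s≤s z≤n) t<c parks))) ⟩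
    is-nothing (parkCar 1 c k ℓ OL (suc t)) ∎
    where
    open ≡-Reasoning
    agree : AgreeOn 1 c O OL
    agree q _ q≤c = trans (free-++ OL ORs q) (trans (cong (free OL q ∧_) (free-shift-below (suc c) OR q (s≤s q≤c))) (∧-identityʳ (free OL q)))

  landsOn-gap-at-gap : landsOn (parkCar 1 N k ℓ O (suc c)) (suc c) ≡ true
  landsOn-gap-at-gap = trans
    (cong (λ v → landsOn v (suc c)) (trans (parkCar≡parkOutcome 1 N k ℓ O (suc c))
      (cong (λ b → parkOutcome (suc c) b (backScan O 1 (suc c) k) (fwdScan O N (suc (suc c)) ℓ)) free-gap)))
    (≡ᵇ-refl (suc c))

  landsOn-gap-from-right : ∀ t → t < d →
    landsOn (parkCar 1 N k ℓ O (suc c + suc t)) (suc c) ≡ landsOn (parkCar 0 d k ℓ OR (suc t)) 0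
  landsOn-gap-from-right t t<d = begin
    landsOn (parkCar 1 N k ℓ O (suc c + suc t)) (suc c)
      ≡⟨ cong (λ v → landsOn v (suc c)) (parkCar-raise 1 (suc c) N k ℓ O (suc c + suc t) (s≤s z≤n) (m<m+n (suc c) z<s) free-gap) ⟩
    landsOn (parkCar (suc c) N k ℓ O (suc c + suc t)) (suc c)
      ≡⟨ cong (λ v → landsOn v (suc c)) (parkCar-agree (suc c) N k ℓ O ORs agree (suc c + suc t) (m≤m+n (suc c) (suc t)) (+-monoʳ-≤ (suc c) t<d)) ⟩
    landsOn (parkCar (suc c) N k ℓ ORs (suc c + suc t)) (suc c)
      ≡⟨ cong (λ v → landsOn v (suc c)) (parkCar-shift₀ (suc c) d k ℓ OR (suc t)) ⟩
    landsOn (Maybe.map (suc c +_) (parkCar 0 d k ℓ OR (suc t))) (suc c)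
      ≡⟨ landsOn-shift (suc c) (parkCar 0 d k ℓ OR (suc t)) ⟩
    landsOn (parkCar 0 d k ℓ OR (suc t)) 0 ∎
    where
    open ≡-Reasoning
    agree : AgreeOn (suc c) N O ORs
    agree q c<q _ = trans (free-++ OL ORs q) (cong (_∧ free ORs q) (InRange-free-above 1 c OL q OL∈ c<q))

  #landing-split : #landing k ℓ N (suc c) (just O)
                   ≡ #failing k ℓ c (just OL) + (1 + ∑[ t < d ] 𝟙 (landsOn (parkCar 0 d k ℓ OR (suc t)) 0))
  #landing-split = begin
    ∑< N lands                                                   ≡⟨ cong (λ z → ∑< z lands) (+-suc c d) ⟨
    ∑< (c + suc d) lands                                         ≡⟨ ∑<-split c (suc d) lands ⟩
    ∑< c lands + (lands (c + 0) + ∑[ t < d ] lands (c + suc t))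
      ≡⟨ cong₂ _+_ (∑<-cong c (λ t t<c → cong 𝟙 (landsOn-gap-from-left t t<c)))
                   (cong₂ _+_ (trans (cong (λ i → 𝟙 (landsOn (parkCar 1 N k ℓ O (suc i)) (suc c))) (+-identityʳ c))
                                     (cong 𝟙 landsOn-gap-at-gap))
                              (∑<-cong d (λ t t<d → cong 𝟙 (landsOn-gap-from-right t t<d)))) ⟩
    #failing k ℓ c (just OL) + (1 + ∑[ t < d ] 𝟙 (landsOn (parkCar 0 d k ℓ OR (suc t)) 0)) ∎
    where
    open ≡-Reasoning
    lands : ℕ → ℕ
    lands t = 𝟙 (landsOn (parkCar 1 N k ℓ O (suc t)) (suc c))

runPark-split-at : ∀ lo c d k ℓ α → lo ≤ 1 → suc c + d ≤ ℓ → InRange 1 (suc c + d) α → prefers (suc c) α ≡ false →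
  keepIfFree (suc c) (runPark lo (suc c + d) k ℓ [] α)
  ≈ᴹ zipWith _++_ (runPark lo c k ℓ [] (leftPrefs c α))
                  (keepIfFree (suc c) (Maybe.map (map (suc c +_)) (runPark 0 d k ℓ [] (rightPrefs c α))))
runPark-split-at lo c d k ℓ α lo≤1 N≤ℓ α∈ avoids =
  subst (λ R → keepIfFree (suc c) (runPark lo N k ℓ [] α) ≈ᴹ zipWith _++_ (runPark lo c k ℓ [] (leftPrefs c α)) (keepIfFree (suc c) R))
        (trans (cong (runPark (suc c) N k ℓ []) (sym (rightPrefs-shift c α))) (runPark-shift₀ (suc c) d k ℓ (rightPrefs c α)))
        (runPark-split lo N c k ℓ α [] [] [] (≤-trans lo≤1 (s≤s z≤n)) (s≤s (m≤m+n c d)) N≤ℓ (mk≈ (λ _ → refl)) [] []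
                       (InRange-monoˡ α lo≤1 α∈) avoids)
  where N = suc c + d

left-inRange : ∀ lo c d k ℓ α → lo ≤ 1 → InRange 1 (suc c + d) α →
  ∀ OL → runPark lo c k ℓ [] (leftPrefs c α) ≡ just OL → InRange lo c OL
left-inRange lo c d k ℓ α lo≤1 α∈ OL run =
  runPark-inRange lo c k ℓ [] (leftPrefs c α) OL run [] (InRange-monoˡ (leftPrefs c α) lo≤1 (InRange-leftPrefs c (suc c + d) α α∈))

#landing-zipWith : ∀ k c d ML MR → (∀ OL → ML ≡ just OL → InRange 1 c OL) →
  #landing k (suc c + d) (suc c + d) (suc c) (zipWith _++_ ML (keepIfFree (suc c) (Maybe.map (map (suc c +_)) MR)))
  ≡ 𝟙 (is-just ML) * 𝟙 (spot0Free MR) + #failing k (suc c + d) c ML * 𝟙 (spot0Free MR)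
    + 𝟙 (is-just ML) * #into0 k (suc c + d) d MR
#landing-zipWith k c d nothing   MR        _ = refl
#landing-zipWith k c d (just OL) nothing   _ = sym (trans (+-identityʳ _) (*-zeroʳ (#failing k (suc c + d) c (just OL))))
#landing-zipWith k c d (just OL) (just OR) OL∈ rewrite free-shift₀ (suc c) OR with free OR 0 in free-0
... | false = sym (trans (+-identityʳ _) (*-zeroʳ (#failing k (suc c + d) c (just OL))))
... | true  = trans (#landing-split k (suc c + d) c d ≤-refl (OL∈ OL refl) free-0)
                    (rearrange (#failing k (suc c + d) c (just OL)) _)
  where
  rearrange : ∀ a b → a + (1 + b) ≡ 1 + a * 1 + (b + 0)
  rearrange = solve 2 (λ a b → a :+ (con 1 :+ b) := con 1 :+ a :* con 1 :+ (b :+ con 0)) refl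

#landing≡⊗ : ∀ k c d α → InRange 1 (suc c + d) α →
  #landing k (suc c + d) (suc c + d) (suc c) (runPark 1 (suc c + d) k (suc c + d) [] α)
  ≡ (parksOn k (suc c + d) c ⊗[ c ] parksAvoiding0 k (suc c + d) d) α
    + (failuresAfter k (suc c + d) c ⊗[ c ] parksAvoiding0 k (suc c + d) d) α
    + (parksOn k (suc c + d) c ⊗[ c ] into0After k (suc c + d) d) α
#landing≡⊗ k c d α α∈ with prefers (suc c) α in prefers-gap
... | true = trans (#landing-keepIfFree k N N (suc c) (runPark 1 N k N [] α) (s≤s z≤n))
                   (cong (#landing k N N (suc c)) (keepIfFree-prefers 1 N k N [] α (suc c) prefers-gap))
  where N = suc c + d
... | false =
  trans (#landing-keepIfFree k N N (suc c) (runPark 1 N k N [] α) (s≤s z≤n))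
  (trans (#landing-≈ k N N (suc c) (runPark-split-at 1 c d k N α (s≤s z≤n) ≤-refl α∈ prefers-gap))
         (#landing-zipWith k c d (runPark 1 c k N [] (leftPrefs c α)) (runPark 0 d k N [] (rightPrefs c α))
                           (left-inRange 1 c d k N α ≤-refl α∈)))
  where N = suc c + d

𝟙-is-just≡∑-landsOn : ∀ k n O j → 1 ≤ j → j ≤ n →
  𝟙 (is-just (parkCar 1 n k n O j)) ≡ ∑[ i < n ] 𝟙 (landsOn (parkCar 1 n k n O j) (suc i))
𝟙-is-just≡∑-landsOn k n O j 1≤j j≤n = go (parkCar 1 n k n O j) refl
  where
  go : ∀ v → parkCar 1 n k n O j ≡ v → 𝟙 (is-just v) ≡ ∑[ i < n ] 𝟙 (landsOn v (suc i))
  go nothing        _     = sym (∑<-0 n _ (λ _ _ → refl))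
  go (just zero)    parks = case proj₁ (parkCar-result 1 n k n O j 0 1≤j j≤n parks) of λ ()
  go (just (suc q)) parks = sym (trans
    (∑<-select n _ q (proj₁ (proj₂ (parkCar-result 1 n k n O j (suc q) 1≤j j≤n parks)))
               (λ i _ i≢q → cong 𝟙 (≢⇒≡ᵇ≡false (i≢q ∘ sym))))
    (cong 𝟙 (≡ᵇ-refl q)))

is-just-continueRun : ∀ lo hi k ℓ O v → is-just (continueRun lo hi k ℓ O [] v) ≡ is-just v
is-just-continueRun lo hi k ℓ O nothing  = refl
is-just-continueRun lo hi k ℓ O (just q) = refl

numPF≡∑-#landing : ∀ k m′ n →
  numPF (suc m′) n k ≡ ∑[ i < n ] ∑Prefs m′ n (λ α → #landing k n n (suc i) (runPark 1 n k n [] α))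
numPF≡∑-#landing k m′ n = begin
  numPF (suc m′) n k
    ≡⟨ count≡sum-𝟙 (isNaplesPF n k) (allPrefs (suc m′) n) ⟩
  ∑Prefs (suc m′) n (𝟙 ∘ isNaplesPF n k)
    ≡⟨ ∑Prefs-snoc m′ n (𝟙 ∘ isNaplesPF n k) ⟩
  ∑Prefs m′ n (λ α → ∑[ t < n ] 𝟙 (isNaplesPF n k (α ++ suc t ∷ [])))
    ≡⟨ ∑Prefs-cong m′ n _ _ (λ α _ _ → by-last-spot α) ⟩
  ∑Prefs m′ n (λ α → ∑[ i < n ] #landing k n n (suc i) (runPark 1 n k n [] α))
    ≡⟨ ∑Prefs-∑< m′ n n (λ i α → #landing k n n (suc i) (runPark 1 n k n [] α)) ⟩
  ∑[ i < n ] ∑Prefs m′ n (λ α → #landing k n n (suc i) (runPark 1 n k n [] α)) ∎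
  where
  open ≡-Reasoning
  by-last-spot : ∀ α → ∑[ t < n ] 𝟙 (isNaplesPF n k (α ++ suc t ∷ [])) ≡ ∑[ i < n ] #landing k n n (suc i) (runPark 1 n k n [] α)
  by-last-spot α =
    trans (∑<-cong n (λ t _ → cong 𝟙 (trans (isPullbackPF≡is-just n k n (α ++ suc t ∷ [])) (cong is-just (runPark-snoc 1 n k n [] α (suc t))))))
          (go (runPark 1 n k n [] α))
    where
    go : ∀ M → ∑[ t < n ] 𝟙 (is-just (parkLast 1 n k n (suc t) M)) ≡ ∑[ i < n ] #landing k n n (suc i) M
    go nothing  = trans (∑<-0 n _ (λ _ _ → refl)) (sym (∑<-0 n _ (λ _ _ → refl)))
    go (just O) = trans (∑<-cong n (λ t t<n → trans (cong 𝟙 (is-just-continueRun 1 n k n O (parkCar 1 n k n O (suc t))))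
                                                    (𝟙-is-just≡∑-landsOn k n O (suc t) (s≤s z≤n) t<n)))
                        (∑<-comm n n (λ t i → 𝟙 (landsOn (parkCar 1 n k n O (suc t)) (suc i))))

∑Prefs-parksOn≡numPF : ∀ k ℓ c x → c ≤ ℓ → ∑Prefs x c (parksOn k ℓ c) ≡ numPF x c k
∑Prefs-parksOn≡numPF k ℓ c x c≤ℓ = sym (trans (count≡sum-𝟙 (isNaplesPF c k) (allPrefs x c))
  (∑Prefs-cong x c _ _ (λ β β∈ _ → cong 𝟙 (trans (isPullbackPF≡is-just c k c β)
    (cong is-just (runPark-ℓ-irrelevant 1 c k c ℓ c [] β β∈ (n≤1+n c) (≤-trans c≤ℓ (n≤1+n ℓ))))))))

∑Prefs-parksAvoiding0≡numC : ∀ k ℓ ℓC d y → d ≤ ℓ → d ≤ ℓC → ∑Prefs y d (parksAvoiding0 k ℓ d) ≡ numC y d k ℓC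
∑Prefs-parksAvoiding0≡numC k ℓ ℓC d y d≤ℓ d≤ℓC = sym (trans (count≡sum-𝟙 (isC d k ℓC) (allPrefs y d))
  (∑Prefs-cong y d _ _ (λ γ γ∈ _ → cong 𝟙 (trans (isC≡spot0Free d k ℓC γ)
    (cong spot0Free (runPark-ℓ-irrelevant 0 d k ℓC ℓ d [] γ γ∈ (≤-trans d≤ℓC (n≤1+n ℓC)) (≤-trans d≤ℓ (n≤1+n ℓ))))))))

∑Prefs-#landing : ∀ k m′ c d → let N = suc c + d in
  ∑Prefs m′ N (λ α → #landing k N N (suc c) (runPark 1 N k N [] α))
  ≡ ∑[ x < suc m′ ] ((m′ C x) * (∑Prefs x c (parksOn k N c) * ∑Prefs (m′ ∸ x) d (parksAvoiding0 k N d)))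
    + ∑[ x < suc m′ ] ((m′ C x) * (∑Prefs x c (failuresAfter k N c) * ∑Prefs (m′ ∸ x) d (parksAvoiding0 k N d)))
    + ∑[ x < suc m′ ] ((m′ C x) * (∑Prefs x c (parksOn k N c) * ∑Prefs (m′ ∸ x) d (into0After k N d)))
∑Prefs-#landing k m′ c d = begin
  ∑Prefs m′ N (λ α → #landing k N N (suc c) (runPark 1 N k N [] α))
    ≡⟨ ∑Prefs-cong m′ N _ _ (λ α α∈ _ → #landing≡⊗ k c d α α∈) ⟩
  ∑Prefs m′ N (λ α → F₁ α + F₂ α + F₃ α)
    ≡⟨ ∑Prefs-distrib-+ m′ N (λ α → F₁ α + F₂ α) F₃ ⟩
  ∑Prefs m′ N (λ α → F₁ α + F₂ α) + ∑Prefs m′ N F₃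
    ≡⟨ cong (_+ ∑Prefs m′ N F₃) (∑Prefs-distrib-+ m′ N F₁ F₂) ⟩
  ∑Prefs m′ N F₁ + ∑Prefs m′ N F₂ + ∑Prefs m′ N F₃
    ≡⟨ cong₂ _+_ (cong₂ _+_ (shuffle (parksOn k N c) (parksAvoiding0 k N d)) (shuffle (failuresAfter k N c) (parksAvoiding0 k N d)))
                 (shuffle (parksOn k N c) (into0After k N d)) ⟩
  _ ∎
  where
  open ≡-Reasoning
  N = suc c + d
  F₁ F₂ F₃ : List ℕ → ℕ
  F₁ = parksOn k N c ⊗[ c ] parksAvoiding0 k N d
  F₂ = failuresAfter k N c ⊗[ c ] parksAvoiding0 k N d
  F₃ = parksOn k N c ⊗[ c ] into0After k N d
  shuffle : ∀ G H → ∑Prefs m′ N (G ⊗[ c ] H) ≡ ∑[ x < suc m′ ] ((m′ C x) * (∑Prefs x c G * ∑Prefs (m′ ∸ x) d H))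
  shuffle G H = trans (cong (λ z → ∑Prefs m′ z (G ⊗[ c ] H)) (sym (+-suc c d))) (∑Prefs-⊗ m′ c d G H)

-- Counting by the position of the gap

∑<-𝟙[m<1+t]≡∸ : ∀ c m → ∑[ t < c ] 𝟙 (m <ᵇ suc t) ≡ c ∸ m
∑<-𝟙[m<1+t]≡∸ zero    m = sym (0∸n≡0 m)
∑<-𝟙[m<1+t]≡∸ (suc c) m = trans (∑<-last c _) (trans (cong (_+ 𝟙 (m <ᵇ suc c)) (∑<-𝟙[m<1+t]≡∸ c m)) last-step)
  where
  last-step : c ∸ m + 𝟙 (m <ᵇ suc c) ≡ suc c ∸ m
  last-step with m ≤? c
  ... | yes m≤c rewrite <⇒<ᵇ≡true (s≤s m≤c) = trans (+-comm _ 1) (sym (+-∸-assoc 1 m≤c))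
  ... | no m≰c rewrite ≥⇒<ᵇ≡false {m} {suc c} (≰⇒> m≰c) =
    trans (+-identityʳ _) (trans (m≤n⇒m∸n≡0 (<⇒≤ (≰⇒> m≰c))) (sym (m≤n⇒m∸n≡0 (≰⇒> m≰c))))

∑<-𝟙[t<m]≡⊓ : ∀ d m → ∑[ t < d ] 𝟙 (t <ᵇ m) ≡ d ⊓ m
∑<-𝟙[t<m]≡⊓ zero    m       = refl
∑<-𝟙[t<m]≡⊓ (suc d) zero    = ∑<-0 (suc d) _ (λ _ _ → refl)
∑<-𝟙[t<m]≡⊓ (suc d) (suc m) = cong suc (∑<-𝟙[t<m]≡⊓ d m)

lastGapAt : ℕ → ℕ → List ℕ → Bool
lastGapAt c e O = free O (suc e) ∧ allTaken O (suc (suc e)) (c ∸ suc e)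

firstGapAt : ℕ → List ℕ → Bool
firstGapAt e O = free O (suc e) ∧ allTaken O 1 e

last-gap-partition : ∀ O a c →
  𝟙 (allTaken O a c) + ∑[ e < c ] 𝟙 (free O (a + e) ∧ allTaken O (suc (a + e)) (c ∸ suc e)) ≡ 1
last-gap-partition O a zero    = refl
last-gap-partition O a (suc c) = begin
  𝟙 (taken O a ∧ X) + (𝟙 (free O (a + 0) ∧ allTaken O (suc (a + 0)) c) + Rest)
    ≡⟨ cong (λ u → 𝟙 (taken O a ∧ X) + (𝟙 (free O u ∧ allTaken O (suc u) c) + Rest)) (+-identityʳ a) ⟩
  𝟙 (taken O a ∧ X) + (𝟙 (free O a ∧ X) + Rest)
    ≡⟨ +-assoc (𝟙 (taken O a ∧ X)) _ Rest ⟨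
  (𝟙 (taken O a ∧ X) + 𝟙 (free O a ∧ X)) + Rest
    ≡⟨ cong (_+ Rest) (𝟙-split (free O a) X) ⟩
  𝟙 X + Rest
    ≡⟨ cong (𝟙 X +_) (∑<-cong c (λ e _ → cong (λ u → 𝟙 (free O u ∧ allTaken O (suc u) (c ∸ suc e))) (+-suc a e))) ⟩
  𝟙 X + ∑[ e < c ] 𝟙 (free O (suc a + e) ∧ allTaken O (suc (suc a + e)) (c ∸ suc e))
    ≡⟨ last-gap-partition O (suc a) c ⟩
  1 ∎
  where
  open ≡-Reasoning
  X = allTaken O (suc a) c
  Rest = ∑[ e < c ] 𝟙 (free O (a + suc e) ∧ allTaken O (suc (a + suc e)) (c ∸ suc e))
  𝟙-split : ∀ f x → 𝟙 (not f ∧ x) + 𝟙 (f ∧ x) ≡ 𝟙 x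
  𝟙-split true  x = refl
  𝟙-split false x = +-identityʳ (𝟙 x)

first-gap-partition : ∀ O d → 𝟙 (allTaken O 1 d) + ∑[ e < d ] 𝟙 (firstGapAt e O) ≡ 1
first-gap-partition O zero    = refl
first-gap-partition O (suc d) = begin
  𝟙 (allTaken O 1 (suc d)) + ∑< (suc d) gapAt
    ≡⟨ cong₂ (λ u v → 𝟙 u + v) (allTaken-snoc O 1 d) (∑<-last d gapAt) ⟩
  𝟙 (allTaken O 1 d ∧ taken O (suc d)) + (∑< d gapAt + gapAt d)
    ≡⟨ solve 3 (λ a s g → a :+ (s :+ g) := (a :+ g) :+ s) refl (𝟙 (allTaken O 1 d ∧ taken O (suc d))) (∑< d gapAt) (gapAt d) ⟩
  (𝟙 (allTaken O 1 d ∧ taken O (suc d)) + gapAt d) + ∑< d gapAt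
    ≡⟨ cong (_+ ∑< d gapAt) (𝟙-split (allTaken O 1 d) (free O (suc d))) ⟩
  𝟙 (allTaken O 1 d) + ∑< d gapAt
    ≡⟨ first-gap-partition O d ⟩
  1 ∎
  where
  open ≡-Reasoning
  gapAt : ℕ → ℕ
  gapAt e = 𝟙 (firstGapAt e O)
  𝟙-split : ∀ x f → 𝟙 (x ∧ not f) + 𝟙 (f ∧ x) ≡ 𝟙 x
  𝟙-split true  true  = refl
  𝟙-split true  false = refl
  𝟙-split false true  = refl
  𝟙-split false false = refl

distribute-over-partition : ∀ Λ a c (g : ℕ → ℕ) → a + ∑< c g ≡ 1 → Λ ≡ Λ * a + ∑[ e < c ] (Λ * g e)
distribute-over-partition Λ a c g partition = begin
  Λ                            ≡⟨ *-identityʳ Λ ⟨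
  Λ * 1                        ≡⟨ cong (Λ *_) partition ⟨
  Λ * (a + ∑< c g)             ≡⟨ *-distribˡ-+ Λ a _ ⟩
  Λ * a + Λ * ∑< c g           ≡⟨ cong (Λ * a +_) (*-distribˡ-∑< c Λ g) ⟨
  Λ * a + ∑[ e < c ] (Λ * g e) ∎
  where open ≡-Reasoning

*-𝟙-cong : ∀ b x y → (b ≡ true → x ≡ y) → x * 𝟙 b ≡ y * 𝟙 b
*-𝟙-cong true  x y x≡y = cong (_* 1) (x≡y refl)
*-𝟙-cong false x y _   = trans (*-zeroʳ x) (sym (*-zeroʳ y))

#failing-by-last-gap : ∀ k ℓ c O → c ≤ ℓ →
  #failing k ℓ c (just O) ≡ c * 𝟙 (allTaken O 1 c)
    + ∑[ e < c ] (((c ∸ suc e) ∸ k) * 𝟙 (lastGapAt c e O))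
#failing-by-last-gap k ℓ c O c≤ℓ =
  trans (distribute-over-partition Λ _ c _ (last-gap-partition O 1 c))
        (cong₂ _+_ (*-𝟙-cong _ Λ c full) (∑<-cong c (λ e e<c → *-𝟙-cong _ Λ _ (gap e e<c))))
  where
  Λ = #failing k ℓ c (just O)
  full : allTaken O 1 c ≡ true → Λ ≡ c
  full all = trans (∑<-cong c (λ t t<c → cong (𝟙 ∘ is-nothing) (parkCar-fails-when-full c k ℓ O (suc t) all (s≤s z≤n) t<c)))
                   (trans (∑<-const c 1) (*-identityʳ c))
  gap : ∀ e → e < c → lastGapAt c e O ≡ true → Λ ≡ (c ∸ suc e) ∸ k
  gap e e<c last-gap = begin
    Λ                                  ≡⟨ ∑<-cong c (λ t t<c → cong 𝟙 (parkCar-fails-past-last-gap c k ℓ O e (suc t) e<c c≤ℓ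
                                            (∧-conicalˡ _ _ last-gap) (∧-conicalʳ _ _ last-gap) (s≤s z≤n) t<c)) ⟩
    ∑[ t < c ] 𝟙 (suc e + k <ᵇ suc t)  ≡⟨ ∑<-𝟙[m<1+t]≡∸ c (suc e + k) ⟩
    c ∸ (suc e + k)                    ≡⟨ ∸-+-assoc c (suc e) k ⟨
    (c ∸ suc e) ∸ k                    ∎
    where open ≡-Reasoning

#into0-by-first-gap : ∀ k ℓ d O → free O 0 ≡ true →
  ∑[ t < d ] 𝟙 (landsOn (parkCar 0 d k ℓ O (suc t)) 0)
  ≡ (d ⊓ k) * 𝟙 (allTaken O 1 d) + ∑[ e < d ] ((e ⊓ k) * 𝟙 (firstGapAt e O))
#into0-by-first-gap k ℓ d O free-0 =
  trans (distribute-over-partition Λ _ d _ (first-gap-partition O d))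
        (cong₂ _+_ (*-𝟙-cong _ Λ (d ⊓ k) full) (∑<-cong d (λ e e<d → *-𝟙-cong _ Λ _ (gap e e<d))))
  where
  into0 : ℕ → ℕ
  into0 t = 𝟙 (landsOn (parkCar 0 d k ℓ O (suc t)) 0)
  Λ = ∑< d into0
  full : allTaken O 1 d ≡ true → Λ ≡ d ⊓ k
  full all = trans (∑<-cong d (λ t t<d → cong 𝟙 (landsOn0-behind-full-prefix d k ℓ O d (suc t) free-0 all (s≤s z≤n) t<d)))
                   (∑<-𝟙[t<m]≡⊓ d k)
  gap : ∀ e → e < d → firstGapAt e O ≡ true → Λ ≡ e ⊓ k
  gap e e<d first-gap = begin
    ∑< d into0                                     ≡⟨ cong (λ z → ∑< z into0) (m+[n∸m]≡n (<⇒≤ e<d)) ⟨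
    ∑< (e + (d ∸ e)) into0                         ≡⟨ ∑<-split e (d ∸ e) into0 ⟩
    ∑< e into0 + ∑[ t < d ∸ e ] into0 (e + t)
      ≡⟨ cong₂ _+_ (∑<-cong e (λ t t<e → cong 𝟙 (landsOn0-behind-full-prefix d k ℓ O e (suc t) free-0 (∧-conicalʳ _ _ first-gap) (s≤s z≤n) t<e)))
                   (∑<-0 (d ∸ e) _ (λ t _ → cong 𝟙 (landsOn0-blocked-by-gap d k ℓ O (suc e) (suc (e + t)) (s≤s z≤n) (s≤s (m≤m+n e t)) (∧-conicalˡ _ _ first-gap)))) ⟩
    ∑[ t < e ] 𝟙 (suc t ≤ᵇ k) + 0                 ≡⟨ +-identityʳ _ ⟩
    ∑[ t < e ] 𝟙 (t <ᵇ k)                         ≡⟨ ∑<-𝟙[t<m]≡⊓ e k ⟩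
    e ⊓ k                                          ∎
    where open ≡-Reasoning

onRun : (List ℕ → Bool) → Maybe (List ℕ) → ℕ
onRun P nothing  = 0
onRun P (just O) = 𝟙 (P O)

leftFullAfter : ℕ → ℕ → ℕ → List ℕ → ℕ
leftFullAfter k ℓ c β = onRun (λ O → allTaken O 1 c) (runPark 1 c k ℓ [] β)

lastGapAfter : ℕ → ℕ → ℕ → ℕ → List ℕ → ℕ
lastGapAfter k ℓ c e β = onRun (lastGapAt c e) (runPark 1 c k ℓ [] β)

rightFullAfter : ℕ → ℕ → ℕ → List ℕ → ℕ
rightFullAfter k ℓ d γ = onRun (λ O → free O 0 ∧ allTaken O 1 d) (runPark 0 d k ℓ [] γ)

firstGapAfter : ℕ → ℕ → ℕ → ℕ → List ℕ → ℕ
firstGapAfter k ℓ d e γ = onRun (λ O → free O 0 ∧ firstGapAt e O) (runPark 0 d k ℓ [] γ)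

∑Prefs-linear : ∀ a b c n (w : ℕ → ℕ) (f : List ℕ → ℕ) (g : ℕ → List ℕ → ℕ) →
  ∑Prefs a b (λ α → c * f α + ∑[ e < n ] (w e * g e α)) ≡ c * ∑Prefs a b f + ∑[ e < n ] (w e * ∑Prefs a b (g e))
∑Prefs-linear a b c n w f g = begin
  ∑Prefs a b (λ α → c * f α + ∑[ e < n ] (w e * g e α))
    ≡⟨ ∑Prefs-distrib-+ a b (λ α → c * f α) (λ α → ∑[ e < n ] (w e * g e α)) ⟩
  ∑Prefs a b (λ α → c * f α) + ∑Prefs a b (λ α → ∑[ e < n ] (w e * g e α))
    ≡⟨ cong₂ _+_ (*-distribˡ-∑Prefs a b c f) (∑Prefs-∑< a b n (λ e α → w e * g e α)) ⟩
  c * ∑Prefs a b f + ∑[ e < n ] ∑Prefs a b (λ α → w e * g e α)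
    ≡⟨ cong (c * ∑Prefs a b f +_) (∑<-cong n (λ e _ → *-distribˡ-∑Prefs a b (w e) (g e))) ⟩
  c * ∑Prefs a b f + ∑[ e < n ] (w e * ∑Prefs a b (g e)) ∎
  where open ≡-Reasoning

∑Prefs-failuresAfter : ∀ k ℓ c x → c ≤ ℓ →
  ∑Prefs x c (failuresAfter k ℓ c)
  ≡ c * ∑Prefs x c (leftFullAfter k ℓ c) + ∑[ e < c ] (((c ∸ suc e) ∸ k) * ∑Prefs x c (lastGapAfter k ℓ c e))
∑Prefs-failuresAfter k ℓ c x c≤ℓ =
  trans (∑Prefs-cong x c _ _ (λ β _ _ → by-gap (runPark 1 c k ℓ [] β)))
        (∑Prefs-linear x c c c (λ e → (c ∸ suc e) ∸ k) (leftFullAfter k ℓ c) (lastGapAfter k ℓ c))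
  where
  by-gap : ∀ M → #failing k ℓ c M ≡ c * onRun (λ O → allTaken O 1 c) M + ∑[ e < c ] (((c ∸ suc e) ∸ k) * onRun (lastGapAt c e) M)
  by-gap nothing  = sym (trans (cong₂ _+_ (*-zeroʳ c) (∑<-0 c _ (λ e _ → *-zeroʳ ((c ∸ suc e) ∸ k)))) refl)
  by-gap (just O) = #failing-by-last-gap k ℓ c O c≤ℓ

∑Prefs-into0After : ∀ k ℓ d y →
  ∑Prefs y d (into0After k ℓ d) ≡ (d ⊓ k) * ∑Prefs y d (rightFullAfter k ℓ d) + ∑[ e < d ] ((e ⊓ k) * ∑Prefs y d (firstGapAfter k ℓ d e))
∑Prefs-into0After k ℓ d y =
  trans (∑Prefs-cong y d _ _ (λ γ _ _ → by-gap (runPark 0 d k ℓ [] γ)))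
        (∑Prefs-linear y d (d ⊓ k) d (_⊓ k) (rightFullAfter k ℓ d) (firstGapAfter k ℓ d))
  where
  none : (d ⊓ k) * 0 + ∑[ e < d ] ((e ⊓ k) * 0) ≡ 0
  none = cong₂ _+_ (*-zeroʳ (d ⊓ k)) (∑<-0 d _ (λ e _ → *-zeroʳ (e ⊓ k)))
  by-gap : ∀ M → #into0 k ℓ d M ≡ (d ⊓ k) * onRun (λ O → free O 0 ∧ allTaken O 1 d) M
                                  + ∑[ e < d ] ((e ⊓ k) * onRun (λ O → free O 0 ∧ firstGapAt e O) M)
  by-gap nothing  = sym none
  by-gap (just O) with free O 0 in free-0
  ... | true  = #into0-by-first-gap k ℓ d O free-0
  ... | false = sym none

∑Prefs-leftFullAfter : ∀ k ℓ c x → c ≤ ℓ → ∑Prefs x c (leftFullAfter k ℓ c) ≡ 𝟙 (x ≡ᵇ c) * numPF x c k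
∑Prefs-leftFullAfter k ℓ c x c≤ℓ =
  trans (∑Prefs-cong x c _ _ pigeonhole)
        (trans (*-distribˡ-∑Prefs x c (𝟙 (x ≡ᵇ c)) (parksOn k ℓ c)) (cong (𝟙 (x ≡ᵇ c) *_) (∑Prefs-parksOn≡numPF k ℓ c x c≤ℓ)))
  where
  pigeonhole : ∀ β → InRange 1 c β → length β ≡ x → leftFullAfter k ℓ c β ≡ 𝟙 (x ≡ᵇ c) * parksOn k ℓ c β
  pigeonhole β β∈ |β| with runPark 1 c k ℓ [] β in run
  ... | nothing = sym (*-zeroʳ (𝟙 (x ≡ᵇ c)))
  ... | just O  = trans (cong 𝟙 (trans (runPark-allTaken k ℓ c β O run β∈) (cong (_≡ᵇ c) |β|))) (sym (*-identityʳ _))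

∑Prefs-rightFullAfter : ∀ k ℓ ℓC d y → d ≤ ℓ → d ≤ ℓC → ∑Prefs y d (rightFullAfter k ℓ d) ≡ 𝟙 (y ≡ᵇ d) * numC y d k ℓC
∑Prefs-rightFullAfter k ℓ ℓC d y d≤ℓ d≤ℓC =
  trans (∑Prefs-cong y d _ _ pigeonhole)
        (trans (*-distribˡ-∑Prefs y d (𝟙 (y ≡ᵇ d)) (parksAvoiding0 k ℓ d))
               (cong (𝟙 (y ≡ᵇ d) *_) (∑Prefs-parksAvoiding0≡numC k ℓ ℓC d y d≤ℓ d≤ℓC)))
  where
  pigeonhole : ∀ γ → InRange 1 d γ → length γ ≡ y → rightFullAfter k ℓ d γ ≡ 𝟙 (y ≡ᵇ d) * parksAvoiding0 k ℓ d γ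
  pigeonhole γ γ∈ |γ| with runPark 0 d k ℓ [] γ in run
  ... | nothing = sym (*-zeroʳ (𝟙 (y ≡ᵇ d)))
  ... | just O with free O 0 in free-0
  ...   | false = sym (*-zeroʳ (𝟙 (y ≡ᵇ d)))
  ...   | true  = trans (cong 𝟙 (trans (runPark-allTaken₀ k ℓ d γ O run γ∈ free-0) (cong (_≡ᵇ d) |γ|))) (sym (*-identityʳ _))

onRun-≈ : ∀ P → (∀ {O O′} → O ≈ O′ → P O ≡ P O′) → ∀ {M M′} → M ≈ᴹ M′ → onRun P M ≡ onRun P M′
onRun-≈ P P-≈ nothing       = refl
onRun-≈ P P-≈ (just O≈O′) = cong 𝟙 (P-≈ O≈O′)

onRun-keepIfFree : ∀ P s → (∀ O → free O s ≡ false → P O ≡ false) → ∀ M → onRun P M ≡ onRun P (keepIfFree s M)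
onRun-keepIfFree P s P⇒free nothing  = refl
onRun-keepIfFree P s P⇒free (just O) with free O s in free-s
... | true  = refl
... | false = cong 𝟙 (P⇒free O free-s)

allTaken-≈ : ∀ {O O′} → O ≈ O′ → ∀ a len → allTaken O a len ≡ allTaken O′ a len
allTaken-≈ {O} {O′} O≈O′ a len = allTaken-cong O O′ a a len (λ t _ → free≡ O≈O′ (a + t))

allTaken-++-shifted : ∀ OL OR a f → InRange 0 a OL →
  allTaken (OL ++ map (suc a +_) OR) (suc (suc a)) f ≡ allTaken OR 1 f
allTaken-++-shifted OL OR a f OL∈ = allTaken-cong (OL ++ ORs) OR (suc (suc a)) 1 f (λ t _ → begin
  free (OL ++ ORs) (suc (suc a) + t)                 ≡⟨ free-++ OL ORs (suc (suc a) + t) ⟩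
  free OL (suc (suc a) + t) ∧ free ORs (suc (suc a) + t)
    ≡⟨ cong₂ _∧_ (InRange-free-above 0 a OL _ OL∈ (s≤s (≤-trans (n≤1+n a) (m≤m+n (suc a) t))))
                 (cong (free ORs) (cong suc (sym (+-suc a t)))) ⟩
  true ∧ free ORs (suc a + suc t)                    ≡⟨ free-shift (suc a) OR (suc t) ⟩
  free OR (suc t)                                    ∎)
  where
  open ≡-Reasoning
  ORs = map (suc a +_) OR

lastGapAfter≡⊗ : ∀ k ℓ e f β → suc e + f ≤ ℓ → InRange 1 (suc e + f) β →
  lastGapAfter k ℓ (suc e + f) e β ≡ (parksOn k ℓ e ⊗[ e ] rightFullAfter k ℓ f) β
lastGapAfter≡⊗ k ℓ e f β c≤ℓ β∈ with prefers (suc e) β in prefers-gap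
... | true = trans (onRun-keepIfFree (lastGapAt c e) (suc e) (λ O taken → cong (_∧ allTaken O (suc (suc e)) (c ∸ suc e)) taken) (runPark 1 c k ℓ [] β))
                   (cong (onRun (lastGapAt c e)) (keepIfFree-prefers 1 c k ℓ [] β (suc e) prefers-gap))
  where c = suc e + f
... | false =
  trans (onRun-keepIfFree (lastGapAt c e) (suc e) (λ O taken → cong (_∧ allTaken O (suc (suc e)) (c ∸ suc e)) taken) (runPark 1 c k ℓ [] β))
  (trans (onRun-≈ (lastGapAt c e) (λ O≈O′ → cong₂ _∧_ (free≡ O≈O′ (suc e)) (allTaken-≈ O≈O′ (suc (suc e)) (c ∸ suc e)))
                  (runPark-split-at 1 e f k ℓ β ≤-refl c≤ℓ β∈ prefers-gap))
         (evaluate (runPark 1 e k ℓ [] (leftPrefs e β)) (runPark 0 f k ℓ [] (rightPrefs e β)) (left-inRange 1 e f k ℓ β ≤-refl β∈)))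
  where
  c = suc e + f
  evaluate : ∀ ML MR → (∀ OL → ML ≡ just OL → InRange 1 e OL) →
    onRun (lastGapAt c e) (zipWith _++_ ML (keepIfFree (suc e) (Maybe.map (map (suc e +_)) MR)))
    ≡ 𝟙 (is-just ML) * onRun (λ O → free O 0 ∧ allTaken O 1 f) MR
  evaluate nothing   MR        _ = refl
  evaluate (just OL) nothing   _ = refl
  evaluate (just OL) (just OR) OL∈ rewrite free-shift₀ (suc e) OR with free OR 0 in free-0
  ... | false = refl
  ... | true  = trans (cong₂ (λ u v → 𝟙 (u ∧ v)) free-gap rest-full) (sym (+-identityʳ _))
    where
    ORs = map (suc e +_) OR
    free-gap : free (OL ++ ORs) (suc e) ≡ true
    free-gap = trans (free-++ OL ORs (suc e))
                     (cong₂ _∧_ (InRange-free-above 1 e OL (suc e) (OL∈ OL refl) ≤-refl) (trans (free-shift₀ (suc e) OR) free-0))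
    rest-full : allTaken (OL ++ ORs) (suc (suc e)) (c ∸ suc e) ≡ allTaken OR 1 f
    rest-full = trans (cong (allTaken (OL ++ ORs) (suc (suc e))) (m+n∸m≡n (suc e) f))
                      (allTaken-++-shifted OL OR e f (InRange-monoˡ OL z≤n (OL∈ OL refl)))

firstGapAfter≡⊗ : ∀ k ℓ e f γ → suc e + f ≤ ℓ → InRange 1 (suc e + f) γ →
  firstGapAfter k ℓ (suc e + f) e γ ≡ (rightFullAfter k ℓ e ⊗[ e ] parksAvoiding0 k ℓ f) γ
firstGapAfter≡⊗ k ℓ e f γ d≤ℓ γ∈ with prefers (suc e) γ in prefers-gap
... | true = trans (onRun-keepIfFree P (suc e) P⇒free (runPark 0 d k ℓ [] γ))
                   (cong (onRun P) (keepIfFree-prefers 0 d k ℓ [] γ (suc e) prefers-gap))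
  where
  d = suc e + f
  P : List ℕ → Bool
  P O = free O 0 ∧ firstGapAt e O
  P⇒free : ∀ O → free O (suc e) ≡ false → P O ≡ false
  P⇒free O taken rewrite taken = ∧-zeroʳ (free O 0)
... | false =
  trans (onRun-keepIfFree P (suc e) P⇒free (runPark 0 d k ℓ [] γ))
  (trans (onRun-≈ P (λ O≈O′ → cong₂ _∧_ (free≡ O≈O′ 0) (cong₂ _∧_ (free≡ O≈O′ (suc e)) (allTaken-≈ O≈O′ 1 e)))
                  (runPark-split-at 0 e f k ℓ γ z≤n d≤ℓ γ∈ prefers-gap))
         (evaluate (runPark 0 e k ℓ [] (leftPrefs e γ)) (runPark 0 f k ℓ [] (rightPrefs e γ)) (left-inRange 0 e f k ℓ γ z≤n γ∈)))
  where
  d = suc e + f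
  P : List ℕ → Bool
  P O = free O 0 ∧ firstGapAt e O
  P⇒free : ∀ O → free O (suc e) ≡ false → P O ≡ false
  P⇒free O taken rewrite taken = ∧-zeroʳ (free O 0)
  evaluate : ∀ ML MR → (∀ OL → ML ≡ just OL → InRange 0 e OL) →
    onRun P (zipWith _++_ ML (keepIfFree (suc e) (Maybe.map (map (suc e +_)) MR)))
    ≡ onRun (λ O → free O 0 ∧ allTaken O 1 e) ML * 𝟙 (spot0Free MR)
  evaluate nothing   MR        _ = refl
  evaluate (just OL) nothing   _ = sym (*-zeroʳ (onRun (λ O → free O 0 ∧ allTaken O 1 e) (just OL)))
  evaluate (just OL) (just OR) OL∈ rewrite free-shift₀ (suc e) OR with free OR 0 in free-0
  ... | false = sym (*-zeroʳ (onRun (λ O → free O 0 ∧ allTaken O 1 e) (just OL)))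
  ... | true  = trans (cong₂ (λ u v → 𝟙 (u ∧ v)) free-0-left (cong₂ _∧_ free-gap left-full)) (sym (*-identityʳ _))
    where
    ORs = map (suc e +_) OR
    below-ORs : ∀ q → q ≤ e → free (OL ++ ORs) q ≡ free OL q
    below-ORs q q≤e = trans (free-++ OL ORs q) (trans (cong (free OL q ∧_) (free-shift-below (suc e) OR q (s≤s q≤e))) (∧-identityʳ _))
    free-0-left : free (OL ++ ORs) 0 ≡ free OL 0
    free-0-left = below-ORs 0 z≤n
    free-gap : free (OL ++ ORs) (suc e) ≡ true
    free-gap = trans (free-++ OL ORs (suc e))
                     (cong₂ _∧_ (InRange-free-above 0 e OL (suc e) (OL∈ OL refl) ≤-refl) (trans (free-shift₀ (suc e) OR) free-0))
    left-full : allTaken (OL ++ ORs) 1 e ≡ allTaken OL 1 e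
    left-full = allTaken-cong (OL ++ ORs) OL 1 1 e (λ t t<e → below-ORs (suc t) t<e)

∑Prefs-lastGapAfter : ∀ k ℓ ℓC c e x → e < c → c ≤ ℓ → c ≤ ℓC →
  ∑Prefs x c (lastGapAfter k ℓ c e)
  ≡ ∑[ y < suc x ] ((x C y) * (numPF y e k * (𝟙 ((x ∸ y) ≡ᵇ (c ∸ suc e)) * numC (x ∸ y) (c ∸ suc e) k ℓC)))
∑Prefs-lastGapAfter k ℓ ℓC c e x e<c c≤ℓ c≤ℓC = begin
  ∑Prefs x c (lastGapAfter k ℓ c e)
    ≡⟨ cong (λ c′ → ∑Prefs x c′ (lastGapAfter k ℓ c′ e)) (sym split-c) ⟩
  ∑Prefs x (suc e + f) (lastGapAfter k ℓ (suc e + f) e)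
    ≡⟨ ∑Prefs-cong x (suc e + f) _ _ (λ β β∈ _ → lastGapAfter≡⊗ k ℓ e f β (subst (_≤ ℓ) (sym split-c) c≤ℓ) β∈) ⟩
  ∑Prefs x (suc e + f) (parksOn k ℓ e ⊗[ e ] rightFullAfter k ℓ f)
    ≡⟨ cong (λ z → ∑Prefs x z (parksOn k ℓ e ⊗[ e ] rightFullAfter k ℓ f)) (sym (+-suc e f)) ⟩
  ∑Prefs x (e + suc f) (parksOn k ℓ e ⊗[ e ] rightFullAfter k ℓ f)
    ≡⟨ ∑Prefs-⊗ x e f (parksOn k ℓ e) (rightFullAfter k ℓ f) ⟩
  ∑[ y < suc x ] ((x C y) * (∑Prefs y e (parksOn k ℓ e) * ∑Prefs (x ∸ y) f (rightFullAfter k ℓ f)))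
    ≡⟨ ∑<-cong (suc x) (λ y _ → cong ((x C y) *_) (cong₂ _*_
         (∑Prefs-parksOn≡numPF k ℓ e y (≤-trans (<⇒≤ e<c) c≤ℓ))
         (∑Prefs-rightFullAfter k ℓ ℓC f (x ∸ y) (≤-trans (m∸n≤m c (suc e)) c≤ℓ) (≤-trans (m∸n≤m c (suc e)) c≤ℓC)))) ⟩
  ∑[ y < suc x ] ((x C y) * (numPF y e k * (𝟙 ((x ∸ y) ≡ᵇ f) * numC (x ∸ y) f k ℓC))) ∎
  where
  open ≡-Reasoning
  f = c ∸ suc e
  split-c : suc e + f ≡ c
  split-c = m+[n∸m]≡n e<c

∑Prefs-firstGapAfter : ∀ k ℓ ℓC d e y → e < d → d ≤ ℓ → d ≤ ℓC →
  ∑Prefs y d (firstGapAfter k ℓ d e)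
  ≡ ∑[ r < suc y ] ((y C r) * ((𝟙 (r ≡ᵇ e) * numC r e k ℓC) * numC (y ∸ r) (d ∸ suc e) k ℓC))
∑Prefs-firstGapAfter k ℓ ℓC d e y e<d d≤ℓ d≤ℓC = begin
  ∑Prefs y d (firstGapAfter k ℓ d e)
    ≡⟨ cong (λ d′ → ∑Prefs y d′ (firstGapAfter k ℓ d′ e)) (sym split-d) ⟩
  ∑Prefs y (suc e + f) (firstGapAfter k ℓ (suc e + f) e)
    ≡⟨ ∑Prefs-cong y (suc e + f) _ _ (λ γ γ∈ _ → firstGapAfter≡⊗ k ℓ e f γ (subst (_≤ ℓ) (sym split-d) d≤ℓ) γ∈) ⟩
  ∑Prefs y (suc e + f) (rightFullAfter k ℓ e ⊗[ e ] parksAvoiding0 k ℓ f)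
    ≡⟨ cong (λ z → ∑Prefs y z (rightFullAfter k ℓ e ⊗[ e ] parksAvoiding0 k ℓ f)) (sym (+-suc e f)) ⟩
  ∑Prefs y (e + suc f) (rightFullAfter k ℓ e ⊗[ e ] parksAvoiding0 k ℓ f)
    ≡⟨ ∑Prefs-⊗ y e f (rightFullAfter k ℓ e) (parksAvoiding0 k ℓ f) ⟩
  ∑[ r < suc y ] ((y C r) * (∑Prefs r e (rightFullAfter k ℓ e) * ∑Prefs (y ∸ r) f (parksAvoiding0 k ℓ f)))
    ≡⟨ ∑<-cong (suc y) (λ r _ → cong ((y C r) *_) (cong₂ _*_
         (∑Prefs-rightFullAfter k ℓ ℓC e r (≤-trans (<⇒≤ e<d) d≤ℓ) (≤-trans (<⇒≤ e<d) d≤ℓC))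
         (∑Prefs-parksAvoiding0≡numC k ℓ ℓC f (y ∸ r) (≤-trans (m∸n≤m d (suc e)) d≤ℓ) (≤-trans (m∸n≤m d (suc e)) d≤ℓC)))) ⟩
  ∑[ r < suc y ] ((y C r) * ((𝟙 (r ≡ᵇ e) * numC r e k ℓC) * numC (y ∸ r) f k ℓC)) ∎
  where
  open ≡-Reasoning
  f = d ∸ suc e
  split-d : suc e + f ≡ d
  split-d = m+[n∸m]≡n e<d

∑C-select : ∀ m s (F : ℕ → ℕ) → ∑[ x < suc m ] ((m C x) * (𝟙 (x ≡ᵇ s) * F x)) ≡ (m C s) * F s
∑C-select m s F = by-cases (s ≤? m)
  where
  vanish : ∀ x → x ≢ s → (m C x) * (𝟙 (x ≡ᵇ s) * F x) ≡ 0
  vanish x x≢s rewrite ≢⇒≡ᵇ≡false x≢s = *-zeroʳ (m C x)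
  by-cases : Dec (s ≤ m) → ∑[ x < suc m ] ((m C x) * (𝟙 (x ≡ᵇ s) * F x)) ≡ (m C s) * F s
  by-cases (yes s≤m) = trans (∑<-select (suc m) _ s (s≤s s≤m) (λ x _ → vanish x))
    (trans (cong (λ b → (m C s) * (𝟙 b * F s)) (≡ᵇ-refl s)) (cong ((m C s) *_) (+-identityʳ (F s))))
  by-cases (no s≰m) = trans (∑<-0 (suc m) _ (λ x x≤m → vanish x (λ x≡s → s≰m (subst (_≤ m) x≡s (≤-pred x≤m)))))
                            (sym (cong (_* F s) (k>n⇒nCk≡0 (≰⇒> s≰m))))

∑C-select-complement : ∀ m s (F : ℕ → ℕ) →
  ∑[ x < suc m ] ((m C x) * (𝟙 ((m ∸ x) ≡ᵇ s) * F x)) ≡ (m C s) * F (m ∸ s)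
∑C-select-complement m s F = begin
  ∑[ x < suc m ] ((m C x) * (𝟙 ((m ∸ x) ≡ᵇ s) * F x))
    ≡⟨ ∑<-reverse (suc m) (λ x → (m C x) * (𝟙 ((m ∸ x) ≡ᵇ s) * F x)) ⟩
  ∑[ t < suc m ] ((m C (m ∸ t)) * (𝟙 ((m ∸ (m ∸ t)) ≡ᵇ s) * F (m ∸ t)))
    ≡⟨ ∑<-cong (suc m) (λ t t≤m → cong₂ (λ a b → a * (𝟙 (b ≡ᵇ s) * F (m ∸ t)))
                                       (sym (nCk≡nC[n∸k] (≤-pred t≤m))) (m∸[m∸n]≡n (≤-pred t≤m))) ⟩
  ∑[ t < suc m ] ((m C t) * (𝟙 (t ≡ᵇ s) * F (m ∸ t)))
    ≡⟨ ∑C-select m s (λ t → F (m ∸ t)) ⟩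
  (m C s) * F (m ∸ s) ∎
  where open ≡-Reasoning

∑C-select-shifted : ∀ m y f (g : ℕ → ℕ) → y ≤ m →
  ∑[ x < suc m ] ((m C x) * ((x C y) * (𝟙 ((x ∸ y) ≡ᵇ f) * g x))) ≡ (m C y) * ((m ∸ y) C f) * g (y + f)
∑C-select-shifted m y f g y≤m = by-cases (y + f ≤? m)
  where
  open ≡-Reasoning
  term : ℕ → ℕ
  term x = (m C x) * ((x C y) * (𝟙 ((x ∸ y) ≡ᵇ f) * g x))
  term-vanish : ∀ x → y + f ≢ x → term x ≡ 0
  term-vanish x y+f≢x with y ≤? x
  ... | no y≰x rewrite k>n⇒nCk≡0 (≰⇒> y≰x) = *-zeroʳ (m C x)
  ... | yes y≤x rewrite ≢⇒≡ᵇ≡false {x ∸ y} {f} (λ x∸y≡f → y+f≢x (trans (cong (y +_) (sym x∸y≡f)) (m+[n∸m]≡n y≤x)))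
                      | *-zeroʳ (x C y) = *-zeroʳ (m C x)
  by-cases : Dec (y + f ≤ m) → ∑< (suc m) term ≡ (m C y) * ((m ∸ y) C f) * g (y + f)
  by-cases (yes y+f≤m) = begin
    ∑< (suc m) term
      ≡⟨ ∑<-select (suc m) term (y + f) (s≤s y+f≤m) (λ x _ x≢y+f → term-vanish x (x≢y+f ∘ sym)) ⟩
    (m C (y + f)) * (((y + f) C y) * (𝟙 ((y + f ∸ y) ≡ᵇ f) * g (y + f)))
      ≡⟨ cong (λ u → (m C (y + f)) * (((y + f) C y) * (𝟙 (u ≡ᵇ f) * g (y + f)))) (m+n∸m≡n y f) ⟩
    (m C (y + f)) * (((y + f) C y) * (𝟙 (f ≡ᵇ f) * g (y + f)))
      ≡⟨ cong (λ u → (m C (y + f)) * (((y + f) C y) * (𝟙 u * g (y + f)))) (≡ᵇ-refl f) ⟩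
    (m C (y + f)) * (((y + f) C y) * (1 * g (y + f)))
      ≡⟨ solve 3 (λ p q a → p :* (q :* (con 1 :* a)) := p :* q :* a) refl (m C (y + f)) ((y + f) C y) (g (y + f)) ⟩
    (m C (y + f)) * ((y + f) C y) * g (y + f)
      ≡⟨ cong (_* g (y + f)) (nC[x+r]*[x+r]Cx≡nCx*[n∸x]Cr m y f y+f≤m) ⟩
    (m C y) * ((m ∸ y) C f) * g (y + f) ∎
  by-cases (no y+f≰m) = begin
    ∑< (suc m) term
      ≡⟨ ∑<-0 (suc m) term (λ x x≤m → term-vanish x (λ y+f≡x → y+f≰m (subst (_≤ m) (sym y+f≡x) (≤-pred x≤m)))) ⟩
    0
      ≡⟨ cong (_* g (y + f)) (trans (cong ((m C y) *_) (k>n⇒nCk≡0 m∸y<f)) (*-zeroʳ (m C y))) ⟨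
    (m C y) * ((m ∸ y) C f) * g (y + f) ∎
    where
    m∸y<f : m ∸ y < f
    m∸y<f = +-cancelˡ-< y (m ∸ y) f (subst (_< y + f) (sym (m+[n∸m]≡n y≤m)) (≰⇒> y+f≰m))

∑C-∑C-collapse : ∀ m f (A B : ℕ → ℕ) K →
  ∑[ x < suc m ] ((m C x) * (∑[ y < suc x ] ((x C y) * (A y * (𝟙 ((x ∸ y) ≡ᵇ f) * K))) * B (m ∸ x)))
  ≡ ∑[ y < suc m ] ((m C y) * ((m ∸ y) C f) * A y * K * B (m ∸ y ∸ f))
∑C-∑C-collapse m f A B K = begin
  ∑[ x < suc m ] ((m C x) * (∑< (suc x) (g x) * B (m ∸ x)))
    ≡⟨ ∑<-cong (suc m) (λ x x≤m → cong (λ z → (m C x) * (z * B (m ∸ x)))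
         (∑<-extend (suc x) (suc m) (g x) x≤m (λ y x<y _ → cong (_* (A y * (𝟙 ((x ∸ y) ≡ᵇ f) * K))) (k>n⇒nCk≡0 x<y)))) ⟩
  ∑[ x < suc m ] ((m C x) * (∑[ y < suc m ] g x y * B (m ∸ x)))
    ≡⟨ ∑<-cong (suc m) (λ x _ → cong ((m C x) *_) (*-distribʳ-∑< (suc m) (B (m ∸ x)) (g x))) ⟨
  ∑[ x < suc m ] ((m C x) * ∑[ y < suc m ] (g x y * B (m ∸ x)))
    ≡⟨ ∑<-∑<-*ˡ (suc m) (suc m) (m C_) (λ y x → g x y * B (m ∸ x)) ⟨
  ∑[ y < suc m ] ∑[ x < suc m ] ((m C x) * (g x y * B (m ∸ x)))
    ≡⟨ ∑<-cong (suc m) (λ y y≤m → trans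
         (∑<-cong (suc m) (λ x _ → solve 6 (λ p q a i k b → p :* ((q :* (a :* (i :* k))) :* b) := p :* (q :* (i :* (a :* k :* b)))) refl
                                            (m C x) (x C y) (A y) (𝟙 ((x ∸ y) ≡ᵇ f)) K (B (m ∸ x))))
         (∑C-select-shifted m y f (λ x → A y * K * B (m ∸ x)) (≤-pred y≤m))) ⟩
  ∑[ y < suc m ] ((m C y) * ((m ∸ y) C f) * (A y * K * B (m ∸ (y + f))))
    ≡⟨ ∑<-cong (suc m) (λ y _ → trans (cong (λ z → (m C y) * ((m ∸ y) C f) * (A y * K * B z)) (sym (∸-+-assoc m y f)))
                                       (solve 5 (λ p q a k b → p :* q :* (a :* k :* b) := p :* q :* a :* k :* b) refl
                                                (m C y) ((m ∸ y) C f) (A y) K (B (m ∸ y ∸ f)))) ⟩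
  ∑[ y < suc m ] ((m C y) * ((m ∸ y) C f) * A y * K * B (m ∸ y ∸ f)) ∎
  where
  open ≡-Reasoning
  g : ℕ → ℕ → ℕ
  g x y = (x C y) * (A y * (𝟙 ((x ∸ y) ≡ᵇ f) * K))

𝟙-≡ᵇ-subst : ∀ u v (F : ℕ → ℕ) → 𝟙 (u ≡ᵇ v) * F u ≡ 𝟙 (u ≡ᵇ v) * F v
𝟙-≡ᵇ-subst u v F with u ≟ v
... | yes refl = refl
... | no u≢v rewrite ≢⇒≡ᵇ≡false u≢v = refl

[1+c+d]∸R∸[1+c]∸1≡d∸[1+R] : ∀ c d R → R ≤ d → suc c + d ∸ R ∸ suc c ∸ 1 ≡ d ∸ suc R
[1+c+d]∸R∸[1+c]∸1≡d∸[1+R] c d R R≤d = begin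
  suc c + d ∸ R ∸ suc c ∸ 1     ≡⟨ cong (λ z → z ∸ suc c ∸ 1) (+-∸-assoc (suc c) R≤d) ⟩
  suc c + (d ∸ R) ∸ suc c ∸ 1   ≡⟨ cong (_∸ 1) (m+n∸m≡n (suc c) (d ∸ R)) ⟩
  d ∸ R ∸ 1                     ≡⟨ ∸-+-assoc d R 1 ⟩
  d ∸ (R + 1)                   ≡⟨ cong (d ∸_) (+-comm R 1) ⟩
  d ∸ suc R                     ∎
  where open ≡-Reasoning

c∸[1+[c∸[1+R]]]≡R : ∀ {c R} → R < c → c ∸ suc (c ∸ suc R) ≡ R
c∸[1+[c∸[1+R]]]≡R {c} R<c = trans (cong (c ∸_) (sym (+-∸-assoc 1 R<c))) (m∸[m∸n]≡n (<⇒≤ R<c))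

[1+[c∸1]]∸[k+1]≡c∸[1+k] : ∀ c k → suc (c ∸ 1) ∸ (k + 1) ≡ c ∸ suc k
[1+[c∸1]]∸[k+1]≡c∸[1+k] zero    k = trans (cong (1 ∸_) (+-comm k 1)) (0∸n≡0 k)
[1+[c∸1]]∸[k+1]≡c∸[1+k] (suc c) k = cong (suc c ∸_) (+-comm k 1)

[1+c]∸R∸2≡c∸[1+R] : ∀ c R → suc c ∸ R ∸ 2 ≡ c ∸ suc R
[1+c]∸R∸2≡c∸[1+R] c R = trans (∸-+-assoc (suc c) R 2) (cong (suc c ∸_) (+-comm R 2))

[1+m+[1+c]]∸1∸[1+c+d]≡m∸d : ∀ m c d → suc m + suc c ∸ 1 ∸ (suc c + d) ≡ m ∸ d
[1+m+[1+c]]∸1∸[1+c+d]≡m∸d m c d = trans (cong (_∸ (suc c + d)) (+-comm m (suc c))) ([m+n]∸[m+o]≡n∸o (suc c) m d)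

termX termY : ℕ → ℕ → ℕ → ℕ → ℕ
termX m n k i = ((m ∸ 1) C (n ∸ i)) * numPF (m + i ∸ 1 ∸ n) (i ∸ 1) k * numC (n ∸ i) (n ∸ i) k (n ∸ 1) * (k ⊓ (n ∸ i))
termY m n k i = ((m ∸ 1) C (i ∸ 1)) * numPF (i ∸ 1) (i ∸ 1) k * numC (m ∸ i) (n ∸ i) k (n ∸ 1) * (i ∸ 1)

termZ : ℕ → ℕ → ℕ → ℕ → ℕ → ℕ
termZ m n k i x = ((m ∸ 1) C x) * numPF x (i ∸ 1) k * numC (m ∸ 1 ∸ x) (n ∸ i) k (n ∸ 1)

termV termW : ℕ → ℕ → ℕ → ℕ → ℕ → ℕ → ℕ
termV m n k i x R = ((m ∸ 1) C x) * numPF x (i ∸ 1) k * ((m ∸ 1 ∸ x) C R) * numC R R k (n ∸ 1)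
                    * numC (m ∸ 1 ∸ x ∸ R) (n ∸ R ∸ i ∸ 1) k (n ∸ 1) * (R ⊓ k)
termW m n k i x R = ((m ∸ 1) C x) * numPF x (i ∸ R ∸ 2) k * ((m ∸ 1 ∸ x) C R) * numC R R k (n ∸ 1)
                    * numC (m ∸ 1 ∸ x ∸ R) (n ∸ i) k (n ∸ 1) * (R ∸ k)

spotTerm : ℕ → ℕ → ℕ → ℕ → ℕ
spotTerm m n k i = termX m n k i + termY m n k i
  + sumFromTo 0 (m ∸ 1) (λ x → termZ m n k i x + sumFromTo 1 (n ∸ i ∸ 1) (termV m n k i x)
                                               + sumFromTo (k + 1) (i ∸ 2) (termW m n k i x))

module _ (k m′ c d : ℕ) where
  private
    N = suc c + d
    c≤N : c ≤ N
    c≤N = ≤-trans (n≤1+n c) (s≤s (m≤m+n c d))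
    d≤N : d ≤ N
    d≤N = ≤-trans (m≤n+m d c) (n≤1+n (c + d))
    d≤c+d : d ≤ c + d
    d≤c+d = m≤n+m d c
    N∸i≡d : N ∸ suc c ≡ d
    N∸i≡d = m+n∸m≡n (suc c) d

  Z-part : ∑[ x < suc m′ ] ((m′ C x) * (∑Prefs x c (parksOn k N c) * ∑Prefs (m′ ∸ x) d (parksAvoiding0 k N d)))
           ≡ ∑[ x < suc m′ ] termZ (suc m′) N k (suc c) x
  Z-part = ∑<-cong (suc m′) (λ x _ → begin
    (m′ C x) * (∑Prefs x c (parksOn k N c) * ∑Prefs (m′ ∸ x) d (parksAvoiding0 k N d))
      ≡⟨ cong₂ (λ u v → (m′ C x) * (u * v)) (∑Prefs-parksOn≡numPF k N c x c≤N)
                                              (∑Prefs-parksAvoiding0≡numC k N (c + d) d (m′ ∸ x) d≤N d≤c+d) ⟩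
    (m′ C x) * (numPF x c k * numC (m′ ∸ x) d k (c + d))
      ≡⟨ *-assoc (m′ C x) _ _ ⟨
    (m′ C x) * numPF x c k * numC (m′ ∸ x) d k (c + d)
      ≡⟨ cong (λ z → (m′ C x) * numPF x c k * numC (m′ ∸ x) z k (c + d)) N∸i≡d ⟨
    termZ (suc m′) N k (suc c) x ∎)
    where open ≡-Reasoning

  private
    B : ℕ → ℕ
    B z = numC z d k (c + d)
    gapWeight : ℕ → ℕ
    gapWeight e = (c ∸ suc e) ∸ k
    lastGapSum : ℕ → ℕ → ℕ
    lastGapSum x e = ∑[ y < suc x ] ((x C y) * (numPF y e k * (𝟙 ((x ∸ y) ≡ᵇ (c ∸ suc e)) * numC (x ∸ y) (c ∸ suc e) k (c + d))))

  Y-sum : ∑[ x < suc m′ ] ((m′ C x) * ((c * (𝟙 (x ≡ᵇ c) * numPF x c k)) * B (m′ ∸ x))) ≡ termY (suc m′) N k (suc c)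
  Y-sum = begin
    ∑[ x < suc m′ ] ((m′ C x) * ((c * (𝟙 (x ≡ᵇ c) * numPF x c k)) * B (m′ ∸ x)))
      ≡⟨ ∑<-cong (suc m′) (λ x _ → reassoc (m′ C x) c (𝟙 (x ≡ᵇ c)) (numPF x c k) (B (m′ ∸ x))) ⟩
    ∑[ x < suc m′ ] ((m′ C x) * (𝟙 (x ≡ᵇ c) * (numPF x c k * B (m′ ∸ x) * c)))
      ≡⟨ ∑C-select m′ c (λ x → numPF x c k * B (m′ ∸ x) * c) ⟩
    (m′ C c) * (numPF c c k * B (m′ ∸ c) * c)
      ≡⟨ solve 4 (λ p a b c → p :* (a :* b :* c) := p :* a :* b :* c) refl (m′ C c) (numPF c c k) (B (m′ ∸ c)) c ⟩
    (m′ C c) * numPF c c k * numC (m′ ∸ c) d k (c + d) * c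
      ≡⟨ cong (λ z → (m′ C c) * numPF c c k * numC (m′ ∸ c) z k (c + d) * c) N∸i≡d ⟨
    termY (suc m′) N k (suc c) ∎
    where
    open ≡-Reasoning
    reassoc : ∀ p c i a b → p * ((c * (i * a)) * b) ≡ p * (i * (a * b * c))
    reassoc = solve 5 (λ p c i a b → p :* ((c :* (i :* a)) :* b) := p :* (i :* (a :* b :* c))) refl

  private
    blockSum : ℕ → ℕ → ℕ
    blockSum R e = ∑[ y < suc m′ ] ((m′ C y) * ((m′ ∸ y) C R) * numPF y e k * numC R R k (c + d) * B (m′ ∸ y ∸ R))

  W-sum-by-gap : ∑[ x < suc m′ ] ((m′ C x) * (∑[ e < c ] (gapWeight e * lastGapSum x e) * B (m′ ∸ x)))
                 ≡ ∑[ e < c ] (gapWeight e * blockSum (c ∸ suc e) e)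
  W-sum-by-gap = begin
    ∑[ x < suc m′ ] ((m′ C x) * (∑[ e < c ] (gapWeight e * lastGapSum x e) * B (m′ ∸ x)))
      ≡⟨ ∑<-cong (suc m′) (λ x _ → pull-in x) ⟩
    ∑[ x < suc m′ ] ∑[ e < c ] (gapWeight e * ((m′ C x) * (lastGapSum x e * B (m′ ∸ x))))
      ≡⟨ ∑<-comm (suc m′) c (λ x e → gapWeight e * ((m′ C x) * (lastGapSum x e * B (m′ ∸ x)))) ⟩
    ∑[ e < c ] ∑[ x < suc m′ ] (gapWeight e * ((m′ C x) * (lastGapSum x e * B (m′ ∸ x))))
      ≡⟨ ∑<-cong c (λ e _ → trans (*-distribˡ-∑< (suc m′) (gapWeight e) (λ x → (m′ C x) * (lastGapSum x e * B (m′ ∸ x))))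
                                      (cong (gapWeight e *_) (collapse e))) ⟩
    ∑[ e < c ] (gapWeight e * blockSum (c ∸ suc e) e) ∎
    where
    open ≡-Reasoning
    pull-in : ∀ x → (m′ C x) * (∑[ e < c ] (gapWeight e * lastGapSum x e) * B (m′ ∸ x))
                     ≡ ∑[ e < c ] (gapWeight e * ((m′ C x) * (lastGapSum x e * B (m′ ∸ x))))
    pull-in x = begin
      (m′ C x) * (∑[ e < c ] (gapWeight e * lastGapSum x e) * B (m′ ∸ x))
        ≡⟨ cong ((m′ C x) *_) (*-distribʳ-∑< c (B (m′ ∸ x)) (λ e → gapWeight e * lastGapSum x e)) ⟨
      (m′ C x) * ∑[ e < c ] (gapWeight e * lastGapSum x e * B (m′ ∸ x))
        ≡⟨ *-distribˡ-∑< c (m′ C x) (λ e → gapWeight e * lastGapSum x e * B (m′ ∸ x)) ⟨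
      ∑[ e < c ] ((m′ C x) * (gapWeight e * lastGapSum x e * B (m′ ∸ x)))
        ≡⟨ ∑<-cong c (λ e _ → solve 4 (λ p w s b → p :* (w :* s :* b) := w :* (p :* (s :* b))) refl
                                        (m′ C x) (gapWeight e) (lastGapSum x e) (B (m′ ∸ x))) ⟩
      ∑[ e < c ] (gapWeight e * ((m′ C x) * (lastGapSum x e * B (m′ ∸ x)))) ∎
    collapse : ∀ e → ∑[ x < suc m′ ] ((m′ C x) * (lastGapSum x e * B (m′ ∸ x))) ≡ blockSum (c ∸ suc e) e
    collapse e =
      trans (∑<-cong (suc m′) (λ x _ → cong (λ z → (m′ C x) * (z * B (m′ ∸ x)))
              (∑<-cong (suc x) (λ y _ → cong (λ z → (x C y) * (numPF y e k * z)) (𝟙-≡ᵇ-subst (x ∸ y) f (λ u → numC u f k (c + d)))))))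
            (∑C-∑C-collapse m′ f (λ y → numPF y e k) B (numC f f k (c + d)))
      where f = c ∸ suc e

  W-sum-reindex : ∑[ e < c ] (gapWeight e * blockSum (c ∸ suc e) e)
                  ≡ ∑[ x < suc m′ ] sumFromTo (k + 1) (c ∸ 1) (termW (suc m′) N k (suc c) x)
  W-sum-reindex = begin
    ∑[ e < c ] (gapWeight e * blockSum (c ∸ suc e) e)
      ≡⟨ ∑<-reverse c (λ e → gapWeight e * blockSum (c ∸ suc e) e) ⟩
    ∑[ R < c ] (gapWeight (c ∸ suc R) * blockSum (c ∸ suc (c ∸ suc R)) (c ∸ suc R))
      ≡⟨ ∑<-cong c (λ R R<c → cong (λ z → (z ∸ k) * blockSum z (c ∸ suc R)) (c∸[1+[c∸[1+R]]]≡R R<c)) ⟩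
    ∑[ R < c ] ((R ∸ k) * blockSum R (c ∸ suc R))
      ≡⟨ ∑<-drop c (suc k) (λ R → (R ∸ k) * blockSum R (c ∸ suc R)) (λ R R≤k → cong (_* blockSum R (c ∸ suc R)) (m≤n⇒m∸n≡0 (≤-pred R≤k))) ⟩
    ∑[ t < c ∸ suc k ] ((suc k + t ∸ k) * blockSum (suc k + t) (c ∸ suc (suc k + t)))
      ≡⟨ ∑<-cong (c ∸ suc k) (λ t _ → spread (suc k + t)) ⟩
    ∑[ t < c ∸ suc k ] ∑[ x < suc m′ ] termW (suc m′) N k (suc c) x (suc k + t)
      ≡⟨ ∑<-comm (c ∸ suc k) (suc m′) (λ t x → termW (suc m′) N k (suc c) x (suc k + t)) ⟩
    ∑[ x < suc m′ ] ∑[ t < c ∸ suc k ] termW (suc m′) N k (suc c) x (suc k + t)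
      ≡⟨ ∑<-cong (suc m′) (λ x _ → sym (trans (sumFromTo≡∑< (k + 1) (c ∸ 1) (termW (suc m′) N k (suc c) x))
                                           (cong₂ (λ n a → ∑[ t < n ] termW (suc m′) N k (suc c) x (a + t)) ([1+[c∸1]]∸[k+1]≡c∸[1+k] c k) (+-comm k 1)))) ⟩
    ∑[ x < suc m′ ] sumFromTo (k + 1) (c ∸ 1) (termW (suc m′) N k (suc c) x) ∎
    where
    open ≡-Reasoning
    spread : ∀ R → (R ∸ k) * blockSum R (c ∸ suc R) ≡ ∑[ x < suc m′ ] termW (suc m′) N k (suc c) x R
    spread R = trans (sym (*-distribˡ-∑< (suc m′) (R ∸ k) (λ y → (m′ C y) * ((m′ ∸ y) C R) * numPF y (c ∸ suc R) k * numC R R k (c + d) * B (m′ ∸ y ∸ R))))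
                     (∑<-cong (suc m′) (λ x _ → begin
      (R ∸ k) * ((m′ C x) * ((m′ ∸ x) C R) * numPF x (c ∸ suc R) k * numC R R k (c + d) * B (m′ ∸ x ∸ R))
        ≡⟨ solve 6 (λ r p q a n b → r :* (p :* q :* a :* n :* b) := p :* a :* q :* n :* b :* r) refl
                   (R ∸ k) (m′ C x) ((m′ ∸ x) C R) (numPF x (c ∸ suc R) k) (numC R R k (c + d)) (B (m′ ∸ x ∸ R)) ⟩
      (m′ C x) * numPF x (c ∸ suc R) k * ((m′ ∸ x) C R) * numC R R k (c + d) * numC (m′ ∸ x ∸ R) d k (c + d) * (R ∸ k)
        ≡⟨ cong₂ (λ u v → (m′ C x) * numPF x u k * ((m′ ∸ x) C R) * numC R R k (c + d) * numC (m′ ∸ x ∸ R) v k (c + d) * (R ∸ k))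
                 ([1+c]∸R∸2≡c∸[1+R] c R) N∸i≡d ⟨
      termW (suc m′) N k (suc c) x R ∎))

  YW-part : ∑[ x < suc m′ ] ((m′ C x) * (∑Prefs x c (failuresAfter k N c) * ∑Prefs (m′ ∸ x) d (parksAvoiding0 k N d)))
            ≡ termY (suc m′) N k (suc c) + ∑[ x < suc m′ ] sumFromTo (k + 1) (c ∸ 1) (termW (suc m′) N k (suc c) x)
  YW-part = begin
    ∑[ x < suc m′ ] ((m′ C x) * (∑Prefs x c (failuresAfter k N c) * ∑Prefs (m′ ∸ x) d (parksAvoiding0 k N d)))
      ≡⟨ ∑<-cong (suc m′) (λ x _ → per-size x) ⟩
    ∑[ x < suc m′ ] (Yx x + Wx x)
      ≡⟨ ∑<-distrib-+ (suc m′) Yx Wx ⟩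
    ∑< (suc m′) Yx + ∑< (suc m′) Wx
      ≡⟨ cong₂ _+_ Y-sum (trans W-sum-by-gap W-sum-reindex) ⟩
    termY (suc m′) N k (suc c) + ∑[ x < suc m′ ] sumFromTo (k + 1) (c ∸ 1) (termW (suc m′) N k (suc c) x) ∎
    where
    open ≡-Reasoning
    Yx Wx : ℕ → ℕ
    Yx x = (m′ C x) * ((c * (𝟙 (x ≡ᵇ c) * numPF x c k)) * B (m′ ∸ x))
    Wx x = (m′ C x) * (∑[ e < c ] (gapWeight e * lastGapSum x e) * B (m′ ∸ x))
    per-size : ∀ x → (m′ C x) * (∑Prefs x c (failuresAfter k N c) * ∑Prefs (m′ ∸ x) d (parksAvoiding0 k N d)) ≡ Yx x + Wx x
    per-size x = begin
      (m′ C x) * (∑Prefs x c (failuresAfter k N c) * ∑Prefs (m′ ∸ x) d (parksAvoiding0 k N d))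
        ≡⟨ cong₂ (λ u v → (m′ C x) * (u * v)) (∑Prefs-failuresAfter k N c x c≤N)
                                                (∑Prefs-parksAvoiding0≡numC k N (c + d) d (m′ ∸ x) d≤N d≤c+d) ⟩
      (m′ C x) * ((c * ∑Prefs x c (leftFullAfter k N c) + ∑[ e < c ] (gapWeight e * ∑Prefs x c (lastGapAfter k N c e))) * B (m′ ∸ x))
        ≡⟨ cong₂ (λ u v → (m′ C x) * ((c * u + v) * B (m′ ∸ x)))
                 (∑Prefs-leftFullAfter k N c x c≤N)
                 (∑<-cong c (λ e e<c → cong (gapWeight e *_) (∑Prefs-lastGapAfter k N (c + d) c e x e<c c≤N (m≤m+n c d)))) ⟩
      (m′ C x) * ((c * (𝟙 (x ≡ᵇ c) * numPF x c k) + ∑[ e < c ] (gapWeight e * lastGapSum x e)) * B (m′ ∸ x))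
        ≡⟨ solve 4 (λ p a b q → p :* ((a :+ b) :* q) := p :* (a :* q) :+ p :* (b :* q)) refl
                   (m′ C x) (c * (𝟙 (x ≡ᵇ c) * numPF x c k)) (∑[ e < c ] (gapWeight e * lastGapSum x e)) (B (m′ ∸ x)) ⟩
      Yx x + Wx x ∎

  private
    firstGapSum : ℕ → ℕ → ℕ
    firstGapSum y e = ∑[ r < suc y ] ((y C r) * ((𝟙 (r ≡ᵇ e) * numC r e k (c + d)) * numC (y ∸ r) (d ∸ suc e) k (c + d)))

  firstGapSum-select : ∀ y e → firstGapSum y e ≡ (y C e) * (numC e e k (c + d) * numC (y ∸ e) (d ∸ suc e) k (c + d))
  firstGapSum-select y e =
    trans (∑<-cong (suc y) (λ r _ → solve 4 (λ p i a b → p :* ((i :* a) :* b) := p :* (i :* (a :* b))) refl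
                                            (y C r) (𝟙 (r ≡ᵇ e)) (numC r e k (c + d)) (numC (y ∸ r) (d ∸ suc e) k (c + d))))
          (∑C-select y e (λ r → numC r e k (c + d) * numC (y ∸ r) (d ∸ suc e) k (c + d)))

  X-sum : ∑[ x < suc m′ ] ((m′ C x) * (numPF x c k * ((d ⊓ k) * (𝟙 ((m′ ∸ x) ≡ᵇ d) * numC (m′ ∸ x) d k (c + d)))))
          ≡ termX (suc m′) N k (suc c)
  X-sum = begin
    ∑[ x < suc m′ ] ((m′ C x) * (numPF x c k * ((d ⊓ k) * (𝟙 ((m′ ∸ x) ≡ᵇ d) * numC (m′ ∸ x) d k (c + d)))))
      ≡⟨ ∑<-cong (suc m′) (λ x _ → cong (λ z → (m′ C x) * (numPF x c k * ((d ⊓ k) * z)))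
                                         (𝟙-≡ᵇ-subst (m′ ∸ x) d (λ u → numC u d k (c + d)))) ⟩
    ∑[ x < suc m′ ] ((m′ C x) * (numPF x c k * ((d ⊓ k) * (𝟙 ((m′ ∸ x) ≡ᵇ d) * numC d d k (c + d)))))
      ≡⟨ ∑<-cong (suc m′) (λ x _ → solve 5 (λ p a w i n → p :* (a :* (w :* (i :* n))) := p :* (i :* (a :* w :* n))) refl
                                          (m′ C x) (numPF x c k) (d ⊓ k) (𝟙 ((m′ ∸ x) ≡ᵇ d)) (numC d d k (c + d))) ⟩
    ∑[ x < suc m′ ] ((m′ C x) * (𝟙 ((m′ ∸ x) ≡ᵇ d) * (numPF x c k * (d ⊓ k) * numC d d k (c + d))))
      ≡⟨ ∑C-select-complement m′ d (λ x → numPF x c k * (d ⊓ k) * numC d d k (c + d)) ⟩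
    (m′ C d) * (numPF (m′ ∸ d) c k * (d ⊓ k) * numC d d k (c + d))
      ≡⟨ solve 4 (λ p a w n → p :* (a :* w :* n) := p :* a :* n :* w) refl (m′ C d) (numPF (m′ ∸ d) c k) (d ⊓ k) (numC d d k (c + d)) ⟩
    (m′ C d) * numPF (m′ ∸ d) c k * numC d d k (c + d) * (d ⊓ k)
      ≡⟨ cong₂ (λ u v → (m′ C d) * numPF u c k * numC d d k (c + d) * v) (sym ([1+m+[1+c]]∸1∸[1+c+d]≡m∸d m′ c d)) (⊓-comm d k) ⟩
    (m′ C d) * numPF (suc m′ + suc c ∸ 1 ∸ N) c k * numC d d k (c + d) * (k ⊓ d)
      ≡⟨ cong (λ z → (m′ C z) * numPF (suc m′ + suc c ∸ 1 ∸ N) c k * numC z z k (c + d) * (k ⊓ z)) N∸i≡d ⟨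
    termX (suc m′) N k (suc c) ∎
    where open ≡-Reasoning

  V-sum : ∑[ x < suc m′ ] ((m′ C x) * (numPF x c k * ∑[ e < d ] ((e ⊓ k) * firstGapSum (m′ ∸ x) e)))
          ≡ ∑[ x < suc m′ ] sumFromTo 1 (N ∸ suc c ∸ 1) (termV (suc m′) N k (suc c) x)
  V-sum = ∑<-cong (suc m′) (λ x _ → begin
    (m′ C x) * (numPF x c k * ∑[ e < d ] ((e ⊓ k) * firstGapSum (m′ ∸ x) e))
      ≡⟨ cong (λ z → (m′ C x) * (numPF x c k * z)) (∑<-cong d (λ e _ → cong ((e ⊓ k) *_) (firstGapSum-select (m′ ∸ x) e))) ⟩
    (m′ C x) * (numPF x c k * ∑[ e < d ] ((e ⊓ k) * (((m′ ∸ x) C e) * (numC e e k (c + d) * numC (m′ ∸ x ∸ e) (d ∸ suc e) k (c + d)))))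
      ≡⟨ pull-in x ⟩
    ∑[ e < d ] term x e
      ≡⟨ ∑<-drop d 1 (term x) (λ { zero _ → *-zeroʳ (term-without-weight x 0) ; (suc _) (s≤s ()) }) ⟩
    ∑[ t < d ∸ 1 ] term x (suc t)
      ≡⟨ ∑<-cong (d ∸ 1) (λ t t<d∸1 → cong (λ z → (m′ C x) * numPF x c k * ((m′ ∸ x) C suc t) * numC (suc t) (suc t) k (c + d)
                                                  * numC (m′ ∸ x ∸ suc t) z k (c + d) * (suc t ⊓ k))
                                            (sym ([1+c+d]∸R∸[1+c]∸1≡d∸[1+R] c d (suc t) (≤-trans t<d∸1 (m∸n≤m d 1))))) ⟩
    ∑[ t < d ∸ 1 ] termV (suc m′) N k (suc c) x (suc t)
      ≡⟨ cong (λ z → ∑[ t < z ∸ 1 ] termV (suc m′) N k (suc c) x (suc t)) N∸i≡d ⟨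
    ∑[ t < N ∸ suc c ∸ 1 ] termV (suc m′) N k (suc c) x (suc t)
      ≡⟨ sumFromTo≡∑< 1 (N ∸ suc c ∸ 1) (termV (suc m′) N k (suc c) x) ⟨
    sumFromTo 1 (N ∸ suc c ∸ 1) (termV (suc m′) N k (suc c) x) ∎)
    where
    open ≡-Reasoning
    term-without-weight term : ℕ → ℕ → ℕ
    term-without-weight x e = (m′ C x) * numPF x c k * ((m′ ∸ x) C e) * numC e e k (c + d) * numC (m′ ∸ x ∸ e) (d ∸ suc e) k (c + d)
    term x e = term-without-weight x e * (e ⊓ k)
    pull-in : ∀ x → (m′ C x) * (numPF x c k * ∑[ e < d ] ((e ⊓ k) * (((m′ ∸ x) C e) * (numC e e k (c + d) * numC (m′ ∸ x ∸ e) (d ∸ suc e) k (c + d)))))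
                    ≡ ∑[ e < d ] term x e
    pull-in x = begin
      (m′ C x) * (numPF x c k * ∑< d inner)           ≡⟨ cong ((m′ C x) *_) (*-distribˡ-∑< d (numPF x c k) inner) ⟨
      (m′ C x) * ∑[ e < d ] (numPF x c k * inner e)  ≡⟨ *-distribˡ-∑< d (m′ C x) (λ e → numPF x c k * inner e) ⟨
      ∑[ e < d ] ((m′ C x) * (numPF x c k * inner e))
        ≡⟨ ∑<-cong d (λ e _ → solve 6 (λ p a w q n₁ n₂ → p :* (a :* (w :* (q :* (n₁ :* n₂)))) := p :* a :* q :* n₁ :* n₂ :* w) refl
                                      (m′ C x) (numPF x c k) (e ⊓ k) ((m′ ∸ x) C e) (numC e e k (c + d)) (numC (m′ ∸ x ∸ e) (d ∸ suc e) k (c + d))) ⟩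
      ∑[ e < d ] term x e ∎
      where
      inner : ℕ → ℕ
      inner e = (e ⊓ k) * (((m′ ∸ x) C e) * (numC e e k (c + d) * numC (m′ ∸ x ∸ e) (d ∸ suc e) k (c + d)))

  XV-part : ∑[ x < suc m′ ] ((m′ C x) * (∑Prefs x c (parksOn k N c) * ∑Prefs (m′ ∸ x) d (into0After k N d)))
            ≡ termX (suc m′) N k (suc c) + ∑[ x < suc m′ ] sumFromTo 1 (N ∸ suc c ∸ 1) (termV (suc m′) N k (suc c) x)
  XV-part = begin
    ∑[ x < suc m′ ] ((m′ C x) * (∑Prefs x c (parksOn k N c) * ∑Prefs (m′ ∸ x) d (into0After k N d)))
      ≡⟨ ∑<-cong (suc m′) (λ x _ → per-size x) ⟩
    ∑[ x < suc m′ ] (Xx x + Vx x)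
      ≡⟨ ∑<-distrib-+ (suc m′) Xx Vx ⟩
    ∑< (suc m′) Xx + ∑< (suc m′) Vx
      ≡⟨ cong₂ _+_ X-sum V-sum ⟩
    termX (suc m′) N k (suc c) + ∑[ x < suc m′ ] sumFromTo 1 (N ∸ suc c ∸ 1) (termV (suc m′) N k (suc c) x) ∎
    where
    open ≡-Reasoning
    Xx Vx : ℕ → ℕ
    Xx x = (m′ C x) * (numPF x c k * ((d ⊓ k) * (𝟙 ((m′ ∸ x) ≡ᵇ d) * numC (m′ ∸ x) d k (c + d))))
    Vx x = (m′ C x) * (numPF x c k * ∑[ e < d ] ((e ⊓ k) * firstGapSum (m′ ∸ x) e))
    per-size : ∀ x → (m′ C x) * (∑Prefs x c (parksOn k N c) * ∑Prefs (m′ ∸ x) d (into0After k N d)) ≡ Xx x + Vx x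
    per-size x = begin
      (m′ C x) * (∑Prefs x c (parksOn k N c) * ∑Prefs (m′ ∸ x) d (into0After k N d))
        ≡⟨ cong₂ (λ u v → (m′ C x) * (u * v)) (∑Prefs-parksOn≡numPF k N c x c≤N) (∑Prefs-into0After k N d (m′ ∸ x)) ⟩
      (m′ C x) * (numPF x c k * ((d ⊓ k) * ∑Prefs (m′ ∸ x) d (rightFullAfter k N d)
                                + ∑[ e < d ] ((e ⊓ k) * ∑Prefs (m′ ∸ x) d (firstGapAfter k N d e))))
        ≡⟨ cong₂ (λ u v → (m′ C x) * (numPF x c k * ((d ⊓ k) * u + v)))
                 (∑Prefs-rightFullAfter k N (c + d) d (m′ ∸ x) d≤N d≤c+d)
                 (∑<-cong d (λ e e<d → cong ((e ⊓ k) *_) (∑Prefs-firstGapAfter k N (c + d) d e (m′ ∸ x) e<d d≤N d≤c+d))) ⟩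
      (m′ C x) * (numPF x c k * ((d ⊓ k) * (𝟙 ((m′ ∸ x) ≡ᵇ d) * numC (m′ ∸ x) d k (c + d)) + ∑[ e < d ] ((e ⊓ k) * firstGapSum (m′ ∸ x) e)))
        ≡⟨ solve 4 (λ p a u v → p :* (a :* (u :+ v)) := p :* (a :* u) :+ p :* (a :* v)) refl
                   (m′ C x) (numPF x c k) ((d ⊓ k) * (𝟙 ((m′ ∸ x) ≡ᵇ d) * numC (m′ ∸ x) d k (c + d))) (∑[ e < d ] ((e ⊓ k) * firstGapSum (m′ ∸ x) e)) ⟩
      Xx x + Vx x ∎

  ∑Prefs-#landing≡spotTerm : ∑Prefs m′ N (λ α → #landing k N N (suc c) (runPark 1 N k N [] α)) ≡ spotTerm (suc m′) N k (suc c)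
  ∑Prefs-#landing≡spotTerm = begin
    ∑Prefs m′ N (λ α → #landing k N N (suc c) (runPark 1 N k N [] α))
      ≡⟨ ∑Prefs-#landing k m′ c d ⟩
    ∑[ x < suc m′ ] ((m′ C x) * (∑Prefs x c (parksOn k N c) * ∑Prefs (m′ ∸ x) d (parksAvoiding0 k N d)))
      + ∑[ x < suc m′ ] ((m′ C x) * (∑Prefs x c (failuresAfter k N c) * ∑Prefs (m′ ∸ x) d (parksAvoiding0 k N d)))
      + ∑[ x < suc m′ ] ((m′ C x) * (∑Prefs x c (parksOn k N c) * ∑Prefs (m′ ∸ x) d (into0After k N d)))
      ≡⟨ cong₂ _+_ (cong₂ _+_ Z-part YW-part) XV-part ⟩
    ∑< (suc m′) Z + (Y + ∑< (suc m′) W) + (X + ∑< (suc m′) V)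
      ≡⟨ solve 5 (λ z y w x v → z :+ (y :+ w) :+ (x :+ v) := x :+ y :+ (z :+ v :+ w)) refl
                 (∑< (suc m′) Z) Y (∑< (suc m′) W) X (∑< (suc m′) V) ⟩
    X + Y + (∑< (suc m′) Z + ∑< (suc m′) V + ∑< (suc m′) W)
      ≡⟨ cong (X + Y +_) (cong (_+ ∑< (suc m′) W) (∑<-distrib-+ (suc m′) Z V)) ⟨
    X + Y + (∑[ x < suc m′ ] (Z x + V x) + ∑< (suc m′) W)
      ≡⟨ cong (X + Y +_) (∑<-distrib-+ (suc m′) (λ x → Z x + V x) W) ⟨
    X + Y + ∑[ x < suc m′ ] (Z x + V x + W x)
      ≡⟨ cong (X + Y +_) (sumFromTo≡∑< 0 m′ (λ x → Z x + V x + W x)) ⟨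
    spotTerm (suc m′) N k (suc c) ∎
    where
    open ≡-Reasoning
    X = termX (suc m′) N k (suc c)
    Y = termY (suc m′) N k (suc c)
    Z V W : ℕ → ℕ
    Z x = termZ (suc m′) N k (suc c) x
    V x = sumFromTo 1 (N ∸ suc c ∸ 1) (termV (suc m′) N k (suc c) x)
    W x = sumFromTo (k + 1) (c ∸ 1) (termW (suc m′) N k (suc c) x)

corollary3p15 : (m n k : ℕ) → 1 ≤ m → m ≤ n → k < n →
    numPF m n k ≡
      sumFromTo 1 n (λ i →
        ((m ∸ 1) C (n ∸ i)) * numPF (m + i ∸ 1 ∸ n) (i ∸ 1) k * numC (n ∸ i) (n ∸ i) k (n ∸ 1) * (k ⊓ (n ∸ i))
        + ((m ∸ 1) C (i ∸ 1)) * numPF (i ∸ 1) (i ∸ 1) k * numC (m ∸ i) (n ∸ i) k (n ∸ 1) * (i ∸ 1)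
        + sumFromTo 0 (m ∸ 1) (λ x →
            ((m ∸ 1) C x) * numPF x (i ∸ 1) k * numC (m ∸ 1 ∸ x) (n ∸ i) k (n ∸ 1)
            + sumFromTo 1 (n ∸ i ∸ 1) (λ R →
                ((m ∸ 1) C x) * numPF x (i ∸ 1) k * ((m ∸ 1 ∸ x) C R) * numC R R k (n ∸ 1)
                  * numC (m ∸ 1 ∸ x ∸ R) (n ∸ R ∸ i ∸ 1) k (n ∸ 1) * (R ⊓ k))
            + sumFromTo (k + 1) (i ∸ 2) (λ R →
                ((m ∸ 1) C x) * numPF x (i ∸ R ∸ 2) k * ((m ∸ 1 ∸ x) C R) * numC R R k (n ∸ 1)
                  * numC (m ∸ 1 ∸ x ∸ R) (n ∸ i) k (n ∸ 1) * (R ∸ k))))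
corollary3p15 (suc m′) n k _ _ _ = begin
  numPF (suc m′) n k
    ≡⟨ numPF≡∑-#landing k m′ n ⟩
  ∑[ t < n ] ∑Prefs m′ n (λ α → #landing k n n (suc t) (runPark 1 n k n [] α))
    ≡⟨ ∑<-cong n (λ t t<n → subst (λ N → ∑Prefs m′ N (λ α → #landing k N N (suc t) (runPark 1 N k N [] α)) ≡ spotTerm (suc m′) N k (suc t))
                                  (m+[n∸m]≡n t<n) (∑Prefs-#landing≡spotTerm k m′ t (n ∸ suc t))) ⟩
  ∑[ t < n ] spotTerm (suc m′) n k (suc t)
    ≡⟨ sumFromTo≡∑< 1 n (spotTerm (suc m′) n k) ⟨
  sumFromTo 1 n (spotTerm (suc m′) n k) ∎
  where open ≡-Reasoning
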